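{- (i) For every $\Sigma^b_0$-formula $F$ of $\mathcal{RL}$, $\vdash_{\mathcal{I}\mathcal{POR}^\lambda}F\vee\neg F$. (ii) For every closed $\Sigma^b_0$-formula $F$ of $\mathcal{RL}$ and every $\eta\in\mathbb{O}$, either $T_\eta\vdash_{\mathcal{I}\mathcal{POR}^\lambda}F$ or $T_\eta\vdash_{\mathcal{I}\mathcal{POR}^\lambda}\neg F$.
   Context: $\mathbb{S}=\{\mathbb{0},\mathbb{1}\}^*$, $\mathbb{O}$ the set of functions $\eta:\mathbb{S}\to\{\mathbb{0},\mathbb{1}\}$. $\mathcal{RL}$: terms $t::=x\mid\epsilon\mid\mathtt{0}\mid\mathtt{1}\mid t\frown t\mid t\times t$; formulas built from $\mathtt{Flip}(t)$, $t=s$, $t\subseteq s$ with $\neg,\wedge,\vee,\to,\exists,\forall$. $\mathtt{1}^t:=\mathtt{1}\times t$; subword quantifiers $(\exists x\subseteq^*t)F:=\exists x\exists w(w\subseteq t\wedge wx\subseteq t\wedge F)$, $(\forall x\subseteq^*t)F:=\forall x(\exists w(w\subseteq t\wedge wx\subseteq t)\to F)$. $\Sigma^b_0$-formulas: smallest class containing atomic formulas, closed under Boolean connectives and subword quantifiers. $\mathcal{POR}^\lambda$: simply typed $\lambda$-calculus with base type $s$ and constants $\mathsf{0},\mathsf{1},\epsilon:s$; $\circ$ (concatenation, written $xy$); $\mathsf{Tail}$; $\mathsf{Trunc}$; $\mathsf{Cond}$; $\mathsf{Flipcoin}:s\Rightarrow s$; $\mathsf{Rec}$, with equational axioms ($\mathsf{b}\in\{\mathsf{0},\mathsf{1}\}$):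 $\epsilon x=x\epsilon=x$; $x(y\mathsf{b})=(xy)\mathsf{b}$; $\mathsf{Tail}(\epsilon)=\epsilon$, $\mathsf{Tail}(x\mathsf{b})=x$; $\mathsf{Trunc}(x,\epsilon)=\mathsf{Trunc}(\epsilon,x)=\epsilon$, $\mathsf{Trunc}(x\mathsf{b},y\mathsf{0})=\mathsf{Trunc}(x\mathsf{b},y\mathsf{1})=\mathsf{Trunc}(x,y)\mathsf{b}$; $\mathsf{Cond}(\epsilon,y,z,w)=y$, $\mathsf{Cond}(x\mathsf{0},y,z,w)=z$, $\mathsf{Cond}(x\mathsf{1},y,z,w)=w$; $\mathsf{Bool}(\mathsf{Flipcoin}(x))=\mathsf{1}$; $\mathsf{Rec}(x,h_0,h_1,k,\epsilon)=x$, $\mathsf{Rec}(x,h_0,h_1,k,y\mathsf{b})=\mathsf{Trunc}(h_b\,y\,(\mathsf{Rec}(x,h_0,h_1,k,y)),k\,y)$; $\beta$- and $\eta$-axioms in contexts. Here $\mathsf{B}(x):=\mathsf{Cond}(x,\epsilon,\mathsf{0},\mathsf{1})$, $\mathsf{BNeg}(x):=\mathsf{Cond}(x,\epsilon,\mathsf{1},\mathsf{0})$, $\mathsf{BOr}(x,y):=\mathsf{Cond}(\mathsf{B}(x),\mathsf{B}(y),\mathsf{B}(y),\mathsf{1})$, $\mathsf{BAnd}(x,y):=\mathsf{Cond}(\mathsf{B}(x),\epsilon,\mathsf{0},\mathsf{B}(y))$, $\mathsf{Eps}(x):=\mathsf{Cond}(x,\mathsf{1},\mathsf{0},\mathsf{0})$,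 $\mathsf{Bool}(x):=\mathsf{BAnd}(\mathsf{Eps}(\mathsf{Tail}(x)),\mathsf{BNeg}(\mathsf{Eps}(x)))$; $\mathsf{Conc},\mathsf{Eq},\mathsf{Times},\mathsf{Sub}$ are the $\mathsf{Rec}$-defined terms with $\mathsf{Conc}(x,\epsilon)=x$, $\mathsf{Conc}(x,y\mathsf{b})=\mathsf{Conc}(x,y)\mathsf{b}$; $\mathsf{Eq}(\epsilon,\epsilon)=\mathsf{1}$, $\mathsf{Eq}(\epsilon,y\mathsf{b})=\mathsf{Eq}(x\mathsf{b},\epsilon)=\mathsf{Eq}(x\mathsf{0},y\mathsf{1})=\mathsf{Eq}(x\mathsf{1},y\mathsf{0})=\mathsf{0}$, $\mathsf{Eq}(x\mathsf{b},y\mathsf{b})=\mathsf{Eq}(x,y)$; $\mathsf{Times}(x,\epsilon)=\epsilon$, $\mathsf{Times}(x,y\mathsf{b})=\mathsf{Conc}(\mathsf{Times}(x,y),x)$; $\mathsf{Sub}(x,\epsilon)=\mathsf{Eps}(x)$, $\mathsf{Sub}(x,y\mathsf{b})=\mathsf{BOr}(\mathsf{Sub}(x,y),\mathsf{Eq}(x,y\mathsf{b}))$. $\mathcal{I}\mathcal{POR}^\lambda$: first-order intuitionistic theory with equality over $\mathcal{POR}^\lambda$-terms, formulas built from $t=u$, $t\subseteq u$, $\mathtt{Flip}(t)$ with $\wedge,\vee,\to,\forall,\exists$ ($\bot:=\mathsf{0}=\mathsf{1}$, $\neg F:=F\to\bot$); axioms: those of $\mathcal{POR}^\lambda$; $x\subseteq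 y\leftrightarrow\mathsf{Sub}(x,y)=\mathsf{1}$; $x=\epsilon\vee x=\mathsf{Tail}(x)\mathsf{0}\vee x=\mathsf{Tail}(x)\mathsf{1}$; $\mathsf{0}=\mathsf{1}\to x=\epsilon$; $\mathsf{Cond}(x,y,z,w)=w'\leftrightarrow(x=\epsilon\wedge w'=y)\vee(x=\mathsf{Tail}(x)\mathsf{0}\wedge w'=z)\vee(x=\mathsf{Tail}(x)\mathsf{1}\wedge w'=w)$; $\mathtt{Flip}(x)\leftrightarrow\mathsf{Flipcoin}(x)=\mathsf{1}$; NP-induction $(F(\epsilon)\wedge\forall x(F(x)\to F(x\mathsf{0}))\wedge\forall x(F(x)\to F(x\mathsf{1})))\to\forall yF(y)$ for $F$ of the form $(\exists z\preceq t)u=v$ (where $(\exists z\preceq t)G:=\exists z(\mathsf{Times}(\mathsf{1},z)\subseteq\mathsf{Times}(\mathsf{1},t)\wedge G)$) with $t$ containing only first-order open variables. $\mathcal{RL}$-formulas are read in $\mathcal{I}\mathcal{POR}^\lambda$ replacing $\mathtt{0},\mathtt{1},\frown,\times$ by $\mathsf{0},\mathsf{1},\circ,\mathsf{Times}$. For $\sigma\in\mathbb{S}$, the numeral $\overline{\overline{\sigma}}$ is $\epsilon$ followed by the digits of $\sigma$; $T_\eta$ is the set of equations $\mathsf{Flipcoin}(\overline{\overline{\sigma}})=\overline{\overline{\eta(\sigma)}}$ for $\sigma\in\mathbb{S}$, and $T_\eta\vdash_{\mathcal{I}\mathcal{POR}^\lambda}F$ means $F$ is derivable in $\mathcal{I}\mathcal{POR}^\lambda$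 using additionally the equations of $T_\eta$ as axioms. -}

module Defs where

open import Data.Nat using (ℕ; zero; suc)
open import Data.Fin using (Fin; zero; suc)
open import Data.Bool using (Bool; true; false)
open import Data.List using (List; []; _∷_; map; foldl)
open import Data.List.Membership.Propositional using (_∈_)
open import Data.Product using (Σ; _×_)
open import Data.Empty using (⊥)
open import Relation.Binary.PropositionalEquality using (_≡_)

-- POR^λ : simply typed λ-calculus over the base type s (written ι)

infixr 7 _⇒_
data Ty : Set where
  ι   : Ty
  _⇒_ : Ty → Ty → Ty

Ctx : Set
Ctx = List Ty

infix 4 _∋_
data _∋_ : Ctx → Ty → Set where
  here  : ∀ {Γ A} → (A ∷ Γ) ∋ A
  there : ∀ {Γ A B} → Γ ∋ A → (B ∷ Γ) ∋ A

-- constants.  Conc, Eq, Times, Sub are taken as constants governed by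
-- their (recursion) equations.
data Const : Ty → Set where
  c0 c1 cε                  : Const ι
  cCat cTrunc               : Const (ι ⇒ ι ⇒ ι)
  cTail cFlipcoin           : Const (ι ⇒ ι)
  cCond                     : Const (ι ⇒ ι ⇒ ι ⇒ ι ⇒ ι)
  cRec                      : Const (ι ⇒ (ι ⇒ ι ⇒ ι) ⇒ (ι ⇒ ι ⇒ ι) ⇒ (ι ⇒ ι) ⇒ ι ⇒ ι)
  cConc cEq cTimes cSub     : Const (ι ⇒ ι ⇒ ι)

infixl 9 _·_
data Tm (Γ : Ctx) : Ty → Set where
  var : ∀ {A} → Γ ∋ A → Tm Γ A
  con : ∀ {A} → Const A → Tm Γ A
  lam : ∀ {A B} → Tm (A ∷ Γ) B → Tm Γ (A ⇒ B)
  _·_ : ∀ {A B} → Tm Γ (A ⇒ B) → Tm Γ A → Tm Γ B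

Ren : Ctx → Ctx → Set
Ren Γ Δ = ∀ {A} → Γ ∋ A → Δ ∋ A

extR : ∀ {Γ Δ B} → Ren Γ Δ → Ren (B ∷ Γ) (B ∷ Δ)
extR ρ here      = here
extR ρ (there x) = there (ρ x)

rename : ∀ {Γ Δ A} → Ren Γ Δ → Tm Γ A → Tm Δ A
rename ρ (var x) = var (ρ x)
rename ρ (con c) = con c
rename ρ (lam t) = lam (rename (extR ρ) t)
rename ρ (t · u) = rename ρ t · rename ρ u

Subst : Ctx → Ctx → Set
Subst Γ Δ = ∀ {A} → Γ ∋ A → Tm Δ A

extS : ∀ {Γ Δ B} → Subst Γ Δ → Subst (B ∷ Γ) (B ∷ Δ)
extS σ here      = var here
extS σ (there x) = rename there (σ x)

subst : ∀ {Γ Δ A} → Subst Γ Δ → Tm Γ A → Tm Δ A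
subst σ (var x) = σ x
subst σ (con c) = con c
subst σ (lam t) = lam (subst (extS σ) t)
subst σ (t · u) = subst σ t · subst σ u

σ₀ : ∀ {Γ B} → Tm Γ B → Subst (B ∷ Γ) Γ
σ₀ u here      = u
σ₀ u (there x) = var x

_[_] : ∀ {Γ A B} → Tm (B ∷ Γ) A → Tm Γ B → Tm Γ A
t [ u ] = subst (σ₀ u) t

module _ {Γ : Ctx} where
  `0 `1 `ε : Tm Γ ι
  `0 = con c0
  `1 = con c1
  `ε = con cε

  _∘_ : Tm Γ ι → Tm Γ ι → Tm Γ ι
  x ∘ y = con cCat · x · y

  Tail Flipcoin : Tm Γ ι → Tm Γ ι
  Tail x     = con cTail · x
  Flipcoin x = con cFlipcoin · x

  Trunc Conc Eq Times Sub : Tm Γ ι → Tm Γ ι → Tm Γ ι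
  Trunc x y = con cTrunc · x · y
  Conc x y  = con cConc · x · y
  Eq x y    = con cEq · x · y
  Times x y = con cTimes · x · y
  Sub x y   = con cSub · x · y

  Cond : Tm Γ ι → Tm Γ ι → Tm Γ ι → Tm Γ ι → Tm Γ ι
  Cond x y z w = con cCond · x · y · z · w

  Rec : Tm Γ ι → Tm Γ (ι ⇒ ι ⇒ ι) → Tm Γ (ι ⇒ ι ⇒ ι) → Tm Γ (ι ⇒ ι) → Tm Γ ι → Tm Γ ι
  Rec x h₀ h₁ k y = con cRec · x · h₀ · h₁ · k · y

  bit : Bool → Tm Γ ι
  bit false = `0
  bit true  = `1

  B BNeg Eps BoolT : Tm Γ ι → Tm Γ ι
  B x    = Cond x `ε `0 `1
  BNeg x = Cond x `ε `1 `0
  Eps x  = Cond x `1 `0 `0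

  BOr BAnd : Tm Γ ι → Tm Γ ι → Tm Γ ι
  BOr x y  = Cond (B x) (B y) (B y) `1
  BAnd x y = Cond (B x) `ε `0 (B y)

  BoolT x = BAnd (Eps (Tail x)) (BNeg (Eps x))

  numeral : List Bool → Tm Γ ι
  numeral σ = foldl (λ t b → t ∘ bit b) `ε σ

selB : ∀ {X : Set} → Bool → X → X → X
selB false a b = a
selB true  a b = b

infix 4 _≈_
data _≈_ {Γ : Ctx} : ∀ {A} → Tm Γ A → Tm Γ A → Set where
  ≈refl  : ∀ {A} {t : Tm Γ A} → t ≈ t
  ≈sym   : ∀ {A} {t u : Tm Γ A} → t ≈ u → u ≈ t
  ≈trans : ∀ {A} {t u v : Tm Γ A} → t ≈ u → u ≈ v → t ≈ v
  ≈app   : ∀ {A C} {t t' : Tm Γ (A ⇒ C)} {u u' : Tm Γ A} → t ≈ t' → u ≈ u' → t · u ≈ t' · u'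
  ≈lam   : ∀ {A C} {t t' : Tm (A ∷ Γ) C} → _≈_ {A ∷ Γ} t t' → lam t ≈ lam t'
  ≈β     : ∀ {A C} (t : Tm (A ∷ Γ) C) (u : Tm Γ A) → lam t · u ≈ t [ u ]
  ≈η     : ∀ {A C} (t : Tm Γ (A ⇒ C)) → lam (rename there t · var here) ≈ t
  catεl  : ∀ x → `ε ∘ x ≈ x
  catεr  : ∀ x → x ∘ `ε ≈ x
  catb   : ∀ x y b → x ∘ (y ∘ bit b) ≈ (x ∘ y) ∘ bit b
  tailε  : Tail `ε ≈ `ε
  tailb  : ∀ x b → Tail (x ∘ bit b) ≈ x
  truncεr : ∀ x → Trunc x `ε ≈ `ε
  truncεl : ∀ x → Trunc `ε x ≈ `ε
  truncb  : ∀ x y b c → Trunc (x ∘ bit b) (y ∘ bit c) ≈ Trunc x y ∘ bit b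
  condε  : ∀ y z w → Cond `ε y z w ≈ y
  cond0  : ∀ x y z w → Cond (x ∘ `0) y z w ≈ z
  cond1  : ∀ x y z w → Cond (x ∘ `1) y z w ≈ w
  flipBool : ∀ x → BoolT (Flipcoin x) ≈ `1
  recε   : ∀ x h₀ h₁ k → Rec x h₀ h₁ k `ε ≈ x
  recb   : ∀ x h₀ h₁ k y b →
           Rec x h₀ h₁ k (y ∘ bit b) ≈ Trunc (selB b h₀ h₁ · y · Rec x h₀ h₁ k y) (k · y)
  concε  : ∀ x → Conc x `ε ≈ x
  concb  : ∀ x y b → Conc x (y ∘ bit b) ≈ Conc x y ∘ bit b
  eqεε   : Eq `ε `ε ≈ `1
  eqεb   : ∀ y b → Eq `ε (y ∘ bit b) ≈ `0
  eqbε   : ∀ x b → Eq (x ∘ bit b) `ε ≈ `0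
  eq01   : ∀ x y → Eq (x ∘ `0) (y ∘ `1) ≈ `0
  eq10   : ∀ x y → Eq (x ∘ `1) (y ∘ `0) ≈ `0
  eqbb   : ∀ x y b → Eq (x ∘ bit b) (y ∘ bit b) ≈ Eq x y
  timesε : ∀ x → Times x `ε ≈ `ε
  timesb : ∀ x y b → Times x (y ∘ bit b) ≈ Conc (Times x y) x
  subε   : ∀ x → Sub x `ε ≈ Eps x
  subb   : ∀ x y b → Sub x (y ∘ bit b) ≈ BOr (Sub x y) (Eq x (y ∘ bit b))

-- Formulas of IPOR^λ (free variables are first-order, of type s)

fctx : ℕ → Ctx
fctx zero    = []
fctx (suc n) = ι ∷ fctx n

FTm : ℕ → Set
FTm n = Tm (fctx n) ι

infix 6 _≐_ _⊑_
infixr 5 _∧ᶠ_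
infixr 4 _∨ᶠ_
infixr 3 _⊃_ _⇔ᶠ_
data Fm (n : ℕ) : Set where
  _≐_ _⊑_ : FTm n → FTm n → Fm n
  Flip    : FTm n → Fm n
  _∧ᶠ_ _∨ᶠ_ _⊃_ : Fm n → Fm n → Fm n
  ∀ᶠ ∃ᶠ   : Fm (suc n) → Fm n

substF : ∀ {n m} → Subst (fctx n) (fctx m) → Fm n → Fm m
substF σ (t ≐ u)  = subst σ t ≐ subst σ u
substF σ (t ⊑ u)  = subst σ t ⊑ subst σ u
substF σ (Flip t) = Flip (subst σ t)
substF σ (A ∧ᶠ C) = substF σ A ∧ᶠ substF σ C
substF σ (A ∨ᶠ C) = substF σ A ∨ᶠ substF σ C
substF σ (A ⊃ C)  = substF σ A ⊃ substF σ C
substF σ (∀ᶠ A)   = ∀ᶠ (substF (extS σ) A)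
substF σ (∃ᶠ A)   = ∃ᶠ (substF (extS σ) A)

wkF : ∀ {n} → Fm n → Fm (suc n)
wkF = substF (λ x → var (there x))

instF : ∀ {n} → Fm (suc n) → FTm n → Fm n
instF A t = substF (σ₀ t) A

σ₁ : ∀ {n} → FTm (suc n) → Subst (fctx (suc n)) (fctx (suc n))
σ₁ t here      = t
σ₁ t (there x) = var (there x)

⊥ᶠ : ∀ {n} → Fm n
⊥ᶠ = `0 ≐ `1

¬ᶠ : ∀ {n} → Fm n → Fm n
¬ᶠ A = A ⊃ ⊥ᶠ

_⇔ᶠ_ : ∀ {n} → Fm n → Fm n → Fm n
A ⇔ᶠ C = (A ⊃ C) ∧ᶠ (C ⊃ A)

-- (∃ z ⪯ t) u = v, with t not depending on z (z is variable 0)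
NPForm : ∀ {n} → FTm n → FTm (suc n) → FTm (suc n) → Fm n
NPForm t u v = ∃ᶠ ((Times `1 (var here) ⊑ Times `1 (rename there t)) ∧ᶠ (u ≐ v))

-- non-logical axioms of IPOR^λ (other than the equations, see `conv`)
data Ax {n : ℕ} : Fm n → Set where
  axSub   : ∀ (x y : FTm n) → Ax ((x ⊑ y) ⇔ᶠ (Sub x y ≐ `1))
  axCases : ∀ (x : FTm n) → Ax ((x ≐ `ε) ∨ᶠ (x ≐ Tail x ∘ `0) ∨ᶠ (x ≐ Tail x ∘ `1))
  axBot   : ∀ (x : FTm n) → Ax (⊥ᶠ ⊃ (x ≐ `ε))
  axCond  : ∀ (x y z w w' : FTm n) →
            Ax ((Cond x y z w ≐ w') ⇔ᶠ
                (((x ≐ `ε) ∧ᶠ (w' ≐ y))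
                 ∨ᶠ ((x ≐ Tail x ∘ `0) ∧ᶠ (w' ≐ z))
                 ∨ᶠ ((x ≐ Tail x ∘ `1) ∧ᶠ (w' ≐ w))))
  axFlip  : ∀ (x : FTm n) → Ax (Flip x ⇔ᶠ (Flipcoin x ≐ `1))
  -- NP-induction for F(y) := (∃ z ⪯ t) u = v, y being variable 0 of F
  axInd   : ∀ (t : FTm (suc n)) (u v : FTm (suc (suc n))) →
            let F = NPForm t u v in
            Ax ((instF F `ε
                 ∧ᶠ ∀ᶠ (F ⊃ substF (σ₁ (var here ∘ `0)) F)
                 ∧ᶠ ∀ᶠ (F ⊃ substF (σ₁ (var here ∘ `1)) F))
                ⊃ ∀ᶠ F)

Ext : Set₁
Ext = ∀ {n} → Fm n → Set

noExt : Ext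
noExt _ = ⊥

Tη : (List Bool → Bool) → Ext
Tη η {n} A = Σ (List Bool) λ σ → A ≡ (Flipcoin (numeral σ) ≐ numeral (η σ ∷ []))

infix 2 Der
data Der (E : Ext) {n : ℕ} (Γ : List (Fm n)) : Fm n → Set where
  hyp   : ∀ {A} → A ∈ Γ → Der E Γ A
  ax    : ∀ {A} → Ax A → Der E Γ A
  ext   : ∀ {A} → E A → Der E Γ A
  conv  : ∀ {t u : FTm n} → t ≈ u → Der E Γ (t ≐ u)
  leib  : ∀ (A : Fm (suc n)) {t u} → Der E Γ (t ≐ u) → Der E Γ (instF A t) → Der E Γ (instF A u)
  ∧I    : ∀ {A C} → Der E Γ A → Der E Γ C → Der E Γ (A ∧ᶠ C)
  ∧E₁   : ∀ {A C} → Der E Γ (A ∧ᶠ C) → Der E Γ A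
  ∧E₂   : ∀ {A C} → Der E Γ (A ∧ᶠ C) → Der E Γ C
  ∨I₁   : ∀ {A C} → Der E Γ A → Der E Γ (A ∨ᶠ C)
  ∨I₂   : ∀ {A C} → Der E Γ C → Der E Γ (A ∨ᶠ C)
  ∨E    : ∀ {A C D} → Der E Γ (A ∨ᶠ C) → Der E (A ∷ Γ) D → Der E (C ∷ Γ) D → Der E Γ D
  ⊃I    : ∀ {A C} → Der E (A ∷ Γ) C → Der E Γ (A ⊃ C)
  ⊃E    : ∀ {A C} → Der E Γ (A ⊃ C) → Der E Γ A → Der E Γ C
  ∀I    : ∀ {A} → Der E (map wkF Γ) A → Der E Γ (∀ᶠ A)
  ∀E    : ∀ {A} → Der E Γ (∀ᶠ A) → (t : FTm n) → Der E Γ (instF A t)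
  ∃I    : ∀ {A} (t : FTm n) → Der E Γ (instF A t) → Der E Γ (∃ᶠ A)
  ∃E    : ∀ {A C} → Der E Γ (∃ᶠ A) → Der E (A ∷ map wkF Γ) (wkF C) → Der E Γ C

syntax Der E Γ A = E ∣ Γ ⊢ A

-- The language RL

infixl 8 _⌢_
infixl 9 _×ʳ_
data RTm (n : ℕ) : Set where
  rv     : Fin n → RTm n
  rε r0 r1 : RTm n
  _⌢_ _×ʳ_ : RTm n → RTm n → RTm n

infix 6 _=ʳ_ _⊆ʳ_
infixr 5 _∧ʳ_
infixr 4 _∨ʳ_
infixr 3 _→ʳ_
data RFm (n : ℕ) : Set where
  rFlip   : RTm n → RFm n
  _=ʳ_ _⊆ʳ_ : RTm n → RTm n → RFm n
  ¬ʳ      : RFm n → RFm n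
  _∧ʳ_ _∨ʳ_ _→ʳ_ : RFm n → RFm n → RFm n
  ∃ʳ ∀ʳ   : RFm (suc n) → RFm n

liftR : ∀ {n m} → (Fin n → Fin m) → Fin (suc n) → Fin (suc m)
liftR ρ zero    = zero
liftR ρ (suc i) = suc (ρ i)

renRT : ∀ {n m} → (Fin n → Fin m) → RTm n → RTm m
renRT ρ (rv i)   = rv (ρ i)
renRT ρ rε       = rε
renRT ρ r0       = r0
renRT ρ r1       = r1
renRT ρ (t ⌢ u)  = renRT ρ t ⌢ renRT ρ u
renRT ρ (t ×ʳ u) = renRT ρ t ×ʳ renRT ρ u

renRF : ∀ {n m} → (Fin n → Fin m) → RFm n → RFm m
renRF ρ (rFlip t) = rFlip (renRT ρ t)
renRF ρ (t =ʳ u)  = renRT ρ t =ʳ renRT ρ u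
renRF ρ (t ⊆ʳ u)  = renRT ρ t ⊆ʳ renRT ρ u
renRF ρ (¬ʳ A)    = ¬ʳ (renRF ρ A)
renRF ρ (A ∧ʳ C)  = renRF ρ A ∧ʳ renRF ρ C
renRF ρ (A ∨ʳ C)  = renRF ρ A ∨ʳ renRF ρ C
renRF ρ (A →ʳ C)  = renRF ρ A →ʳ renRF ρ C
renRF ρ (∃ʳ A)    = ∃ʳ (renRF (liftR ρ) A)
renRF ρ (∀ʳ A)    = ∀ʳ (renRF (liftR ρ) A)

-- inside ∃x∃w : w is variable 0, x is variable 1
skipW : ∀ {n} → Fin (suc n) → Fin (suc (suc n))
skipW zero    = suc zero
skipW (suc i) = suc (suc i)

bExists : ∀ {n} → RTm n → RFm (suc n) → RFm n
bExists t F =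
  ∃ʳ (∃ʳ ((rv zero ⊆ʳ t') ∧ʳ ((rv zero ⌢ rv (suc zero) ⊆ʳ t') ∧ʳ renRF skipW F)))
  where t' = renRT (λ i → suc (suc i)) t

bForall : ∀ {n} → RTm n → RFm (suc n) → RFm n
bForall t F =
  ∀ʳ (∃ʳ ((rv zero ⊆ʳ t') ∧ʳ (rv zero ⌢ rv (suc zero) ⊆ʳ t')) →ʳ F)
  where t' = renRT (λ i → suc (suc i)) t

data Σb₀ : ∀ {n} → RFm n → Set where
  sFlip : ∀ {n} (t : RTm n) → Σb₀ (rFlip t)
  sEq   : ∀ {n} (t u : RTm n) → Σb₀ (t =ʳ u)
  sSub  : ∀ {n} (t u : RTm n) → Σb₀ (t ⊆ʳ u)
  sNeg  : ∀ {n} {A : RFm n} → Σb₀ A → Σb₀ (¬ʳ A)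
  sAnd  : ∀ {n} {A C : RFm n} → Σb₀ A → Σb₀ C → Σb₀ (A ∧ʳ C)
  sOr   : ∀ {n} {A C : RFm n} → Σb₀ A → Σb₀ C → Σb₀ (A ∨ʳ C)
  sImp  : ∀ {n} {A C : RFm n} → Σb₀ A → Σb₀ C → Σb₀ (A →ʳ C)
  sBEx  : ∀ {n} (t : RTm n) {F : RFm (suc n)} → Σb₀ F → Σb₀ (bExists t F)
  sBAll : ∀ {n} (t : RTm n) {F : RFm (suc n)} → Σb₀ F → Σb₀ (bForall t F)

finVar : ∀ {n} → Fin n → fctx n ∋ ι
finVar {suc n} zero    = here
finVar {suc n} (suc i) = there (finVar i)

trT : ∀ {n} → RTm n → FTm n
trT (rv i)   = var (finVar i)
trT rε       = `ε
trT r0       = `0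
trT r1       = `1
trT (t ⌢ u)  = trT t ∘ trT u
trT (t ×ʳ u) = Times (trT t) (trT u)

trF : ∀ {n} → RFm n → Fm n
trF (rFlip t) = Flip (trT t)
trF (t =ʳ u)  = trT t ≐ trT u
trF (t ⊆ʳ u)  = trT t ⊑ trT u
trF (¬ʳ A)    = ¬ᶠ (trF A)
trF (A ∧ʳ C)  = trF A ∧ᶠ trF C
trF (A ∨ʳ C)  = trF A ∨ᶠ trF C
trF (A →ʳ C)  = trF A ⊃ trF C
trF (∃ʳ A)    = ∃ᶠ (trF A)
trF (∀ʳ A)    = ∀ᶠ (trF A)

{-# OPTIONS --safe #-}
-- Every Σᵇ₀ formula F gets a characteristic term χ_F for which IPOR^λ proves χ_F = 0 ∨ χ_F = 1,
-- χ_F = 1 → F and F → χ_F = 1; then F ∨ ¬F is immediate. Connectives become Cond-combinations of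
-- the characteristic terms of their parts. A bounded quantifier (∃x ⊆* t) becomes two nested
-- searches by recursion: the subwords of t are the suffixes of its prefixes v, and the suffix of v
-- of length |k| is Trunc(v, 1^|k|), for k ranging over the prefixes of 1^|v|.
--
-- Induction is only available for formulas (∃z ⪯ t) u = v, so every invariant is phrased as one
-- equation between Cond-terms. The hardest instance is soundness of the equality test,
-- Eq(x, y) = 1 → x = y: instead of a simultaneous recursion on x and y, a single recursion on
-- k = xy strips one digit at a time off the ends of both x and y and keeps the stripped suffixes
-- equal.
--
-- For (ii), a logical relation shows that under T_η every closed term provably equals the numeral
-- of its value. Hence χ_F provably equals a numeral, which is either 1 or refutably different from 1.
module Submission where

open import Defs
open import Data.Nat using (ℕ; zero; suc)
open import Data.Fin using (Fin; zero; suc)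
open import Data.Bool using (Bool; true; false)
open import Data.Bool.Properties using (_≟_)
open import Data.Empty using (⊥-elim)
open import Data.List using (List; []; _∷_; map; reverse; _++_)
open import Data.List.Properties using (foldl-∷ʳ; unfold-reverse; ≡-dec)
open import Data.List.Relation.Unary.Any using (here; there)
open import Data.List.Relation.Binary.Subset.Propositional using (_⊆_)
open import Data.List.Relation.Binary.Subset.Propositional.Properties using (∷⁺ʳ; map⁺; xs⊆x∷xs)
open import Data.Product using (_×_; _,_)
open import Data.Sum using (_⊎_; inj₁; inj₂)
open import Relation.Nullary using (yes; no)
open import Relation.Binary.PropositionalEquality as ≡ using (_≡_; _≢_; refl; cong; cong₂; sym; trans)

private variable
  E : Ext
  n m l : ℕ
  Ψ : Ctx
  Γ : List (Fm n)
  A C : Fm n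

cong₃ : ∀ {a b c d} {A : Set a} {B : Set b} {C : Set c} {D : Set d} (f : A → B → C → D) {x y u v s t} →
        x ≡ y → u ≡ v → s ≡ t → f x u s ≡ f y v t
cong₃ f refl refl refl = refl

infix 4 _≗ʳ_ _≗ˢ_
_≗ʳ_ : ∀ {Γ Δ} → Ren Γ Δ → Ren Γ Δ → Set
_≗ʳ_ {Γ} ρ ρ′ = ∀ {A} (x : Γ ∋ A) → ρ x ≡ ρ′ x

_≗ˢ_ : ∀ {Γ Δ} → Subst Γ Δ → Subst Γ Δ → Set
_≗ˢ_ {Γ} σ τ = ∀ {A} (x : Γ ∋ A) → σ x ≡ τ x

infixl 5 _,,_
_,,_ : ∀ {Γ Δ B} → Subst Γ Δ → Tm Δ B → Subst (B ∷ Γ) Δ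
(σ ,, u) here      = u
(σ ,, u) (there x) = σ x

↑ˢ : ∀ {Γ B} → Subst Γ (B ∷ Γ)
↑ˢ x = var (there x)

wk : ∀ {Γ B A} → Tm Γ A → Tm (B ∷ Γ) A
wk = subst ↑ˢ

infixr 9 _∘ˢ_
_∘ˢ_ : ∀ {Γ Δ Θ} → Subst Δ Θ → Subst Γ Δ → Subst Γ Θ
(τ ∘ˢ σ) x = subst τ (σ x)

wkˢ : ∀ {Γ Δ B} → Subst Γ Δ → Subst Γ (B ∷ Δ)
wkˢ σ = ↑ˢ ∘ˢ σ

,,-cong : ∀ {Γ Δ B} {σ τ : Subst Γ Δ} {u v : Tm Δ B} → σ ≗ˢ τ → u ≡ v → (σ ,, u) ≗ˢ (τ ,, v)
,,-cong e refl here      = refl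
,,-cong e refl (there x) = e x

∘ˢ-,, : ∀ {Γ Δ Θ B} (τ : Subst Δ Θ) (σ : Subst Γ Δ) (u : Tm Δ B) → τ ∘ˢ (σ ,, u) ≗ˢ (τ ∘ˢ σ ,, subst τ u)
∘ˢ-,, τ σ u here      = refl
∘ˢ-,, τ σ u (there x) = refl

extR-cong : ∀ {Γ Δ B} {ρ ρ′ : Ren Γ Δ} → ρ ≗ʳ ρ′ → extR {B = B} ρ ≗ʳ extR ρ′
extR-cong e here      = refl
extR-cong e (there x) = cong there (e x)

rename-cong : ∀ {Γ Δ A} {ρ ρ′ : Ren Γ Δ} → ρ ≗ʳ ρ′ → (t : Tm Γ A) → rename ρ t ≡ rename ρ′ t
rename-cong e (var x) = cong var (e x)
rename-cong e (con c) = refl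
rename-cong e (lam t) = cong lam (rename-cong (extR-cong e) t)
rename-cong e (t · u) = cong₂ _·_ (rename-cong e t) (rename-cong e u)

extS-cong : ∀ {Γ Δ B} {σ τ : Subst Γ Δ} → σ ≗ˢ τ → extS {B = B} σ ≗ˢ extS τ
extS-cong e here      = refl
extS-cong e (there x) = cong (rename there) (e x)

subst-cong : ∀ {Γ Δ A} {σ τ : Subst Γ Δ} → σ ≗ˢ τ → (t : Tm Γ A) → subst σ t ≡ subst τ t
subst-cong e (var x) = e x
subst-cong e (con c) = refl
subst-cong e (lam t) = cong lam (subst-cong (extS-cong e) t)
subst-cong e (t · u) = cong₂ _·_ (subst-cong e t) (subst-cong e u)

rename-rename : ∀ {Γ Δ Θ A} (ρ : Ren Δ Θ) (ρ′ : Ren Γ Δ) (t : Tm Γ A) →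
                rename ρ (rename ρ′ t) ≡ rename (λ x → ρ (ρ′ x)) t
rename-rename ρ ρ′ (var x) = refl
rename-rename ρ ρ′ (con c) = refl
rename-rename ρ ρ′ (lam t) =
  cong lam (trans (rename-rename (extR ρ) (extR ρ′) t) (rename-cong (λ { here → refl ; (there x) → refl }) t))
rename-rename ρ ρ′ (t · u) = cong₂ _·_ (rename-rename ρ ρ′ t) (rename-rename ρ ρ′ u)

subst-rename : ∀ {Γ Δ Θ A} (σ : Subst Δ Θ) (ρ : Ren Γ Δ) (t : Tm Γ A) →
               subst σ (rename ρ t) ≡ subst (λ x → σ (ρ x)) t
subst-rename σ ρ (var x) = refl
subst-rename σ ρ (con c) = refl
subst-rename σ ρ (lam t) =
  cong lam (trans (subst-rename (extS σ) (extR ρ) t) (subst-cong (λ { here → refl ; (there x) → refl }) t))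
subst-rename σ ρ (t · u) = cong₂ _·_ (subst-rename σ ρ t) (subst-rename σ ρ u)

rename-subst : ∀ {Γ Δ Θ A} (ρ : Ren Δ Θ) (σ : Subst Γ Δ) (t : Tm Γ A) →
               rename ρ (subst σ t) ≡ subst (λ x → rename ρ (σ x)) t
rename-subst ρ σ (var x) = refl
rename-subst ρ σ (con c) = refl
rename-subst ρ σ (lam t) = cong lam (trans (rename-subst (extR ρ) (extS σ) t) (subst-cong ext-comm t))
  where
  ext-comm : (λ {A} x → rename (extR ρ) (extS σ {A} x)) ≗ˢ extS (λ x → rename ρ (σ x))
  ext-comm here      = refl
  ext-comm (there x) = trans (rename-rename (extR ρ) there (σ x)) (sym (rename-rename there ρ (σ x)))
rename-subst ρ σ (t · u) = cong₂ _·_ (rename-subst ρ σ t) (rename-subst ρ σ u)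

subst-extS-rename : ∀ {Γ Δ A B} (σ : Subst Γ Δ) (t : Tm Γ A) →
                    subst (extS {B = B} σ) (rename there t) ≡ rename there (subst σ t)
subst-extS-rename σ t = trans (subst-rename (extS σ) there t) (sym (rename-subst there σ t))

extS-∘ˢ : ∀ {Γ Δ Θ B} (σ : Subst Δ Θ) (τ : Subst Γ Δ) → extS {B = B} σ ∘ˢ extS τ ≗ˢ extS (σ ∘ˢ τ)
extS-∘ˢ σ τ here      = refl
extS-∘ˢ σ τ (there x) = subst-extS-rename σ (τ x)

subst-subst : ∀ {Γ Δ Θ A} (σ : Subst Δ Θ) (τ : Subst Γ Δ) (t : Tm Γ A) → subst σ (subst τ t) ≡ subst (σ ∘ˢ τ) t
subst-subst σ τ (var x) = refl
subst-subst σ τ (con c) = refl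
subst-subst σ τ (lam t) = cong lam (trans (subst-subst (extS σ) (extS τ) t) (subst-cong (extS-∘ˢ σ τ) t))
subst-subst σ τ (t · u) = cong₂ _·_ (subst-subst σ τ t) (subst-subst σ τ u)

subst-id : ∀ {Γ A} {σ : Subst Γ Γ} → σ ≗ˢ var → (t : Tm Γ A) → subst σ t ≡ t
subst-id e (var x) = e x
subst-id e (con c) = refl
subst-id e (lam t) = cong lam (subst-id (λ { here → refl ; (there x) → cong (rename there) (e x) }) t)
subst-id e (t · u) = cong₂ _·_ (subst-id e t) (subst-id e u)

rename-as-subst : ∀ {Γ Δ A} (ρ : Ren Γ Δ) (t : Tm Γ A) → rename ρ t ≡ subst (λ x → var (ρ x)) t
rename-as-subst ρ (var x) = refl
rename-as-subst ρ (con c) = refl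
rename-as-subst ρ (lam t) =
  cong lam (trans (rename-as-subst (extR ρ) t) (subst-cong (λ { here → refl ; (there x) → refl }) t))
rename-as-subst ρ (t · u) = cong₂ _·_ (rename-as-subst ρ t) (rename-as-subst ρ u)

wk≡rename : ∀ {Γ B A} (t : Tm Γ A) → wk {B = B} t ≡ rename there t
wk≡rename t = sym (rename-as-subst there t)

subst-extS-wk : ∀ {Γ Δ A B} (σ : Subst Γ Δ) (t : Tm Γ A) → subst (extS {B = B} σ) (wk t) ≡ wk (subst σ t)
subst-extS-wk σ t =
  trans (cong (subst (extS σ)) (wk≡rename t)) (trans (subst-extS-rename σ t) (sym (wk≡rename (subst σ t))))

[]-rename : ∀ {Γ A B} (t : Tm Γ A) (u : Tm Γ B) → rename there t [ u ] ≡ t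
[]-rename t u = trans (subst-rename (σ₀ u) there t) (subst-id (λ x → refl) t)

[]-wk : ∀ {Γ A B} (t : Tm Γ A) (u : Tm Γ B) → wk t [ u ] ≡ t
[]-wk t u = trans (subst-subst (σ₀ u) ↑ˢ t) (subst-id (λ x → refl) t)

[]-extS : ∀ {Γ Δ A B} (σ : Subst Γ Δ) (t : Tm (B ∷ Γ) A) (u : Tm Δ B) → subst (extS σ) t [ u ] ≡ subst (σ ,, u) t
[]-extS σ t u = trans (subst-subst (σ₀ u) (extS σ) t) (subst-cong σ₀-extS t)
  where
  σ₀-extS : σ₀ u ∘ˢ extS σ ≗ˢ (σ ,, u)
  σ₀-extS here      = refl
  σ₀-extS (there x) = []-rename (σ x) u

substF-cong : ∀ {n m} {σ τ : Subst (fctx n) (fctx m)} → σ ≗ˢ τ → (A : Fm n) → substF σ A ≡ substF τ A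
substF-cong e (t ≐ u)  = cong₂ _≐_ (subst-cong e t) (subst-cong e u)
substF-cong e (t ⊑ u)  = cong₂ _⊑_ (subst-cong e t) (subst-cong e u)
substF-cong e (Flip t) = cong Flip (subst-cong e t)
substF-cong e (A ∧ᶠ C) = cong₂ _∧ᶠ_ (substF-cong e A) (substF-cong e C)
substF-cong e (A ∨ᶠ C) = cong₂ _∨ᶠ_ (substF-cong e A) (substF-cong e C)
substF-cong e (A ⊃ C)  = cong₂ _⊃_ (substF-cong e A) (substF-cong e C)
substF-cong e (∀ᶠ A)   = cong ∀ᶠ (substF-cong (extS-cong e) A)
substF-cong e (∃ᶠ A)   = cong ∃ᶠ (substF-cong (extS-cong e) A)

substF-substF : ∀ {n m l} (σ : Subst (fctx m) (fctx l)) (τ : Subst (fctx n) (fctx m)) (A : Fm n) →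
                substF σ (substF τ A) ≡ substF (σ ∘ˢ τ) A
substF-substF σ τ (t ≐ u)  = cong₂ _≐_ (subst-subst σ τ t) (subst-subst σ τ u)
substF-substF σ τ (t ⊑ u)  = cong₂ _⊑_ (subst-subst σ τ t) (subst-subst σ τ u)
substF-substF σ τ (Flip t) = cong Flip (subst-subst σ τ t)
substF-substF σ τ (A ∧ᶠ C) = cong₂ _∧ᶠ_ (substF-substF σ τ A) (substF-substF σ τ C)
substF-substF σ τ (A ∨ᶠ C) = cong₂ _∨ᶠ_ (substF-substF σ τ A) (substF-substF σ τ C)
substF-substF σ τ (A ⊃ C)  = cong₂ _⊃_ (substF-substF σ τ A) (substF-substF σ τ C)
substF-substF σ τ (∀ᶠ A)   = cong ∀ᶠ (trans (substF-substF (extS σ) (extS τ) A) (substF-cong (extS-∘ˢ σ τ) A))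
substF-substF σ τ (∃ᶠ A)   = cong ∃ᶠ (trans (substF-substF (extS σ) (extS τ) A) (substF-cong (extS-∘ˢ σ τ) A))

substF-id : ∀ {n} {σ : Subst (fctx n) (fctx n)} → σ ≗ˢ var → (A : Fm n) → substF σ A ≡ A
substF-id e (t ≐ u)  = cong₂ _≐_ (subst-id e t) (subst-id e u)
substF-id e (t ⊑ u)  = cong₂ _⊑_ (subst-id e t) (subst-id e u)
substF-id e (Flip t) = cong Flip (subst-id e t)
substF-id e (A ∧ᶠ C) = cong₂ _∧ᶠ_ (substF-id e A) (substF-id e C)
substF-id e (A ∨ᶠ C) = cong₂ _∨ᶠ_ (substF-id e A) (substF-id e C)
substF-id e (A ⊃ C)  = cong₂ _⊃_ (substF-id e A) (substF-id e C)
substF-id e (∀ᶠ A)   = cong ∀ᶠ (substF-id (λ { here → refl ; (there x) → cong (rename there) (e x) }) A)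
substF-id e (∃ᶠ A)   = cong ∃ᶠ (substF-id (λ { here → refl ; (there x) → cong (rename there) (e x) }) A)

wk²ˢ : ∀ {n} → Subst (fctx n) (fctx (suc (suc n)))
wk²ˢ x = var (there (there x))

wk-wk : ∀ {A} (t : Tm (fctx n) A) → wk (wk t) ≡ subst wk²ˢ t
wk-wk t = subst-subst _ _ t

wkF-wkF : (A : Fm n) → wkF (wkF A) ≡ substF wk²ˢ A
wkF-wkF A = substF-substF _ _ A

subst-bit : ∀ {Γ Δ} (σ : Subst Γ Δ) (b : Bool) → subst σ (bit b) ≡ bit b
subst-bit σ false = refl
subst-bit σ true  = refl

weaken-⊆ : ∀ {Γ Δ : List (Fm n)} → Γ ⊆ Δ → E ∣ Γ ⊢ A → E ∣ Δ ⊢ A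
weaken-⊆ f (hyp p)      = hyp (f p)
weaken-⊆ f (ax a)       = ax a
weaken-⊆ f (ext e)      = ext e
weaken-⊆ f (conv c)     = conv c
weaken-⊆ f (leib A d e) = leib A (weaken-⊆ f d) (weaken-⊆ f e)
weaken-⊆ f (∧I d e)     = ∧I (weaken-⊆ f d) (weaken-⊆ f e)
weaken-⊆ f (∧E₁ d)      = ∧E₁ (weaken-⊆ f d)
weaken-⊆ f (∧E₂ d)      = ∧E₂ (weaken-⊆ f d)
weaken-⊆ f (∨I₁ d)      = ∨I₁ (weaken-⊆ f d)
weaken-⊆ f (∨I₂ d)      = ∨I₂ (weaken-⊆ f d)
weaken-⊆ f (∨E d e e′)  = ∨E (weaken-⊆ f d) (weaken-⊆ (∷⁺ʳ _ f) e) (weaken-⊆ (∷⁺ʳ _ f) e′)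
weaken-⊆ f (⊃I d)       = ⊃I (weaken-⊆ (∷⁺ʳ _ f) d)
weaken-⊆ f (⊃E d e)     = ⊃E (weaken-⊆ f d) (weaken-⊆ f e)
weaken-⊆ f (∀I d)       = ∀I (weaken-⊆ (map⁺ wkF f) d)
weaken-⊆ f (∀E d t)     = ∀E (weaken-⊆ f d) t
weaken-⊆ f (∃I t d)     = ∃I t (weaken-⊆ f d)
weaken-⊆ f (∃E d e)     = ∃E (weaken-⊆ f d) (weaken-⊆ (∷⁺ʳ _ (map⁺ wkF f)) e)

weaken : E ∣ Γ ⊢ A → E ∣ C ∷ Γ ⊢ A
weaken = weaken-⊆ (xs⊆x∷xs _ _)

hyp₀ : ∀ {B} → E ∣ B ∷ Γ ⊢ B
hyp₀ = hyp (here refl)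

hyp₁ : ∀ {B D} → E ∣ D ∷ B ∷ Γ ⊢ B
hyp₁ = hyp (there (here refl))

hyp₂ : ∀ {B D F} → E ∣ F ∷ D ∷ B ∷ Γ ⊢ B
hyp₂ = hyp (there (there (here refl)))

hyp₃ : ∀ {B D F G} → E ∣ G ∷ F ∷ D ∷ B ∷ Γ ⊢ B
hyp₃ = hyp (there (there (there (here refl))))

cast : A ≡ C → E ∣ Γ ⊢ A → E ∣ Γ ⊢ C
cast = ≡.subst (Der _ _)

-- Plugging a term into a frame is definitional, unlike substituting into a term that contains
-- rename there, so rewriting under frames needs no casts.
infixl 9 _$_
data Frame (n : ℕ) : Ty → Set where
  ●   : Frame n ι
  ⌜_⌝ : ∀ {A} → Tm (fctx n) A → Frame n A
  _$_ : ∀ {A B} → Frame n (A ⇒ B) → Frame n A → Frame n B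

plug : ∀ {A} → Frame n A → FTm n → Tm (fctx n) A
plug ●       a = a
plug ⌜ t ⌝   a = t
plug (f $ x) a = plug f a · plug x a

frameTm : ∀ {A} → Frame n A → Tm (fctx (suc n)) A
frameTm ●       = var here
frameTm ⌜ t ⌝   = rename there t
frameTm (f $ x) = frameTm f · frameTm x

frameTm-[] : ∀ {A} (C : Frame n A) (a : FTm n) → frameTm C [ a ] ≡ plug C a
frameTm-[] ●       a = refl
frameTm-[] ⌜ t ⌝   a = []-rename t a
frameTm-[] (f $ x) a = cong₂ _·_ (frameTm-[] f a) (frameTm-[] x a)

≡⇒≈ : ∀ {Γ A} {t u : Tm Γ A} → t ≡ u → t ≈ u
≡⇒≈ refl = ≈refl

≐-refl : ∀ {t : FTm n} → E ∣ Γ ⊢ t ≐ t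
≐-refl = conv ≈refl

≡⇒≐ : ∀ {t u : FTm n} → t ≡ u → E ∣ Γ ⊢ t ≐ u
≡⇒≐ refl = ≐-refl

leib-frame : ∀ {a b : FTm n} (C D : Frame n ι) →
             E ∣ Γ ⊢ a ≐ b → E ∣ Γ ⊢ plug C a ≐ plug D a → E ∣ Γ ⊢ plug C b ≐ plug D b
leib-frame {a = a} {b} C D e d =
  cast (cong₂ _≐_ (frameTm-[] C b) (frameTm-[] D b))
    (leib (frameTm C ≐ frameTm D) e (cast (sym (cong₂ _≐_ (frameTm-[] C a) (frameTm-[] D a))) d))

≐-sym : ∀ {a b : FTm n} → E ∣ Γ ⊢ a ≐ b → E ∣ Γ ⊢ b ≐ a
≐-sym {a = a} e = leib-frame ● ⌜ a ⌝ e ≐-refl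

≐-trans : ∀ {a b c : FTm n} → E ∣ Γ ⊢ a ≐ b → E ∣ Γ ⊢ b ≐ c → E ∣ Γ ⊢ a ≐ c
≐-trans {a = a} d e = leib-frame ⌜ a ⌝ ● e d

≐-cong : ∀ {a b : FTm n} (C : Frame n ι) → E ∣ Γ ⊢ a ≐ b → E ∣ Γ ⊢ plug C a ≐ plug C b
≐-cong {a = a} C e = leib-frame ⌜ plug C a ⌝ C e ≐-refl

≐-cong-[] : ∀ (c : Tm (ι ∷ fctx n) ι) {a b : FTm n} → E ∣ Γ ⊢ a ≐ b → E ∣ Γ ⊢ c [ a ] ≐ c [ b ]
≐-cong-[] c {a} {b} e = ≐-trans (conv (≈sym (≈β c a))) (≐-trans (≐-cong (⌜ lam c ⌝ $ ●) e) (conv (≈β c b)))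

infixr 2 _≐⟨_⟩_ _≈⟨_⟩_
infix 3 _∎
_≐⟨_⟩_ : ∀ (a : FTm n) {b c : FTm n} → E ∣ Γ ⊢ a ≐ b → E ∣ Γ ⊢ b ≐ c → E ∣ Γ ⊢ a ≐ c
a ≐⟨ p ⟩ q = ≐-trans p q

_≈⟨_⟩_ : ∀ (a : FTm n) {b c : FTm n} → a ≈ b → E ∣ Γ ⊢ b ≐ c → E ∣ Γ ⊢ a ≐ c
a ≈⟨ p ⟩ q = ≐-trans (conv p) q

_∎ : ∀ (a : FTm n) → E ∣ Γ ⊢ a ≐ a
a ∎ = ≐-refl

infixl 8 _∘ᴴ_
_∘ᴴ_ : Frame n ι → Frame n ι → Frame n ι
a ∘ᴴ b = ⌜ con cCat ⌝ $ a $ b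

Tailᴴ : Frame n ι → Frame n ι
Tailᴴ x = ⌜ con cTail ⌝ $ x

Condᴴ : Frame n ι → Frame n ι → Frame n ι → Frame n ι → Frame n ι
Condᴴ x y z w = ⌜ con cCond ⌝ $ x $ y $ z $ w

Truncᴴ Eqᴴ Subᴴ : Frame n ι → Frame n ι → Frame n ι
Truncᴴ x y = ⌜ con cTrunc ⌝ $ x $ y
Eqᴴ x y    = ⌜ con cEq ⌝ $ x $ y
Subᴴ x y   = ⌜ con cSub ⌝ $ x $ y

-- ⊥ᶠ is the equation 0 = 1, and axBot only turns it into equations x = ε; explosion for the other
-- formulas is built along their structure.
ex-falso⊃ : (A : Fm n) → E ∣ Γ ⊢ ⊥ᶠ ⊃ A
ex-falso⊃ (t ≐ u)  = ⊃I (≐-trans (⊃E (ax (axBot t)) hyp₀) (≐-sym (⊃E (ax (axBot u)) hyp₀)))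
ex-falso⊃ (t ⊑ u)  = ⊃I (⊃E (∧E₂ (ax (axSub t u))) (⊃E (ex-falso⊃ (Sub t u ≐ `1)) hyp₀))
ex-falso⊃ (Flip t) = ⊃I (⊃E (∧E₂ (ax (axFlip t))) (⊃E (ex-falso⊃ (Flipcoin t ≐ `1)) hyp₀))
ex-falso⊃ (A ∧ᶠ C) = ⊃I (∧I (⊃E (ex-falso⊃ A) hyp₀) (⊃E (ex-falso⊃ C) hyp₀))
ex-falso⊃ (A ∨ᶠ C) = ⊃I (∨I₁ (⊃E (ex-falso⊃ A) hyp₀))
ex-falso⊃ (A ⊃ C)  = ⊃I (⊃I (⊃E (ex-falso⊃ C) hyp₁))
ex-falso⊃ (∀ᶠ A)   = ⊃I (∀I (⊃E (ex-falso⊃ A) hyp₀))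
ex-falso⊃ (∃ᶠ A)   = ⊃I (∃I `ε (∀E (∀I (⊃E (ex-falso⊃ A) hyp₀)) `ε))

ex-falso : E ∣ Γ ⊢ ⊥ᶠ → E ∣ Γ ⊢ A
ex-falso {A = A} = ⊃E (ex-falso⊃ A)

by-shape : ∀ (x : FTm n) → E ∣ (x ≐ `ε) ∷ Γ ⊢ A →
           E ∣ (x ≐ Tail x ∘ `0) ∷ Γ ⊢ A → E ∣ (x ≐ Tail x ∘ `1) ∷ Γ ⊢ A → E ∣ Γ ⊢ A
by-shape x d₀ d₁ d₂ =
  ∨E (ax (axCases x)) d₀ (∨E hyp₀ (weaken-⊆ (∷⁺ʳ _ there) d₁) (weaken-⊆ (∷⁺ʳ _ there) d₂))

-- NP-induction

len : ∀ {Γ} → Tm Γ ι → Tm Γ ι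
len x = Times `1 x

record NPTemplate (Ψ : Ctx) : Set where
  field
    bound   : Tm (ι ∷ Ψ) ι
    lhs rhs : Tm (ι ∷ ι ∷ Ψ) ι
open NPTemplate

-- npAt P σ y is the induction formula (∃z ⪯ bound) lhs = rhs at parameters σ and induction
-- variable y; z is variable 0 and y variable 1 of lhs and rhs. Templates mention their parameters
-- only as variables, so their instances at concrete terms compute definitionally.
npBody : NPTemplate Ψ → Subst Ψ (fctx m) → FTm m → Fm (suc m)
npBody P σ y = (len (var here) ⊑ len (rename there (subst (σ ,, y) (bound P))))
               ∧ᶠ (subst (wkˢ σ ,, wk y ,, var here) (lhs P) ≐ subst (wkˢ σ ,, wk y ,, var here) (rhs P))

npAt : NPTemplate Ψ → Subst Ψ (fctx m) → FTm m → Fm m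
npAt P σ y = ∃ᶠ (npBody P σ y)

NPForm-subst : (τ : Subst (fctx m) (fctx l)) (t : FTm m) (u v : FTm (suc m)) →
               substF τ (NPForm t u v) ≡ NPForm (subst τ t) (subst (extS τ) u) (subst (extS τ) v)
NPForm-subst τ t u v =
  cong (λ b → ∃ᶠ ((len (var here) ⊑ len b) ∧ᶠ (subst (extS τ) u ≐ subst (extS τ) v))) (subst-extS-rename τ t)

npAt-cong : (P : NPTemplate Ψ) {σ τ : Subst Ψ (fctx m)} {y z : FTm m} → σ ≗ˢ τ → y ≡ z → npAt P σ y ≡ npAt P τ z
npAt-cong P e refl = cong₃ NPForm (subst-cong (,,-cong e refl) (bound P)) (subst-cong e′ (lhs P)) (subst-cong e′ (rhs P))
  where e′ = ,,-cong (,,-cong (λ x → cong wk (e x)) refl) refl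

npAt-subst : (P : NPTemplate Ψ) (τ : Subst (fctx m) (fctx l)) (σ : Subst Ψ (fctx m)) (y : FTm m) →
             substF τ (npAt P σ y) ≡ npAt P (τ ∘ˢ σ) (subst τ y)
npAt-subst P τ σ y =
  trans (NPForm-subst τ (subst (σ ,, y) (bound P)) (body (lhs P)) (body (rhs P)))
        (cong₃ NPForm (subst-,, (bound P)) (extS-subst-,, (lhs P)) (extS-subst-,, (rhs P)))
  where
  body : Tm (ι ∷ ι ∷ _) ι → FTm (suc _)
  body U = subst (wkˢ σ ,, wk y ,, var here) U
  subst-,, : ∀ {Φ A B} {σ : Subst Φ (fctx _)} {y : Tm (fctx _) B} (U : Tm (B ∷ Φ) A) →
             subst τ (subst (σ ,, y) U) ≡ subst (τ ∘ˢ σ ,, subst τ y) U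
  subst-,, {σ = σ} {y} U = trans (subst-subst τ (σ ,, y) U) (subst-cong (∘ˢ-,, τ σ y) U)
  extS-subst-,, : (U : Tm (ι ∷ ι ∷ _) ι) →
                  subst (extS τ) (subst (wkˢ σ ,, wk y ,, var here) U) ≡ subst (wkˢ (τ ∘ˢ σ) ,, wk (subst τ y) ,, var here) U
  extS-subst-,, U = trans (subst-subst (extS τ) _ U)
    (subst-cong (λ { here → refl ; (there here) → subst-extS-wk τ y ; (there (there x)) → subst-extS-wk τ (σ x) }) U)

wkF-npAt : (P : NPTemplate Ψ) (σ : Subst Ψ (fctx m)) (y : FTm m) → wkF (npAt P σ y) ≡ npAt P (wkˢ σ) (wk y)
wkF-npAt P σ y = npAt-subst P ↑ˢ σ y

-- The step is required at every instance of the parameters because the axiom states it under ∀.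
np-induction : (P : NPTemplate Ψ) (σ : Subst Ψ (fctx n)) →
               E ∣ Γ ⊢ npAt P σ `ε →
               (∀ {m} {Δ : List (Fm m)} (τ : Subst Ψ (fctx m)) (y : FTm m) (b : Bool) →
                  E ∣ Δ ⊢ npAt P τ y → E ∣ Δ ⊢ npAt P τ (y ∘ bit b)) →
               (s : FTm n) → E ∣ Γ ⊢ npAt P σ s
np-induction {E = E} {Γ = Γ} P σ base step s =
  cast (instance-at s) (∀E (⊃E (ax (axInd _ _ _)) (∧I (cast (sym (instance-at `ε)) base) (∧I (step-at false) (step-at true)))) s)
  where
  F = npAt P (wkˢ σ) (var here)
  instance-at : ∀ t → instF F t ≡ npAt P σ t
  instance-at t = trans (npAt-subst P (σ₀ t) (wkˢ σ) (var here)) (npAt-cong P (λ x → []-wk (σ x) t) refl)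
  step-at : ∀ b → E ∣ Γ ⊢ ∀ᶠ (F ⊃ substF (σ₁ (var here ∘ bit b)) F)
  step-at b = ∀I (⊃I (cast (sym (trans (npAt-subst P (σ₁ (var here ∘ bit b)) (wkˢ σ) (var here))
                                       (npAt-cong P (λ x → subst-subst _ _ (σ x)) refl)))
                           (step (wkˢ σ) (var here) b hyp₀)))

np-intro : (P : NPTemplate Ψ) (σ : Subst Ψ (fctx n)) (y w : FTm n) →
           E ∣ Γ ⊢ len w ⊑ len (subst (σ ,, y) (bound P)) →
           E ∣ Γ ⊢ subst (σ ,, y ,, w) (lhs P) ≐ subst (σ ,, y ,, w) (rhs P) →
           E ∣ Γ ⊢ npAt P σ y
np-intro P σ y w bnd eq =
  ∃I w (∧I (cast (cong (λ b → len w ⊑ len b) (sym ([]-rename _ w))) bnd)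
           (cast (sym (cong₂ _≐_ (at-w (lhs P)) (at-w (rhs P)))) eq))
  where
  at-w : (U : Tm (ι ∷ ι ∷ _) ι) → subst (wkˢ σ ,, wk y ,, var here) U [ w ] ≡ subst (σ ,, y ,, w) U
  at-w U = trans (subst-subst (σ₀ w) _ U)
    (subst-cong (λ { here → refl ; (there here) → []-wk y w ; (there (there x)) → []-wk (σ x) w }) U)

np-step : (P : NPTemplate Ψ) (σ : Subst Ψ (fctx n)) (y : FTm n) (b : Bool) →
          E ∣ Γ ⊢ npAt P σ y → E ∣ npBody P σ y ∷ map wkF Γ ⊢ npAt P (wkˢ σ) (wk y ∘ bit b) →
          E ∣ Γ ⊢ npAt P σ (y ∘ bit b)
np-step P σ y b ih d =
  ∃E ih (cast (sym (trans (wkF-npAt P σ (y ∘ bit b)) (npAt-cong P (λ _ → refl) (cong (wk y ∘_) (subst-bit _ b))))) d)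

len-ε-⊑ : E ∣ Γ ⊢ len `ε ⊑ len `ε
len-ε-⊑ = ⊃E (∧E₂ (ax (axSub _ _))) (conv (≈trans (≈app (≈app ≈refl (timesε `1)) (timesε `1))
                                                  (≈trans (subε `ε) (condε _ _ _))))

eq-induction : (U V : Tm (ι ∷ Ψ) ι) (σ : Subst Ψ (fctx n)) →
               E ∣ Γ ⊢ subst (σ ,, `ε) U ≐ subst (σ ,, `ε) V →
               (∀ {m} {Δ : List (Fm m)} (τ : Subst Ψ (fctx m)) (y : FTm m) (b : Bool) →
                  E ∣ Δ ⊢ subst (τ ,, y) U ≐ subst (τ ,, y) V →
                  E ∣ Δ ⊢ subst (τ ,, y ∘ bit b) U ≐ subst (τ ,, y ∘ bit b) V) →
               (s : FTm n) → E ∣ Γ ⊢ subst (σ ,, s) U ≐ subst (σ ,, s) V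
eq-induction {E = E} U V σ base step s =
  from-np σ s (np-induction P σ (to-np σ `ε base) (λ τ y b d → to-np τ (y ∘ bit b) (step τ y b (from-np τ y d))) s)
  where
  P : NPTemplate _
  P = record { bound = `ε ; lhs = rename there U ; rhs = rename there V }
  skip-z : ∀ {m} (τ : Subst _ (fctx m)) (y z : FTm m) (W : Tm (ι ∷ _) ι) →
           subst (τ ,, y ,, z) (rename there W) ≡ subst (τ ,, y) W
  skip-z τ y z W = subst-rename (τ ,, y ,, z) there W
  to-np : ∀ {m} {Δ : List (Fm m)} (τ : Subst _ (fctx m)) (y : FTm m) →
          E ∣ Δ ⊢ subst (τ ,, y) U ≐ subst (τ ,, y) V → E ∣ Δ ⊢ npAt P τ y
  to-np τ y d = np-intro P τ y `ε len-ε-⊑ (cast (sym (cong₂ _≐_ (skip-z τ y `ε U) (skip-z τ y `ε V))) d)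
  from-np : ∀ {m} {Δ : List (Fm m)} (τ : Subst _ (fctx m)) (y : FTm m) →
            E ∣ Δ ⊢ npAt P τ y → E ∣ Δ ⊢ subst (τ ,, y) U ≐ subst (τ ,, y) V
  from-np τ y d = ∃E d (cast (cong₂ _≐_ (to-wk U) (to-wk V)) (∧E₂ hyp₀))
    where
    to-wk : (W : Tm (ι ∷ _) ι) → subst (wkˢ τ ,, wk y ,, var here) (rename there W) ≡ wk (subst (τ ,, y) W)
    to-wk W = trans (skip-z (wkˢ τ) (wk y) (var here) W)
                    (sym (trans (subst-subst _ (τ ,, y) W) (subst-cong (∘ˢ-,, _ τ y) W)))

∅ˢ : ∀ {Δ} → Subst [] Δ
∅ˢ ()

params₁ : ∀ {m} → FTm m → Subst (fctx 1) (fctx m)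
params₁ x = ∅ˢ ,, x

params₂ : ∀ {m} → FTm m → FTm m → Subst (fctx 2) (fctx m)
params₂ x y = ∅ˢ ,, y ,, x

v₀ : ∀ {k} → FTm (suc k)
v₀ = var here
v₁ : ∀ {k} → FTm (suc (suc k))
v₁ = var (there here)
v₂ : ∀ {k} → FTm (suc (suc (suc k)))
v₂ = var (there (there here))

1≈ε1 : ∀ {Γ} → `1 ≈ _∘_ {Γ} `ε `1
1≈ε1 = ≈sym (catεl `1)

0≈ε0 : ∀ {Γ} → `0 ≈ _∘_ {Γ} `ε `0
0≈ε0 = ≈sym (catεl `0)

bit≈εbit : ∀ {Γ} (b : Bool) → bit {Γ} b ≈ `ε ∘ bit b
bit≈εbit false = 0≈ε0
bit≈εbit true  = 1≈ε1

Cond-≈ : ∀ {Γ} {x x′ y y′ z z′ w w′ : Tm Γ ι} →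
         x ≈ x′ → y ≈ y′ → z ≈ z′ → w ≈ w′ → Cond x y z w ≈ Cond x′ y′ z′ w′
Cond-≈ p q r s = ≈app (≈app (≈app (≈app ≈refl p) q) r) s

Cond-≈₁ : ∀ {Γ} {x x′ y z w : Tm Γ ι} → x ≈ x′ → Cond x y z w ≈ Cond x′ y z w
Cond-≈₁ p = Cond-≈ p ≈refl ≈refl ≈refl

Cond-≈₂ : ∀ {Γ} {x y y′ z w : Tm Γ ι} → y ≈ y′ → Cond x y z w ≈ Cond x y′ z w
Cond-≈₂ p = Cond-≈ ≈refl p ≈refl ≈refl

Cond-1 : ∀ {Γ} (y z w : Tm Γ ι) → Cond `1 y z w ≈ w
Cond-1 y z w = ≈trans (Cond-≈₁ 1≈ε1) (cond1 `ε y z w)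

Cond-0 : ∀ {Γ} (y z w : Tm Γ ι) → Cond `0 y z w ≈ z
Cond-0 y z w = ≈trans (Cond-≈₁ 0≈ε0) (cond0 `ε y z w)

Tail-1 : ∀ {Γ} → Tail {Γ} `1 ≈ `ε
Tail-1 = ≈trans (≈app ≈refl 1≈ε1) (tailb `ε true)

lenᴴ : Frame n ι → Frame n ι
lenᴴ x = ⌜ con cTimes ⌝ $ ⌜ `1 ⌝ $ x

∘-assoc : (x y z : FTm n) → E ∣ Γ ⊢ x ∘ (y ∘ z) ≐ (x ∘ y) ∘ z
∘-assoc x y z = eq-induction (v₁ ∘ (v₂ ∘ v₀)) ((v₁ ∘ v₂) ∘ v₀) (params₂ x y)
  (conv (≈trans (≈app ≈refl (catεr y)) (≈sym (catεr _))))
  (λ τ z b ih → step (τ here) (τ (there here)) z b ih) z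
  where
  step : ∀ {m} {Δ : List (Fm m)} (a c z : FTm m) (b : Bool) →
         E ∣ Δ ⊢ a ∘ (c ∘ z) ≐ (a ∘ c) ∘ z → E ∣ Δ ⊢ a ∘ (c ∘ (z ∘ bit b)) ≐ (a ∘ c) ∘ (z ∘ bit b)
  step a c z b ih =
    a ∘ (c ∘ (z ∘ bit b)) ≈⟨ ≈trans (≈app ≈refl (catb c z b)) (catb a (c ∘ z) b) ⟩
    (a ∘ (c ∘ z)) ∘ bit b ≐⟨ ≐-cong (● ∘ᴴ ⌜ bit b ⌝) ih ⟩
    ((a ∘ c) ∘ z) ∘ bit b ≈⟨ ≈sym (catb (a ∘ c) z b) ⟩
    (a ∘ c) ∘ (z ∘ bit b) ∎

len-ε : ∀ {Γ} → len {Γ} `ε ≈ `ε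
len-ε = timesε `1

len-∘bit : ∀ {Γ} (x : Tm Γ ι) (b : Bool) → len (x ∘ bit b) ≈ len x ∘ `1
len-∘bit x b = ≈trans (timesb `1 x b) (≈trans (≈app ≈refl 1≈ε1)
                 (≈trans (concb _ `ε true) (≈app (≈app ≈refl (concε _)) ≈refl)))

len-bit : ∀ {Γ} (b : Bool) → len {Γ} (bit b) ≈ `1
len-bit b = ≈trans (≈app ≈refl (bit≈εbit b))
              (≈trans (len-∘bit `ε b) (≈trans (≈app (≈app ≈refl len-ε) ≈refl) (catεl `1)))

len-∘ : (x y : FTm n) → E ∣ Γ ⊢ len (x ∘ y) ≐ len x ∘ len y
len-∘ x y = eq-induction (len (v₁ ∘ v₀)) (len v₁ ∘ len v₀) (params₁ x)
  (conv (≈trans (≈app ≈refl (catεr x)) (≈sym (≈trans (≈app ≈refl len-ε) (catεr _)))))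
  (λ τ y b ih → step (τ here) y b ih) y
  where
  step : ∀ {m} {Δ : List (Fm m)} (a y : FTm m) (b : Bool) →
         E ∣ Δ ⊢ len (a ∘ y) ≐ len a ∘ len y → E ∣ Δ ⊢ len (a ∘ (y ∘ bit b)) ≐ len a ∘ len (y ∘ bit b)
  step a y b ih =
    len (a ∘ (y ∘ bit b)) ≈⟨ ≈trans (≈app ≈refl (catb a y b)) (len-∘bit (a ∘ y) b) ⟩
    len (a ∘ y) ∘ `1      ≐⟨ ≐-cong (● ∘ᴴ ⌜ `1 ⌝) ih ⟩
    (len a ∘ len y) ∘ `1  ≐⟨ ≐-sym (∘-assoc (len a) (len y) `1) ⟩
    len a ∘ (len y ∘ `1)  ≈⟨ ≈app ≈refl (≈sym (len-∘bit y b)) ⟩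
    len a ∘ len (y ∘ bit b) ∎

∘-len-ε-comm : ∀ {Γ} (x : Tm Γ ι) → x ∘ len `ε ≈ len `ε ∘ x
∘-len-ε-comm x =
  ≈trans (≈app ≈refl len-ε) (≈trans (catεr x) (≈trans (≈sym (catεl x)) (≈app (≈app ≈refl (≈sym len-ε)) ≈refl)))

1-∘-len-comm : (y : FTm n) → E ∣ Γ ⊢ `1 ∘ len y ≐ len y ∘ `1
1-∘-len-comm y = eq-induction (`1 ∘ len v₀) (len v₀ ∘ `1) ∅ˢ (conv (∘-len-ε-comm `1))
  (λ τ y b ih → step y b ih) y
  where
  step : ∀ {m} {Δ : List (Fm m)} (y : FTm m) (b : Bool) →
         E ∣ Δ ⊢ `1 ∘ len y ≐ len y ∘ `1 → E ∣ Δ ⊢ `1 ∘ len (y ∘ bit b) ≐ len (y ∘ bit b) ∘ `1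
  step y b ih =
    `1 ∘ len (y ∘ bit b) ≈⟨ ≈app ≈refl (len-∘bit y b) ⟩
    `1 ∘ (len y ∘ `1)    ≐⟨ ∘-assoc `1 (len y) `1 ⟩
    (`1 ∘ len y) ∘ `1    ≐⟨ ≐-cong (● ∘ᴴ ⌜ `1 ⌝) ih ⟩
    (len y ∘ `1) ∘ `1    ≈⟨ ≈app (≈app ≈refl (≈sym (len-∘bit y b))) ≈refl ⟩
    len (y ∘ bit b) ∘ `1 ∎

len-∘-comm : (x y : FTm n) → E ∣ Γ ⊢ len x ∘ len y ≐ len y ∘ len x
len-∘-comm x y = eq-induction (len v₁ ∘ len v₀) (len v₀ ∘ len v₁) (params₁ x) (conv (∘-len-ε-comm (len x)))
  (λ τ y b ih → step (τ here) y b ih) y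
  where
  step : ∀ {m} {Δ : List (Fm m)} (a y : FTm m) (b : Bool) →
         E ∣ Δ ⊢ len a ∘ len y ≐ len y ∘ len a → E ∣ Δ ⊢ len a ∘ len (y ∘ bit b) ≐ len (y ∘ bit b) ∘ len a
  step a y b ih =
    len a ∘ len (y ∘ bit b) ≈⟨ ≈app ≈refl (len-∘bit y b) ⟩
    len a ∘ (len y ∘ `1)    ≐⟨ ∘-assoc (len a) (len y) `1 ⟩
    (len a ∘ len y) ∘ `1    ≐⟨ ≐-cong (● ∘ᴴ ⌜ `1 ⌝) ih ⟩
    (len y ∘ len a) ∘ `1    ≐⟨ ≐-sym (∘-assoc (len y) (len a) `1) ⟩
    len y ∘ (len a ∘ `1)    ≐⟨ ≐-cong (⌜ len y ⌝ ∘ᴴ ●) (≐-sym (1-∘-len-comm a)) ⟩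
    len y ∘ (`1 ∘ len a)    ≐⟨ ∘-assoc (len y) `1 (len a) ⟩
    (len y ∘ `1) ∘ len a    ≈⟨ ≈app (≈app ≈refl (≈sym (len-∘bit y b))) ≈refl ⟩
    len (y ∘ bit b) ∘ len a ∎

len-len : (x : FTm n) → E ∣ Γ ⊢ len (len x) ≐ len x
len-len x = eq-induction (len (len v₀)) (len v₀) ∅ˢ (conv (≈app ≈refl len-ε)) (λ τ y b ih → step y b ih) x
  where
  step : ∀ {m} {Δ : List (Fm m)} (y : FTm m) (b : Bool) →
         E ∣ Δ ⊢ len (len y) ≐ len y → E ∣ Δ ⊢ len (len (y ∘ bit b)) ≐ len (y ∘ bit b)
  step y b ih =
    len (len (y ∘ bit b)) ≈⟨ ≈trans (≈app ≈refl (len-∘bit y b)) (len-∘bit (len y) true) ⟩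
    len (len y) ∘ `1      ≐⟨ ≐-cong (● ∘ᴴ ⌜ `1 ⌝) ih ⟩
    len y ∘ `1            ≈⟨ ≈sym (len-∘bit y b) ⟩
    len (y ∘ bit b)       ∎

Trunc-padded : (w v : FTm n) → E ∣ Γ ⊢ Trunc v (w ∘ len v) ≐ v
Trunc-padded w v = eq-induction (Trunc v₀ (v₁ ∘ len v₀)) v₀ (params₁ w) (conv (truncεl _))
  (λ τ y b ih → step (τ here) y b ih) v
  where
  step : ∀ {m} {Δ : List (Fm m)} (w y : FTm m) (b : Bool) →
         E ∣ Δ ⊢ Trunc y (w ∘ len y) ≐ y → E ∣ Δ ⊢ Trunc (y ∘ bit b) (w ∘ len (y ∘ bit b)) ≐ y ∘ bit b
  step w y b ih =
    Trunc (y ∘ bit b) (w ∘ len (y ∘ bit b)) ≈⟨ ≈app ≈refl (≈app ≈refl (len-∘bit y b)) ⟩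
    Trunc (y ∘ bit b) (w ∘ (len y ∘ `1))    ≈⟨ ≈app ≈refl (catb w (len y) true) ⟩
    Trunc (y ∘ bit b) ((w ∘ len y) ∘ `1)    ≈⟨ truncb y (w ∘ len y) b true ⟩
    Trunc y (w ∘ len y) ∘ bit b ≐⟨ ≐-cong (● ∘ᴴ ⌜ bit b ⌝) ih ⟩
    y ∘ bit b ∎

Trunc-suffix : (a v : FTm n) → E ∣ Γ ⊢ Trunc (a ∘ v) (len v) ≐ v
Trunc-suffix a v = eq-induction (Trunc (v₁ ∘ v₀) (len v₀)) v₀ (params₁ a)
  (conv (≈trans (≈app (≈app ≈refl (catεr _)) len-ε) (truncεr _)))
  (λ τ y b ih → step (τ here) y b ih) v
  where
  step : ∀ {m} {Δ : List (Fm m)} (a y : FTm m) (b : Bool) →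
         E ∣ Δ ⊢ Trunc (a ∘ y) (len y) ≐ y → E ∣ Δ ⊢ Trunc (a ∘ (y ∘ bit b)) (len (y ∘ bit b)) ≐ y ∘ bit b
  step a y b ih =
    Trunc (a ∘ (y ∘ bit b)) (len (y ∘ bit b))
      ≈⟨ ≈trans (≈app (≈app ≈refl (catb a y b)) (len-∘bit y b)) (truncb (a ∘ y) (len y) b true) ⟩
    Trunc (a ∘ y) (len y) ∘ bit b ≐⟨ ≐-cong (● ∘ᴴ ⌜ bit b ⌝) ih ⟩
    y ∘ bit b ∎

Eq-refl : (x : FTm n) → E ∣ Γ ⊢ Eq x x ≐ `1
Eq-refl x = eq-induction (Eq v₀ v₀) `1 ∅ˢ (conv eqεε) (λ τ y b ih → ≐-trans (conv (eqbb y y b)) ih) x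

Eq-∘-cancelʳ : (a c s : FTm n) → E ∣ Γ ⊢ Eq (a ∘ s) (c ∘ s) ≐ Eq a c
Eq-∘-cancelʳ a c s = eq-induction (Eq (v₁ ∘ v₀) (v₂ ∘ v₀)) (Eq v₁ v₂) (params₂ a c)
  (conv (≈app (≈app ≈refl (catεr a)) (catεr c)))
  (λ τ y b ih → ≐-trans (conv (≈trans (≈app (≈app ≈refl (catb _ y b)) (catb _ y b)) (eqbb _ _ b))) ih) s

distinguish : ∀ {a b : FTm n} (C : Frame n ι) → plug C a ≈ `0 → plug C b ≈ `1 → E ∣ Γ ⊢ a ≐ b → E ∣ Γ ⊢ A
distinguish C p q e = ex-falso (≐-trans (≐-sym (conv p)) (≐-trans (≐-cong C e) (conv q)))

ε≠∘bit : ∀ {x : FTm n} (b : Bool) → E ∣ Γ ⊢ `ε ≐ x ∘ bit b → E ∣ Γ ⊢ A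
ε≠∘bit {x = x} b = distinguish (Condᴴ ● ⌜ `0 ⌝ ⌜ `1 ⌝ ⌜ `1 ⌝) (condε _ _ _) (Cond-∘bit b)
  where
  Cond-∘bit : ∀ b → Cond (x ∘ bit b) `0 `1 `1 ≈ `1
  Cond-∘bit false = cond0 x _ _ _
  Cond-∘bit true  = cond1 x _ _ _

∘0≠∘1 : ∀ {x y : FTm n} → E ∣ Γ ⊢ x ∘ `0 ≐ y ∘ `1 → E ∣ Γ ⊢ A
∘0≠∘1 {x = x} {y} = distinguish (Condᴴ ● ⌜ `0 ⌝ ⌜ `0 ⌝ ⌜ `1 ⌝) (cond0 x _ _ _) (cond1 y _ _ _)

ε≠1 : E ∣ Γ ⊢ `ε ≐ `1 → E ∣ Γ ⊢ A
ε≠1 d = ε≠∘bit true (≐-trans d (conv 1≈ε1))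

IsBit : FTm n → Fm n
IsBit q = (q ≐ `0) ∨ᶠ (q ≐ `1)

IsBitOrε : FTm n → Fm n
IsBitOrε p = (p ≐ `ε) ∨ᶠ IsBit p

IsBit-resp : ∀ {a b : FTm n} → E ∣ Γ ⊢ a ≐ b → E ∣ Γ ⊢ IsBit b → E ∣ Γ ⊢ IsBit a
IsBit-resp e t = ∨E t (∨I₁ (≐-trans (weaken e) hyp₀)) (∨I₂ (≐-trans (weaken e) hyp₀))

IsBitOrε-resp : ∀ {a b : FTm n} → E ∣ Γ ⊢ a ≐ b → E ∣ Γ ⊢ IsBitOrε b → E ∣ Γ ⊢ IsBitOrε a
IsBitOrε-resp e t = ∨E t (∨I₁ (≐-trans (weaken e) hyp₀)) (∨I₂ (IsBit-resp (weaken e) hyp₀))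

Cond-ε-≐ : ∀ {q y z w : FTm n} → E ∣ Γ ⊢ q ≐ `ε → E ∣ Γ ⊢ Cond q y z w ≐ y
Cond-ε-≐ {y = y} {z} {w} e = ≐-trans (≐-cong (Condᴴ ● ⌜ y ⌝ ⌜ z ⌝ ⌜ w ⌝) e) (conv (condε y z w))

Cond-∘0-≐ : ∀ {q p y z w : FTm n} → E ∣ Γ ⊢ q ≐ p ∘ `0 → E ∣ Γ ⊢ Cond q y z w ≐ z
Cond-∘0-≐ {p = p} {y} {z} {w} e = ≐-trans (≐-cong (Condᴴ ● ⌜ y ⌝ ⌜ z ⌝ ⌜ w ⌝) e) (conv (cond0 p y z w))

Cond-∘1-≐ : ∀ {q p y z w : FTm n} → E ∣ Γ ⊢ q ≐ p ∘ `1 → E ∣ Γ ⊢ Cond q y z w ≐ w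
Cond-∘1-≐ {p = p} {y} {z} {w} e = ≐-trans (≐-cong (Condᴴ ● ⌜ y ⌝ ⌜ z ⌝ ⌜ w ⌝) e) (conv (cond1 p y z w))

Cond-0-≐ : ∀ {q y z w : FTm n} → E ∣ Γ ⊢ q ≐ `0 → E ∣ Γ ⊢ Cond q y z w ≐ z
Cond-0-≐ e = Cond-∘0-≐ (≐-trans e (conv 0≈ε0))

Cond-1-≐ : ∀ {q y z w : FTm n} → E ∣ Γ ⊢ q ≐ `1 → E ∣ Γ ⊢ Cond q y z w ≐ w
Cond-1-≐ e = Cond-∘1-≐ (≐-trans e (conv 1≈ε1))

Cond-∘bit-same : ∀ {q p y z : FTm n} (b : Bool) → E ∣ Γ ⊢ q ≐ p ∘ bit b → E ∣ Γ ⊢ Cond q y z z ≐ z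
Cond-∘bit-same false = Cond-∘0-≐
Cond-∘bit-same true  = Cond-∘1-≐

Cond-cases : (q y z w : FTm n) → E ∣ Γ ⊢ (Cond q y z w ≐ y) ∨ᶠ (Cond q y z w ≐ z) ∨ᶠ (Cond q y z w ≐ w)
Cond-cases q y z w =
  by-shape q (∨I₁ (Cond-ε-≐ hyp₀)) (∨I₂ (∨I₁ (Cond-∘0-≐ hyp₀))) (∨I₂ (∨I₂ (Cond-∘1-≐ hyp₀)))

Cond-const : (q a : FTm n) → E ∣ Γ ⊢ Cond q a a a ≐ a
Cond-const q a = by-shape q (Cond-ε-≐ hyp₀) (Cond-∘0-≐ hyp₀) (Cond-∘1-≐ hyp₀)

Cond-isBit : (q : FTm n) {x : FTm n} → E ∣ Γ ⊢ IsBit x → E ∣ Γ ⊢ IsBit (Cond q `0 x `1)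
Cond-isBit q t = ∨E (Cond-cases q `0 _ `1) (∨I₁ hyp₀) (∨E hyp₀ (IsBit-resp hyp₀ (weaken (weaken t))) (∨I₂ hyp₀))

B-isBitOrε : (q : FTm n) → E ∣ Γ ⊢ IsBitOrε (B q)
B-isBitOrε q = Cond-cases q `ε `0 `1

isOne : ∀ {Γ} → Tm Γ ι → Tm Γ ι
isOne z = Cond z `0 `0 (Eps (Tail z))

isOneᴴ : Frame n ι → Frame n ι
isOneᴴ z = Condᴴ z ⌜ `0 ⌝ ⌜ `0 ⌝ (Condᴴ (Tailᴴ z) ⌜ `1 ⌝ ⌜ `0 ⌝ ⌜ `0 ⌝)

isOne-isBit : (z : FTm n) → E ∣ Γ ⊢ IsBit (isOne z)
isOne-isBit z = by-shape z (∨I₁ (Cond-ε-≐ hyp₀)) (∨I₁ (Cond-∘0-≐ hyp₀))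
  (by-shape (Tail z) (∨I₂ (≐-trans (Cond-∘1-≐ hyp₁) (Cond-ε-≐ hyp₀)))
                     (∨I₁ (≐-trans (Cond-∘1-≐ hyp₁) (Cond-∘0-≐ hyp₀)))
                     (∨I₁ (≐-trans (Cond-∘1-≐ hyp₁) (Cond-∘1-≐ hyp₀))))

isOne-complete : ∀ {z : FTm n} → E ∣ Γ ⊢ z ≐ `1 → E ∣ Γ ⊢ isOne z ≐ `1
isOne-complete e = ≐-trans (≐-cong (isOneᴴ ●) e) (conv (≈trans (Cond-1 _ _ _) (≈trans (Cond-≈₁ Tail-1) (condε _ _ _))))

isOne-sound : ∀ {z : FTm n} → E ∣ Γ ⊢ isOne z ≐ `1 → E ∣ Γ ⊢ z ≐ `1
isOne-sound {z = z} d =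
  by-shape z (ex-falso (≐-trans (≐-sym (Cond-ε-≐ hyp₀)) (weaken d)))
             (ex-falso (≐-trans (≐-sym (Cond-∘0-≐ hyp₀)) (weaken d)))
    (by-shape (Tail z) (≐-trans hyp₁ (≐-trans (≐-cong (● ∘ᴴ ⌜ `1 ⌝) hyp₀) (conv (catεl `1))))
                       (ex-falso (≐-trans (≐-sym (≐-trans (Cond-∘1-≐ hyp₁) (Cond-∘0-≐ hyp₀))) (weaken (weaken d))))
                       (ex-falso (≐-trans (≐-sym (≐-trans (Cond-∘1-≐ hyp₁) (Cond-∘1-≐ hyp₀))) (weaken (weaken d)))))

Cond-isBitOrε : ∀ (q : FTm n) {y z w : FTm n} →
                E ∣ Γ ⊢ IsBitOrε y → E ∣ Γ ⊢ IsBitOrε z → E ∣ Γ ⊢ IsBitOrε w →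
                E ∣ Γ ⊢ IsBitOrε (Cond q y z w)
Cond-isBitOrε q dy dz dw = ∨E (Cond-cases q _ _ _) (IsBitOrε-resp hyp₀ (weaken dy))
  (∨E hyp₀ (IsBitOrε-resp hyp₀ (weaken (weaken dz))) (IsBitOrε-resp hyp₀ (weaken (weaken dw))))

0-isBitOrε : E ∣ Γ ⊢ IsBitOrε {n} `0
0-isBitOrε = ∨I₂ (∨I₁ ≐-refl)

1-isBitOrε : E ∣ Γ ⊢ IsBitOrε {n} `1
1-isBitOrε = ∨I₂ (∨I₂ ≐-refl)

Sub-isBitOrε : (j s : FTm n) → E ∣ Γ ⊢ IsBitOrε (Sub j s)
Sub-isBitOrε j s = by-shape s
  (IsBitOrε-resp (≐-trans (≐-cong (Subᴴ ⌜ j ⌝ ●) hyp₀) (conv (subε j)))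
                 (Cond-isBitOrε j 1-isBitOrε 0-isBitOrε 0-isBitOrε))
  (IsBitOrε-resp (≐-trans (≐-cong (Subᴴ ⌜ j ⌝ ●) hyp₀) (conv (subb j _ false))) BOr-isBitOrε)
  (IsBitOrε-resp (≐-trans (≐-cong (Subᴴ ⌜ j ⌝ ●) hyp₀) (conv (subb j _ true))) BOr-isBitOrε)
  where
  BOr-isBitOrε : ∀ {Δ : List (Fm _)} {p q} → E ∣ Δ ⊢ IsBitOrε (BOr p q)
  BOr-isBitOrε {p = p} {q} = Cond-isBitOrε (B p) (B-isBitOrε q) (B-isBitOrε q) 1-isBitOrε

endsIn1 : ∀ {Γ} → Tm Γ ι → Tm Γ ι
endsIn1 q = Cond q `0 `0 `1

endsIn1ᴴ : Frame n ι → Frame n ι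
endsIn1ᴴ q = Condᴴ q ⌜ `0 ⌝ ⌜ `0 ⌝ ⌜ `1 ⌝

endsIn1-isBit : (q : FTm n) → E ∣ Γ ⊢ IsBit (endsIn1 q)
endsIn1-isBit q = ∨E (Cond-cases q `0 `0 `1) (∨I₁ hyp₀) hyp₀

B≐1⇒endsIn1 : ∀ {q : FTm n} → E ∣ Γ ⊢ B q ≐ `1 → E ∣ Γ ⊢ endsIn1 q ≐ `1
B≐1⇒endsIn1 d = by-shape _ (ε≠1 (≐-trans (≐-sym (Cond-ε-≐ hyp₀)) (weaken d)))
                            (ex-falso (≐-trans (≐-sym (Cond-∘0-≐ hyp₀)) (weaken d)))
                            (Cond-∘1-≐ hyp₀)

Bᴴ : Frame n ι → Frame n ι
Bᴴ x = Condᴴ x ⌜ `ε ⌝ ⌜ `0 ⌝ ⌜ `1 ⌝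

BOr-1ʳ : (p : FTm n) → E ∣ Γ ⊢ BOr p `1 ≐ `1
BOr-1ʳ p = ≐-trans (conv (≈app (≈app (≈app ≈refl (Cond-1 _ _ _)) (Cond-1 _ _ _)) ≈refl)) (Cond-const (B p) `1)

BOr-1ˡ : ∀ {p q : FTm n} → E ∣ Γ ⊢ p ≐ `1 → E ∣ Γ ⊢ BOr p q ≐ `1
BOr-1ˡ {q = q} e =
  ≐-trans (≐-cong (Condᴴ (Bᴴ ●) ⌜ B q ⌝ ⌜ B q ⌝ ⌜ `1 ⌝) e)
          (conv (≈trans (Cond-≈₁ (Cond-1 _ _ _)) (Cond-1 _ _ _)))

BOr≐1-cases : ∀ {p q : FTm n} → E ∣ Γ ⊢ IsBitOrε p → E ∣ Γ ⊢ BOr p q ≐ `1 →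
              E ∣ Γ ⊢ (p ≐ `1) ∨ᶠ (endsIn1 q ≐ `1)
BOr≐1-cases {p = p} {q} t d = ∨E t
  (∨I₂ (via-B (≈trans (Cond-≈₁ (condε _ _ _)) (condε _ _ _)) (weaken d)))
  (∨E hyp₀ (∨I₂ (via-B (≈trans (Cond-≈₁ (Cond-0 _ _ _)) (Cond-0 _ _ _)) (weaken (weaken d)))) (∨I₁ hyp₀))
  where
  via-B : ∀ {Δ} {p′ : FTm _} → Cond (B p′) (B q) (B q) `1 ≈ B q →
          E ∣ (p ≐ p′) ∷ Δ ⊢ BOr p q ≐ `1 → E ∣ (p ≐ p′) ∷ Δ ⊢ endsIn1 q ≐ `1
  via-B c d =
    B≐1⇒endsIn1 (≐-trans (≐-sym (≐-trans (≐-cong (Condᴴ (Bᴴ ●) ⌜ B q ⌝ ⌜ B q ⌝ ⌜ `1 ⌝) hyp₀) (conv c))) d)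

Sub-refl : (a : FTm n) → E ∣ Γ ⊢ Sub a a ≐ `1
Sub-refl a = by-shape a
  (≐-trans (≐-cong (Subᴴ ● ●) hyp₀) (conv (≈trans (subε `ε) (condε _ _ _))))
  (≐-trans (≐-cong (Subᴴ ● ●) hyp₀) (last-prefix false))
  (≐-trans (≐-cong (Subᴴ ● ●) hyp₀) (last-prefix true))
  where
  last-prefix : ∀ {Δ : List (Fm _)} b → E ∣ Δ ⊢ Sub (Tail a ∘ bit b) (Tail a ∘ bit b) ≐ `1
  last-prefix b = ≐-trans (conv (subb _ _ b))
    (≐-trans (≐-cong (Condᴴ ⌜ B (Sub (Tail a ∘ bit b) (Tail a)) ⌝ (Bᴴ ●) (Bᴴ ●) ⌜ `1 ⌝) (Eq-refl _)) (BOr-1ʳ _))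

Sub-∘bit : ∀ {a c : FTm n} (b : Bool) → E ∣ Γ ⊢ Sub a c ≐ `1 → E ∣ Γ ⊢ Sub a (c ∘ bit b) ≐ `1
Sub-∘bit b e = ≐-trans (conv (subb _ _ b)) (BOr-1ˡ e)

Sub-∘ : (a b : FTm n) → E ∣ Γ ⊢ Sub a (a ∘ b) ≐ `1
Sub-∘ a b = eq-induction (Sub v₁ (v₁ ∘ v₀)) `1 (params₁ a)
  (≐-trans (conv (≈app ≈refl (catεr a))) (Sub-refl a))
  (λ τ y b ih → ≐-trans (conv (≈app ≈refl (catb (τ here) y b))) (Sub-∘bit b ih)) b

Sub-ε : (y : FTm n) → E ∣ Γ ⊢ Sub `ε y ≐ `1
Sub-ε y = ≐-trans (conv (≈app ≈refl (≈sym (catεl y)))) (Sub-∘ `ε y)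

Sub-ε≐1 : ∀ {j : FTm n} → E ∣ Γ ⊢ Sub j `ε ≐ `1 → E ∣ Γ ⊢ j ≐ `ε
Sub-ε≐1 {j = j} d = by-shape j hyp₀
  (ex-falso (≐-sym (≐-trans (≐-sym (≐-trans (conv (≈sym (subε j))) (weaken d))) (Cond-∘0-≐ hyp₀))))
  (ex-falso (≐-sym (≐-trans (≐-sym (≐-trans (conv (≈sym (subε j))) (weaken d))) (Cond-∘1-≐ hyp₀))))

Trunc-1-bit : ∀ {q : FTm n} → E ∣ Γ ⊢ IsBit q → E ∣ Γ ⊢ Trunc q `1 ≐ q
Trunc-1-bit d = ∨E d (≐-trans (≐-cong (Truncᴴ ● ⌜ `1 ⌝) hyp₀) (≐-trans (conv (Trunc-bit-1 false)) (≐-sym hyp₀)))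
                     (≐-trans (≐-cong (Truncᴴ ● ⌜ `1 ⌝) hyp₀) (≐-trans (conv (Trunc-bit-1 true)) (≐-sym hyp₀)))
  where
  Trunc-bit-1 : ∀ {Γ} b → Trunc (bit {Γ} b) `1 ≈ bit b
  Trunc-bit-1 b = ≈trans (≈app (≈app ≈refl (bit≈εbit b)) 1≈ε1)
                    (≈trans (truncb `ε `ε b true) (≈trans (≈app (≈app ≈refl (truncεr `ε)) ≈refl) (≈sym (bit≈εbit b))))

Sub⇒⊑ : ∀ {x y : FTm n} → E ∣ Γ ⊢ Sub x y ≐ `1 → E ∣ Γ ⊢ x ⊑ y
Sub⇒⊑ = ⊃E (∧E₂ (ax (axSub _ _)))

⊑⇒Sub : ∀ {x y : FTm n} → E ∣ Γ ⊢ x ⊑ y → E ∣ Γ ⊢ Sub x y ≐ `1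
⊑⇒Sub = ⊃E (∧E₁ (ax (axSub _ _)))

infixr 7 _∧ᵗ_
_∧ᵗ_ : ∀ {Γ} → Tm Γ ι → Tm Γ ι → Tm Γ ι
p ∧ᵗ q = Cond p `0 `0 q

∧ᵗ-congʳ : ∀ {p q q′ : FTm n} → E ∣ Γ ⊢ q ≐ q′ → E ∣ Γ ⊢ p ∧ᵗ q ≐ p ∧ᵗ q′
∧ᵗ-congʳ {p = p} = ≐-cong (Condᴴ ⌜ p ⌝ ⌜ `0 ⌝ ⌜ `0 ⌝ ●)

∧ᵗ-intro : ∀ {p q : FTm n} → E ∣ Γ ⊢ p ≐ `1 → E ∣ Γ ⊢ q ≐ `1 → E ∣ Γ ⊢ p ∧ᵗ q ≐ `1
∧ᵗ-intro e d = ≐-trans (Cond-1-≐ e) d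

∧ᵗ-elim : ∀ {p q : FTm n} → E ∣ Γ ⊢ IsBit p → E ∣ Γ ⊢ p ∧ᵗ q ≐ `1 → E ∣ Γ ⊢ (p ≐ `1) ∧ᶠ (q ≐ `1)
∧ᵗ-elim bp d = ∨E bp (ex-falso (≐-trans (≐-sym (Cond-0-≐ hyp₀)) (weaken d)))
                     (∧I hyp₀ (≐-trans (≐-sym (Cond-1-≐ hyp₀)) (weaken d)))

∧ᵗ-cancelˡ : ∀ {p q q′ : FTm n} → E ∣ Γ ⊢ p ≐ `1 → E ∣ Γ ⊢ p ∧ᵗ q ≐ p ∧ᵗ q′ →
             E ∣ Γ ⊢ q ≐ q′
∧ᵗ-cancelˡ e d = ≐-trans (≐-sym (Cond-1-≐ e)) (≐-trans d (Cond-1-≐ e))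

∧ᵗ-0 : ∀ {p q q′ : FTm n} → E ∣ Γ ⊢ p ≐ `0 → E ∣ Γ ⊢ p ∧ᵗ q ≐ p ∧ᵗ q′
∧ᵗ-0 e = ≐-trans (Cond-0-≐ e) (≐-sym (Cond-0-≐ e))

-- Splitting a string at a given length from its end

-- dropEnd z k deletes the last |k| digits of z and takeEnd z k collects them; the bound len z of
-- both recursions never truncates.
tailStep : ∀ {Γ} → Tm Γ (ι ⇒ ι ⇒ ι)
tailStep = lam (lam (Tail (var here)))

lenBound : ∀ {Γ} → Tm Γ ι → Tm Γ (ι ⇒ ι)
lenBound z = lam (len (rename there z))

dropEnd : ∀ {Γ} → Tm Γ ι → Tm Γ ι → Tm Γ ι
dropEnd z k = Rec z tailStep tailStep (lenBound z) k

moveStep : ∀ {Γ} → Tm Γ ι → Tm Γ (ι ⇒ ι ⇒ ι)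
moveStep z = lam (lam (Cond (dropEnd (rename there (rename there z)) (var (there here)))
                            (var here) (`0 ∘ var here) (`1 ∘ var here)))

takeEnd : ∀ {Γ} → Tm Γ ι → Tm Γ ι → Tm Γ ι
takeEnd z k = Rec `ε (moveStep z) (moveStep z) (lenBound z) k

dropEnd-subst : ∀ {Γ Δ} (σ : Subst Γ Δ) (z k : Tm Γ ι) → subst σ (dropEnd z k) ≡ dropEnd (subst σ z) (subst σ k)
dropEnd-subst σ z k = cong (λ q → Rec (subst σ z) tailStep tailStep (lam (len q)) (subst σ k)) (subst-extS-rename σ z)

takeEnd-subst : ∀ {Γ Δ} (σ : Subst Γ Δ) (z k : Tm Γ ι) → subst σ (takeEnd z k) ≡ takeEnd (subst σ z) (subst σ k)
takeEnd-subst σ z k = cong₃ (λ h q r → Rec `ε h h (lam (len q)) r) moveStep-subst (subst-extS-rename σ z) refl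
  where
  moveStep-subst : subst σ (moveStep z) ≡ moveStep (subst σ z)
  moveStep-subst = cong (λ q → lam (lam (Cond q (var here) (`0 ∘ var here) (`1 ∘ var here))))
    (trans (dropEnd-subst (extS (extS σ)) (rename there (rename there z)) (var (there here)))
           (cong (λ q → dropEnd q (var (there here)))
                 (trans (subst-extS-rename (extS σ) (rename there z)) (cong (rename there) (subst-extS-rename σ z)))))

dropEnd-∘bit : (z k : FTm n) (b : Bool) → E ∣ Γ ⊢ dropEnd z (k ∘ bit b) ≐ Trunc (Tail (dropEnd z k)) (len z)
dropEnd-∘bit z k b =
  ≐-trans (conv (≈trans (recb z tailStep tailStep (lenBound z) k b) (≈app (≈app ≈refl (tailStep-β b)) (≈β _ k))))
          (≡⇒≐ (cong (λ q → Trunc (Tail (dropEnd z k)) (len q)) ([]-rename z k)))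
  where
  tailStep-β : ∀ b → selB b tailStep tailStep · k · dropEnd z k ≈ Tail (dropEnd z k)
  tailStep-β false = ≈trans (≈app (≈β _ k) ≈refl) (≈β _ _)
  tailStep-β true  = ≈trans (≈app (≈β _ k) ≈refl) (≈β _ _)

takeEnd-∘bit : (z k : FTm n) (b : Bool) →
               E ∣ Γ ⊢ takeEnd z (k ∘ bit b) ≐
                       Trunc (Cond (dropEnd z k) (takeEnd z k) (`0 ∘ takeEnd z k) (`1 ∘ takeEnd z k)) (len z)
takeEnd-∘bit z k b =
  ≐-trans (conv (≈trans (recb `ε (moveStep z) (moveStep z) (lenBound z) k b) (≈app (≈app ≈refl (moveStep-β b)) (≈β _ k))))
          (≡⇒≐ (cong₂ (λ q r → Trunc (Cond q S (`0 ∘ S) (`1 ∘ S)) (len r)) dropEnd-inst ([]-rename z k)))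
  where
  S = takeEnd z k
  body : Tm (ι ∷ ι ∷ fctx _) ι
  body = Cond (dropEnd (rename there (rename there z)) (var (there here))) (var here) (`0 ∘ var here) (`1 ∘ var here)
  moveStep-β : ∀ b → selB b (moveStep z) (moveStep z) · k · S ≈ subst (extS (σ₀ k)) body [ S ]
  moveStep-β false = ≈trans (≈app (≈β _ k) ≈refl) (≈β _ _)
  moveStep-β true  = ≈trans (≈app (≈β _ k) ≈refl) (≈β _ _)
  dropEnd-inst : subst (extS (σ₀ k)) (dropEnd (rename there (rename there z)) (var (there here))) [ S ] ≡ dropEnd z k
  dropEnd-inst =
    trans (cong (subst (σ₀ S)) (dropEnd-subst (extS (σ₀ k)) (rename there (rename there z)) (var (there here))))
    (trans (dropEnd-subst (σ₀ S) (subst (extS (σ₀ k)) (rename there (rename there z))) (rename there k))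
    (cong₂ dropEnd (trans (cong (subst (σ₀ S)) (trans (subst-extS-rename (σ₀ k) (rename there z))
                                                      (cong (rename there) ([]-rename z k))))
                          ([]-rename z S))
                   ([]-rename k S)))

Truncᴴ-len : FTm n → Frame n ι → Frame n ι
Truncᴴ-len a x = Truncᴴ ⌜ a ⌝ (lenᴴ x)

dropEnd-ε-∘bit : (z k : FTm n) (b : Bool) → E ∣ Γ ⊢ dropEnd z k ≐ `ε → E ∣ Γ ⊢ dropEnd z (k ∘ bit b) ≐ `ε
dropEnd-ε-∘bit z k b e =
  ≐-trans (dropEnd-∘bit z k b) (≐-trans (≐-cong (Truncᴴ (Tailᴴ ●) ⌜ len z ⌝) e)
          (conv (≈trans (≈app (≈app ≈refl tailε) ≈refl) (truncεl _))))

takeEnd-ε-∘bit : (z k : FTm n) (b : Bool) → E ∣ Γ ⊢ dropEnd z k ≐ `ε → E ∣ Γ ⊢ z ≐ dropEnd z k ∘ takeEnd z k →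
                 E ∣ Γ ⊢ takeEnd z (k ∘ bit b) ≐ takeEnd z k
takeEnd-ε-∘bit z k b e split =
  takeEnd z (k ∘ bit b)          ≐⟨ takeEnd-∘bit z k b ⟩
  Trunc (Cond (dropEnd z k) S _ _) (len z) ≐⟨ ≐-cong (Truncᴴ ● ⌜ len z ⌝) (Cond-ε-≐ e) ⟩
  Trunc S (len z)                ≐⟨ ≐-cong (Truncᴴ-len S ●) (≐-trans split (≐-cong (● ∘ᴴ ⌜ S ⌝) e)) ⟩
  Trunc S (len (`ε ∘ S))         ≈⟨ ≈app ≈refl (≈trans (≈app ≈refl (catεl _)) (≈sym (catεl _))) ⟩
  Trunc S (`ε ∘ len S)           ≐⟨ Trunc-padded `ε S ⟩
  S ∎
  where S = takeEnd z k

split-∘bit : (z k a : FTm n) (c : Bool) →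
             E ∣ Γ ⊢ dropEnd z k ≐ a ∘ bit c → E ∣ Γ ⊢ z ≐ dropEnd z k ∘ takeEnd z k →
             E ∣ Γ ⊢ z ≐ a ∘ (bit c ∘ takeEnd z k)
split-∘bit z k a c e split =
  ≐-trans split (≐-trans (≐-cong (● ∘ᴴ ⌜ takeEnd z k ⌝) e) (≐-sym (∘-assoc a (bit c) (takeEnd z k))))

dropEnd-∘bit-∘bit : (z k a : FTm n) (b c : Bool) →
                    E ∣ Γ ⊢ dropEnd z k ≐ a ∘ bit c → E ∣ Γ ⊢ z ≐ dropEnd z k ∘ takeEnd z k →
                    E ∣ Γ ⊢ dropEnd z (k ∘ bit b) ≐ a
dropEnd-∘bit-∘bit z k a b c e split =
  dropEnd z (k ∘ bit b)                     ≐⟨ dropEnd-∘bit z k b ⟩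
  Trunc (Tail (dropEnd z k)) (len z)        ≐⟨ ≐-cong (Truncᴴ (Tailᴴ ●) ⌜ len z ⌝) e ⟩
  Trunc (Tail (a ∘ bit c)) (len z)          ≈⟨ ≈app (≈app ≈refl (tailb a c)) ≈refl ⟩
  Trunc a (len z)                           ≐⟨ ≐-cong (Truncᴴ-len a ●) (split-∘bit z k a c e split) ⟩
  Trunc a (len (a ∘ (bit c ∘ takeEnd z k))) ≐⟨ ≐-cong (Truncᴴ ⌜ a ⌝ ●) (≐-trans (len-∘ a _) (len-∘-comm a _)) ⟩
  Trunc a (len (bit c ∘ takeEnd z k) ∘ len a) ≐⟨ Trunc-padded _ a ⟩
  a ∎

takeEnd-∘bit-∘bit : (z k a : FTm n) (b c : Bool) →
                    E ∣ Γ ⊢ dropEnd z k ≐ a ∘ bit c → E ∣ Γ ⊢ z ≐ dropEnd z k ∘ takeEnd z k →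
                    E ∣ Γ ⊢ takeEnd z (k ∘ bit b) ≐ bit c ∘ takeEnd z k
takeEnd-∘bit-∘bit z k a b c e split =
  takeEnd z (k ∘ bit b)                      ≐⟨ takeEnd-∘bit z k b ⟩
  Trunc (Cond (dropEnd z k) S (`0 ∘ S) (`1 ∘ S)) (len z) ≐⟨ ≐-cong (Truncᴴ ● ⌜ len z ⌝) (move c e) ⟩
  Trunc (bit c ∘ S) (len z)                  ≐⟨ ≐-cong (Truncᴴ-len (bit c ∘ S) ●) (split-∘bit z k a c e split) ⟩
  Trunc (bit c ∘ S) (len (a ∘ (bit c ∘ S)))  ≐⟨ ≐-cong (Truncᴴ ⌜ bit c ∘ S ⌝ ●) (len-∘ a _) ⟩
  Trunc (bit c ∘ S) (len a ∘ len (bit c ∘ S)) ≐⟨ Trunc-padded (len a) _ ⟩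
  bit c ∘ S ∎
  where
  S = takeEnd z k
  move : ∀ {Δ : List (Fm _)} {D} c → E ∣ Δ ⊢ D ≐ a ∘ bit c → E ∣ Δ ⊢ Cond D S (`0 ∘ S) (`1 ∘ S) ≐ bit c ∘ S
  move false = Cond-∘0-≐
  move true  = Cond-∘1-≐

dropEnd-∘-takeEnd : (z k : FTm n) → E ∣ Γ ⊢ z ≐ dropEnd z k ∘ takeEnd z k
dropEnd-∘-takeEnd {E = E} z k = eq-induction v₁ (dropEnd v₁ v₀ ∘ takeEnd v₁ v₀) (params₁ z)
  (conv (≈sym (≈trans (≈app (≈app ≈refl (recε _ _ _ _)) (recε _ _ _ _)) (catεr z))))
  (λ τ y b ih → step (τ here) y b ih) k
  where
  step : ∀ {m} {Δ : List (Fm m)} (z k : FTm m) (b : Bool) → E ∣ Δ ⊢ z ≐ dropEnd z k ∘ takeEnd z k →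
         E ∣ Δ ⊢ z ≐ dropEnd z (k ∘ bit b) ∘ takeEnd z (k ∘ bit b)
  step z k b split = by-shape (dropEnd z k)
    (z                                  ≐⟨ weaken split ⟩
     dropEnd z k ∘ takeEnd z k          ≐⟨ ≐-cong (● ∘ᴴ ⌜ takeEnd z k ⌝) hyp₀ ⟩
     `ε ∘ takeEnd z k                   ≐⟨ ≐-sym (≐-cong (● ∘ᴴ ⌜ takeEnd z k ⌝) (dropEnd-ε-∘bit z k b hyp₀)) ⟩
     dropEnd z (k ∘ bit b) ∘ takeEnd z k
       ≐⟨ ≐-sym (≐-cong (⌜ dropEnd z (k ∘ bit b) ⌝ ∘ᴴ ●) (takeEnd-ε-∘bit z k b hyp₀ (weaken split))) ⟩
     dropEnd z (k ∘ bit b) ∘ takeEnd z (k ∘ bit b) ∎)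
    (nonempty false) (nonempty true)
    where
    nonempty : ∀ c → E ∣ (dropEnd z k ≐ Tail (dropEnd z k) ∘ bit c) ∷ _ ⊢
                         z ≐ dropEnd z (k ∘ bit b) ∘ takeEnd z (k ∘ bit b)
    nonempty c =
      z                                    ≐⟨ split-∘bit z k a c hyp₀ (weaken split) ⟩
      a ∘ (bit c ∘ takeEnd z k)
        ≐⟨ ≐-sym (≐-cong (● ∘ᴴ ⌜ bit c ∘ takeEnd z k ⌝) (dropEnd-∘bit-∘bit z k a b c hyp₀ (weaken split))) ⟩
      dropEnd z (k ∘ bit b) ∘ (bit c ∘ takeEnd z k)
        ≐⟨ ≐-sym (≐-cong (⌜ dropEnd z (k ∘ bit b) ⌝ ∘ᴴ ●) (takeEnd-∘bit-∘bit z k a b c hyp₀ (weaken split))) ⟩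
      dropEnd z (k ∘ bit b) ∘ takeEnd z (k ∘ bit b) ∎
      where a = Tail (dropEnd z k)

takeEnd-length-exhausted : (z k e : FTm n) (b : Bool) → E ∣ Γ ⊢ dropEnd z k ≐ `ε →
                           E ∣ Γ ⊢ len k ≐ len (takeEnd z k) ∘ len e →
                           E ∣ Γ ⊢ len (k ∘ bit b) ≐ len (takeEnd z (k ∘ bit b)) ∘ len (e ∘ `1)
takeEnd-length-exhausted z k e b exhausted ih =
  len (k ∘ bit b)                   ≈⟨ len-∘bit k b ⟩
  len k ∘ `1                        ≐⟨ ≐-cong (● ∘ᴴ ⌜ `1 ⌝) ih ⟩
  (len (takeEnd z k) ∘ len e) ∘ `1  ≐⟨ ≐-sym (∘-assoc _ _ _) ⟩
  len (takeEnd z k) ∘ (len e ∘ `1)  ≈⟨ ≈app ≈refl (≈sym (len-∘bit e true)) ⟩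
  len (takeEnd z k) ∘ len (e ∘ `1)  ≐⟨ ≐-cong (lenᴴ ● ∘ᴴ ⌜ len (e ∘ `1) ⌝)
                                               (≐-sym (takeEnd-ε-∘bit z k b exhausted (dropEnd-∘-takeEnd z k))) ⟩
  len (takeEnd z (k ∘ bit b)) ∘ len (e ∘ `1) ∎

takeEnd-length-running : (z k a : FTm n) (b c : Bool) → E ∣ Γ ⊢ dropEnd z k ≐ a ∘ bit c →
                         E ∣ Γ ⊢ len k ≐ len (takeEnd z k) → E ∣ Γ ⊢ len (k ∘ bit b) ≐ len (takeEnd z (k ∘ bit b))
takeEnd-length-running z k a b c running ih =
  len (k ∘ bit b)             ≈⟨ len-∘bit k b ⟩
  len k ∘ `1                  ≐⟨ ≐-cong (● ∘ᴴ ⌜ `1 ⌝) ih ⟩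
  len (takeEnd z k) ∘ `1      ≐⟨ ≐-sym (1-∘-len-comm _) ⟩
  `1 ∘ len (takeEnd z k)      ≈⟨ ≈app (≈app ≈refl (≈sym (len-bit c))) ≈refl ⟩
  len (bit c) ∘ len (takeEnd z k) ≐⟨ ≐-sym (len-∘ (bit c) _) ⟩
  len (bit c ∘ takeEnd z k)
    ≐⟨ ≐-cong (lenᴴ ●) (≐-sym (takeEnd-∘bit-∘bit z k a b c running (dropEnd-∘-takeEnd z k))) ⟩
  len (takeEnd z (k ∘ bit b)) ∎

TakeEndLength : NPTemplate (fctx 1)
TakeEndLength = record
  { bound = v₀
  ; lhs   = len v₁
  ; rhs   = len (takeEnd v₂ v₁) ∘ Cond (dropEnd v₂ v₁) (len v₀) `ε `ε
  }

∘Cond-ε : ∀ {q l x y : FTm n} → E ∣ Γ ⊢ q ≐ `ε → E ∣ Γ ⊢ l ≐ x ∘ Cond q y `ε `ε → E ∣ Γ ⊢ l ≐ x ∘ y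
∘Cond-ε {x = x} e d = ≐-trans d (≐-cong (⌜ x ⌝ ∘ᴴ ●) (Cond-ε-≐ e))

∘Cond-∘bit : ∀ {q p l x y : FTm n} (c : Bool) →
             E ∣ Γ ⊢ q ≐ p ∘ bit c → E ∣ Γ ⊢ l ≐ x ∘ Cond q y `ε `ε → E ∣ Γ ⊢ l ≐ x
∘Cond-∘bit {x = x} c e d = ≐-trans d (≐-trans (≐-cong (⌜ x ⌝ ∘ᴴ ●) (Cond-∘bit-same c e)) (conv (catεr x)))

takeEnd-length : (z k : FTm n) → E ∣ Γ ⊢ npAt TakeEndLength (params₁ z) k
takeEnd-length {E = E} z k = np-induction TakeEndLength (params₁ z) base step k
  where
  base : E ∣ _ ⊢ npAt TakeEndLength (params₁ z) `ε
  base = np-intro TakeEndLength (params₁ z) `ε `ε len-ε-⊑ (≐-sym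
    (len (takeEnd z `ε) ∘ Cond (dropEnd z `ε) (len `ε) `ε `ε
       ≈⟨ ≈app (≈app ≈refl (≈trans (≈app ≈refl (recε _ _ _ _)) len-ε)) (Cond-≈₂ len-ε) ⟩
     `ε ∘ Cond (dropEnd z `ε) `ε `ε `ε ≐⟨ ≐-cong (⌜ `ε ⌝ ∘ᴴ ●) (Cond-const _ _) ⟩
     `ε ∘ `ε ≈⟨ ≈trans (catεr `ε) (≈sym len-ε) ⟩
     len `ε ∎))
  step : ∀ {m} {Δ : List (Fm m)} (τ : Subst (fctx 1) (fctx m)) (y : FTm m) (b : Bool) →
         E ∣ Δ ⊢ npAt TakeEndLength τ y → E ∣ Δ ⊢ npAt TakeEndLength τ (y ∘ bit b)
  step {Δ = Δ} τ y b ih = np-step TakeEndLength τ y b ih (by-shape (dropEnd Z K) exhausted (running false) (running true))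
    where
    Θ = npBody TakeEndLength τ y ∷ map wkF Δ
    Z K e : FTm _
    Z = wk (τ here)
    K = wk y
    e = var here
    exhausted : E ∣ (dropEnd Z K ≐ `ε) ∷ Θ ⊢ npAt TakeEndLength (wkˢ τ) (K ∘ bit b)
    exhausted = np-intro TakeEndLength (wkˢ τ) (K ∘ bit b) (e ∘ `1)
      (Sub⇒⊑ (≐-trans (≐-cong (Subᴴ ⌜ len (e ∘ `1) ⌝ ●) (≐-trans grown (len-∘-comm _ _))) (Sub-∘ _ _)))
      (≐-trans grown (≐-cong (⌜ len (takeEnd Z (K ∘ bit b)) ⌝ ∘ᴴ ●)
                             (≐-sym (Cond-ε-≐ (dropEnd-ε-∘bit Z K b hyp₀)))))
      where
      grown = takeEnd-length-exhausted Z K e b hyp₀ (∘Cond-ε hyp₀ (∧E₂ hyp₁))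
    running : ∀ c → E ∣ (dropEnd Z K ≐ Tail (dropEnd Z K) ∘ bit c) ∷ Θ ⊢ npAt TakeEndLength (wkˢ τ) (K ∘ bit b)
    running c = np-intro TakeEndLength (wkˢ τ) (K ∘ bit b) `ε
      (Sub⇒⊑ (≐-trans (conv (≈app (≈app ≈refl len-ε) ≈refl)) (Sub-ε _)))
      (len (K ∘ bit b) ≐⟨ takeEnd-length-running Z K _ b c hyp₀ (∘Cond-∘bit c hyp₀ (∧E₂ hyp₁)) ⟩
       len S′ ≈⟨ ≈sym (catεr _) ⟩
       len S′ ∘ `ε ≐⟨ ≐-cong (⌜ len S′ ⌝ ∘ᴴ ●) (≐-sym (≐-trans (conv (Cond-≈₂ len-ε)) (Cond-const _ _))) ⟩
       len S′ ∘ Cond (dropEnd Z (K ∘ bit b)) (len `ε) `ε `ε ∎)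
      where S′ = takeEnd Z (K ∘ bit b)

≢-prepend : ∀ {x y : FTm n} {A} (b : Bool) → E ∣ Γ ⊢ x ≐ (y ∘ bit b) ∘ x → E ∣ Γ ⊢ A
≢-prepend {x = x} {y} b e = ex-falso
  (`0                            ≈⟨ ≈sym (eqεb y b) ⟩
   Eq `ε (y ∘ bit b)             ≐⟨ ≐-sym (Eq-∘-cancelʳ `ε _ x) ⟩
   Eq (`ε ∘ x) ((y ∘ bit b) ∘ x) ≈⟨ ≈app (≈app ≈refl (catεl x)) ≈refl ⟩
   Eq x ((y ∘ bit b) ∘ x)        ≐⟨ ≐-sym (≐-cong (Eqᴴ ⌜ x ⌝ ●) e) ⟩
   Eq x x                        ≐⟨ Eq-refl x ⟩
   `1 ∎)

Trunc-len≐takeEnd : (z k : FTm n) → E ∣ Γ ⊢ Trunc z (len k) ≐ takeEnd z k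
Trunc-len≐takeEnd {E = E} {Γ = Γ} z k =
  ∃E (takeEnd-length z k) (cast (cong (Trunc Z (len K) ≐_) (sym (takeEnd-subst _ z k)))
     (by-shape (dropEnd Z K) exhausted (running false) (running true)))
  where
  Z K e : FTm _
  Z = wk z
  K = wk k
  e = var here
  S = takeEnd Z K
  Θ = npBody TakeEndLength (params₁ z) k ∷ map wkF Γ
  exhausted : E ∣ (dropEnd Z K ≐ `ε) ∷ Θ ⊢ Trunc Z (len K) ≐ S
  exhausted =
    Trunc Z (len K)           ≐⟨ ≐-cong (Truncᴴ ● ⌜ len K ⌝)
                                        (≐-trans (dropEnd-∘-takeEnd Z K) (≐-cong (● ∘ᴴ ⌜ S ⌝) hyp₀)) ⟩
    Trunc (`ε ∘ S) (len K)    ≈⟨ ≈app (≈app ≈refl (catεl S)) ≈refl ⟩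
    Trunc S (len K)           ≐⟨ ≐-cong (Truncᴴ ⌜ S ⌝ ●) (∘Cond-ε hyp₀ (∧E₂ hyp₁)) ⟩
    Trunc S (len S ∘ len e)   ≐⟨ ≐-cong (Truncᴴ ⌜ S ⌝ ●) (len-∘-comm _ _) ⟩
    Trunc S (len e ∘ len S)   ≐⟨ Trunc-padded _ S ⟩
    S ∎
  running : ∀ c → E ∣ (dropEnd Z K ≐ Tail (dropEnd Z K) ∘ bit c) ∷ Θ ⊢ Trunc Z (len K) ≐ S
  running c =
    Trunc Z (len K)                ≐⟨ ≐-cong (Truncᴴ ● ⌜ len K ⌝) (dropEnd-∘-takeEnd Z K) ⟩
    Trunc (dropEnd Z K ∘ S) (len K)
      ≐⟨ ≐-cong (Truncᴴ ⌜ dropEnd Z K ∘ S ⌝ ●) (∘Cond-∘bit c hyp₀ (∧E₂ hyp₁)) ⟩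
    Trunc (dropEnd Z K ∘ S) (len S) ≐⟨ Trunc-suffix _ S ⟩
    S ∎

dropEnd-exhausted : (z k q : FTm n) → E ∣ Γ ⊢ (len k ≐ len q ∘ len z) ⊃ (dropEnd z k ≐ `ε)
dropEnd-exhausted {E = E} {Γ = Γ} z k q =
  ∃E (takeEnd-length z k) (cast (cong (λ t → (len K ≐ len Q ∘ len Z) ⊃ (t ≐ `ε)) (sym (dropEnd-subst _ z k)))
     (⊃I (by-shape (dropEnd Z K) hyp₀ (running false) (running true))))
  where
  Z K Q : FTm _
  Z = wk z
  K = wk k
  Q = wk q
  S = takeEnd Z K
  D = dropEnd Z K
  Θ = (len K ≐ len Q ∘ len Z) ∷ npBody TakeEndLength (params₁ z) k ∷ map wkF Γ
  running : ∀ c → E ∣ (D ≐ Tail D ∘ bit c) ∷ Θ ⊢ D ≐ `ε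
  running c = ≢-prepend true
    (len Z ≐⟨ ≐-cong (lenᴴ ●) (dropEnd-∘-takeEnd Z K) ⟩
     len (D ∘ S) ≐⟨ len-∘ _ _ ⟩
     len D ∘ len S ≐⟨ ≐-cong (⌜ len D ⌝ ∘ᴴ ●) (≐-sym (∘Cond-∘bit c hyp₀ (∧E₂ hyp₂))) ⟩
     len D ∘ len K ≐⟨ ≐-cong (⌜ len D ⌝ ∘ᴴ ●) hyp₁ ⟩
     len D ∘ (len Q ∘ len Z) ≐⟨ ∘-assoc _ _ _ ⟩
     (len D ∘ len Q) ∘ len Z ≐⟨ ≐-cong (● ∘ᴴ ⌜ len Z ⌝) (len-∘-comm _ _) ⟩
     (len Q ∘ len D) ∘ len Z ≐⟨ ≐-cong ((⌜ len Q ⌝ ∘ᴴ lenᴴ ●) ∘ᴴ ⌜ len Z ⌝) hyp₀ ⟩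
     (len Q ∘ len (Tail D ∘ bit c)) ∘ len Z ≈⟨ ≈app (≈app ≈refl (≈app ≈refl (len-∘bit (Tail D) c))) ≈refl ⟩
     (len Q ∘ (len (Tail D) ∘ `1)) ∘ len Z ≐⟨ ≐-cong (● ∘ᴴ ⌜ len Z ⌝) (∘-assoc _ _ _) ⟩
     ((len Q ∘ len (Tail D)) ∘ `1) ∘ len Z ∎)

-- Soundness of the equality test

sameDrop : ∀ {Γ} → Tm Γ ι → Tm Γ ι → Tm Γ ι → Tm Γ ι
sameDrop x y k = endsIn1 (Eq (dropEnd x k) (dropEnd y k))

sameDrop-≐ : ∀ {x y k X Y : FTm n} → E ∣ Γ ⊢ dropEnd x k ≐ X → E ∣ Γ ⊢ dropEnd y k ≐ Y →
             E ∣ Γ ⊢ sameDrop x y k ≐ endsIn1 (Eq X Y)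
sameDrop-≐ {y = y} {k} {X} ex ey =
  ≐-trans (≐-cong (endsIn1ᴴ (Eqᴴ ● ⌜ dropEnd y k ⌝)) ex) (≐-cong (endsIn1ᴴ (Eqᴴ ⌜ X ⌝ ●)) ey)

sameDrop-absurd : ∀ {x y k X Y : FTm n} → E ∣ Γ ⊢ sameDrop x y k ≐ `1 →
                  E ∣ Γ ⊢ dropEnd x k ≐ X → E ∣ Γ ⊢ dropEnd y k ≐ Y → Eq X Y ≈ `0 → E ∣ Γ ⊢ A
sameDrop-absurd d ex ey c =
  ex-falso (≐-trans (≐-sym (≐-trans (sameDrop-≐ ex ey) (conv (≈trans (Cond-≈₁ c) (Cond-0 _ _ _))))) d)

sameDrop-∘bit : (x y k : FTm n) (b : Bool) → E ∣ Γ ⊢ sameDrop x y k ≐ `1 → E ∣ Γ ⊢ takeEnd x k ≐ takeEnd y k →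
                E ∣ Γ ⊢ (sameDrop x y (k ∘ bit b) ≐ `1) ∧ᶠ (takeEnd x (k ∘ bit b) ≐ takeEnd y (k ∘ bit b))
sameDrop-∘bit {E = E} {Γ = Γ} x y k b same takes = by-shape (dropEnd x k)
  (by-shape (dropEnd y k) both-empty (absurd (eqεb _ false)) (absurd (eqεb _ true)))
  (by-shape (dropEnd y k) (absurd (eqbε _ false)) (both-∘bit false false) (both-∘bit false true))
  (by-shape (dropEnd y k) (absurd (eqbε _ true)) (both-∘bit true false) (both-∘bit true true))
  where
  Goal = (sameDrop x y (k ∘ bit b) ≐ `1) ∧ᶠ (takeEnd x (k ∘ bit b) ≐ takeEnd y (k ∘ bit b))
  absurd : ∀ {X Y B} → Eq X Y ≈ `0 → E ∣ (dropEnd y k ≐ Y) ∷ (dropEnd x k ≐ X) ∷ Γ ⊢ B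
  absurd c = sameDrop-absurd (weaken (weaken same)) hyp₁ hyp₀ c
  both-empty : E ∣ (dropEnd y k ≐ `ε) ∷ (dropEnd x k ≐ `ε) ∷ Γ ⊢ Goal
  both-empty = ∧I
    (≐-trans (sameDrop-≐ (dropEnd-ε-∘bit x k b hyp₁) (dropEnd-ε-∘bit y k b hyp₀))
             (conv (≈trans (Cond-≈₁ eqεε) (Cond-1 _ _ _))))
    (takeEnd x (k ∘ bit b) ≐⟨ takeEnd-ε-∘bit x k b hyp₁ (dropEnd-∘-takeEnd x k) ⟩
     takeEnd x k           ≐⟨ weaken (weaken takes) ⟩
     takeEnd y k           ≐⟨ ≐-sym (takeEnd-ε-∘bit y k b hyp₀ (dropEnd-∘-takeEnd y k)) ⟩
     takeEnd y (k ∘ bit b) ∎)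
  same-last : ∀ c →
              E ∣ (dropEnd y k ≐ Tail (dropEnd y k) ∘ bit c) ∷ (dropEnd x k ≐ Tail (dropEnd x k) ∘ bit c) ∷ Γ ⊢ Goal
  same-last c = ∧I
    (sameDrop x y (k ∘ bit b)        ≐⟨ sameDrop-≐ (dropEnd-∘bit-∘bit x k _ b c hyp₁ (dropEnd-∘-takeEnd x k))
                                                   (dropEnd-∘bit-∘bit y k _ b c hyp₀ (dropEnd-∘-takeEnd y k)) ⟩
     endsIn1 (Eq x′ y′)              ≈⟨ Cond-≈₁ (≈sym (eqbb _ _ c)) ⟩
     endsIn1 (Eq (x′ ∘ bit c) (y′ ∘ bit c)) ≐⟨ ≐-sym (sameDrop-≐ hyp₁ hyp₀) ⟩
     sameDrop x y k                  ≐⟨ weaken (weaken same) ⟩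
     `1 ∎)
    (takeEnd x (k ∘ bit b)  ≐⟨ takeEnd-∘bit-∘bit x k _ b c hyp₁ (dropEnd-∘-takeEnd x k) ⟩
     bit c ∘ takeEnd x k    ≐⟨ ≐-cong (⌜ bit c ⌝ ∘ᴴ ●) (weaken (weaken takes)) ⟩
     bit c ∘ takeEnd y k    ≐⟨ ≐-sym (takeEnd-∘bit-∘bit y k _ b c hyp₀ (dropEnd-∘-takeEnd y k)) ⟩
     takeEnd y (k ∘ bit b)  ∎)
    where
    x′ = Tail (dropEnd x k)
    y′ = Tail (dropEnd y k)
  both-∘bit : ∀ c c′ →
              E ∣ (dropEnd y k ≐ Tail (dropEnd y k) ∘ bit c′) ∷ (dropEnd x k ≐ Tail (dropEnd x k) ∘ bit c) ∷ Γ ⊢ Goal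
  both-∘bit false false = same-last false
  both-∘bit true  true  = same-last true
  both-∘bit false true  = absurd (eq01 _ _)
  both-∘bit true  false = absurd (eq10 _ _)

-- g = 1 → (s = 1 ∧ t = t′) as a single equation: if g = 1 and s = 0, its sides are 0 and 1.
Guarded : FTm n → FTm n → FTm n → FTm n → Fm n
Guarded g s t t′ = g ∧ᵗ (s ∧ᵗ t) ≐ g ∧ᵗ Cond s `1 `1 t′

Guarded-off : ∀ {g s t t′ : FTm n} → E ∣ Γ ⊢ g ≐ `0 → E ∣ Γ ⊢ Guarded g s t t′
Guarded-off = ∧ᵗ-0

Guarded-on : ∀ {g s t t′ : FTm n} → E ∣ Γ ⊢ s ≐ `1 → E ∣ Γ ⊢ t ≐ t′ → E ∣ Γ ⊢ Guarded g s t t′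
Guarded-on es et = ∧ᵗ-congʳ (≐-trans (Cond-1-≐ es) (≐-trans et (≐-sym (Cond-1-≐ es))))

Guarded-elim : ∀ {g s t t′ : FTm n} → E ∣ Γ ⊢ IsBit s → E ∣ Γ ⊢ g ≐ `1 → E ∣ Γ ⊢ Guarded g s t t′ →
               E ∣ Γ ⊢ (s ≐ `1) ∧ᶠ (t ≐ t′)
Guarded-elim bs eg d = ∨E bs
  (ex-falso (≐-trans (≐-sym (Cond-0-≐ hyp₀)) (≐-trans (∧ᵗ-cancelˡ (weaken eg) (weaken d)) (Cond-0-≐ hyp₀))))
  (∧I hyp₀ (≐-trans (≐-sym (Cond-1-≐ hyp₀)) (≐-trans (∧ᵗ-cancelˡ (weaken eg) (weaken d)) (Cond-1-≐ hyp₀))))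

Eq-invariant : (x y k : FTm n) → E ∣ Γ ⊢ Guarded (endsIn1 (Eq x y)) (sameDrop x y k) (takeEnd x k) (takeEnd y k)
Eq-invariant x y k = eq-induction
  (Cond (endsIn1 (Eq v₁ v₂)) `0 `0 (Cond (sameDrop v₁ v₂ v₀) `0 `0 (takeEnd v₁ v₀)))
  (Cond (endsIn1 (Eq v₁ v₂)) `0 `0 (Cond (sameDrop v₁ v₂ v₀) `1 `1 (takeEnd v₂ v₀)))
  (params₂ x y)
  (∨E (endsIn1-isBit (Eq x y)) (Guarded-off hyp₀)
      (Guarded-on (≐-trans (conv (Cond-≈₁ (≈app (≈app ≈refl (recε _ _ _ _)) (recε _ _ _ _)))) hyp₀)
                       (conv (≈trans (recε _ _ _ _) (≈sym (recε _ _ _ _))))))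
  (λ τ k b ih → step (τ here) (τ (there here)) k b ih) k
  where
  step : ∀ {m} {Δ : List (Fm m)} (x y k : FTm m) (b : Bool) →
         E ∣ Δ ⊢ Guarded (endsIn1 (Eq x y)) (sameDrop x y k) (takeEnd x k) (takeEnd y k) →
         E ∣ Δ ⊢ Guarded (endsIn1 (Eq x y)) (sameDrop x y (k ∘ bit b)) (takeEnd x (k ∘ bit b)) (takeEnd y (k ∘ bit b))
  step x y k b ih = ∨E (endsIn1-isBit (Eq x y)) (Guarded-off hyp₀)
    (Guarded-on (∧E₁ next) (∧E₂ next))
    where
    next = sameDrop-∘bit x y k b (∧E₁ now) (∧E₂ now)
      where now = Guarded-elim (endsIn1-isBit _) hyp₀ (weaken ih)

Eq-sound : ∀ {x y : FTm n} → E ∣ Γ ⊢ endsIn1 (Eq x y) ≐ `1 → E ∣ Γ ⊢ x ≐ y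
Eq-sound {x = x} {y} d =
  x                     ≐⟨ dropEnd-∘-takeEnd x k ⟩
  dropEnd x k ∘ takeEnd x k ≐⟨ ≐-cong (● ∘ᴴ ⌜ takeEnd x k ⌝) x-used-up ⟩
  `ε ∘ takeEnd x k      ≐⟨ ≐-cong (⌜ `ε ⌝ ∘ᴴ ●) (∧E₂ (Guarded-elim (endsIn1-isBit _) d (Eq-invariant x y k))) ⟩
  `ε ∘ takeEnd y k      ≐⟨ ≐-sym (≐-cong (● ∘ᴴ ⌜ takeEnd y k ⌝) y-used-up) ⟩
  dropEnd y k ∘ takeEnd y k ≐⟨ ≐-sym (dropEnd-∘-takeEnd y k) ⟩
  y ∎
  where
  k = x ∘ y
  x-used-up = ⊃E (dropEnd-exhausted x k y) (≐-trans (len-∘ x y) (len-∘-comm x y))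
  y-used-up = ⊃E (dropEnd-exhausted y k x) (len-∘ x y)

Eq-complete : ∀ {x y : FTm n} → E ∣ Γ ⊢ x ≐ y → E ∣ Γ ⊢ endsIn1 (Eq x y) ≐ `1
Eq-complete {x = x} e = ≐-trans (≐-cong (endsIn1ᴴ (Eqᴴ ⌜ x ⌝ ●)) (≐-sym e))
                                (≐-trans (≐-cong (endsIn1ᴴ ●) (Eq-refl x)) (conv (Cond-1 _ _ _)))

-- Searching the prefixes of a string

-- p ⇒₁ x = 1 expresses p = 1 → x = 1 as an equation.
infixr 7 _⇒₁_
_⇒₁_ : ∀ {Γ} → Tm Γ ι → Tm Γ ι → Tm Γ ι
p ⇒₁ x = Cond (isOne p) `1 `1 x

⇒₁-intro : ∀ {p x : FTm n} → E ∣ (p ≐ `1) ∷ Γ ⊢ x ≐ `1 → E ∣ Γ ⊢ p ⇒₁ x ≐ `1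
⇒₁-intro {p = p} d =
  ∨E (isOne-isBit p) (Cond-0-≐ hyp₀) (≐-trans (Cond-1-≐ hyp₀) (⊃E (weaken (⊃I d)) (isOne-sound hyp₀)))

⇒₁-elim : ∀ {p x : FTm n} → E ∣ Γ ⊢ p ⇒₁ x ≐ `1 → E ∣ Γ ⊢ p ≐ `1 → E ∣ Γ ⊢ x ≐ `1
⇒₁-elim d e = ≐-trans (≐-sym (Cond-1-≐ (isOne-complete e))) d

searchStep : ∀ {Γ} → Bool → Tm Γ (ι ⇒ ι) → Tm Γ (ι ⇒ ι ⇒ ι)
searchStep b g = lam (lam (Cond (var here) `0 (isOne (rename there (rename there g) · (var (there here) ∘ bit b))) `1))

search : ∀ {Γ} → Tm Γ (ι ⇒ ι) → Tm Γ ι → Tm Γ ι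
search g s = Rec (isOne (g · `ε)) (searchStep false g) (searchStep true g) (lam `1) s

search-subst : ∀ {Γ Δ} (σ : Subst Γ Δ) (g : Tm Γ (ι ⇒ ι)) (s : Tm Γ ι) →
               subst σ (search g s) ≡ search (subst σ g) (subst σ s)
search-subst σ g s = cong₂ (λ h₀ h₁ → Rec (isOne (subst σ g · `ε)) h₀ h₁ (lam `1) (subst σ s))
                           (searchStep-subst false) (searchStep-subst true)
  where
  searchStep-subst : ∀ b → subst σ (searchStep b g) ≡ searchStep b (subst σ g)
  searchStep-subst b = cong₂ (λ h c → lam (lam (Cond (var here) `0 (isOne (h · (var (there here) ∘ c))) `1)))
    (trans (subst-extS-rename (extS σ) (rename there g)) (cong (rename there) (subst-extS-rename σ g)))
    (subst-bit (extS (extS σ)) b)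

searchᴴ : Tm (fctx n) (ι ⇒ ι) → Frame n ι → Frame n ι
searchᴴ g s = ⌜ con cRec ⌝ $ ⌜ isOne (g · `ε) ⌝ $ ⌜ searchStep false g ⌝ $ ⌜ searchStep true g ⌝ $ ⌜ lam `1 ⌝ $ s

search-ε : ∀ {Γ} (g : Tm Γ (ι ⇒ ι)) → search g `ε ≈ isOne (g · `ε)
search-ε g = recε _ _ _ _

search-∘bit-≈ : (g : Tm (fctx n) (ι ⇒ ι)) (s : FTm n) (b : Bool) →
                search g (s ∘ bit b) ≈ Trunc (Cond (search g s) `0 (isOne (g · (s ∘ bit b))) `1) `1
search-∘bit-≈ g s b = ≈trans (recb _ _ _ _ s b) (≈app (≈app ≈refl (searchStep-β b)) (≈β _ s))
  where
  S = search g s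
  body : Bool → Tm (ι ∷ ι ∷ fctx _) ι
  body b = Cond (var here) `0 (isOne (rename there (rename there g) · (var (there here) ∘ bit b))) `1
  body-inst : ∀ b → subst (extS (σ₀ s)) (body b) [ S ] ≡ Cond S `0 (isOne (g · (s ∘ bit b))) `1
  body-inst b = trans ([]-extS (σ₀ s) (body b) S)
    (cong₂ (λ h c → Cond S `0 (isOne (h · (s ∘ c))) `1)
           (trans (subst-rename _ there (rename there g)) ([]-rename g s)) (subst-bit _ b))
  searchStep-β : ∀ b → selB b (searchStep false g) (searchStep true g) · s · S ≈ Cond S `0 (isOne (g · (s ∘ bit b))) `1
  searchStep-β false = ≈trans (≈app (≈β _ s) ≈refl) (≈trans (≈β _ S) (≡⇒≈ (body-inst false)))
  searchStep-β true  = ≈trans (≈app (≈β _ s) ≈refl) (≈trans (≈β _ S) (≡⇒≈ (body-inst true)))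

search-∘bit : (g : Tm (fctx n) (ι ⇒ ι)) (s : FTm n) (b : Bool) →
              E ∣ Γ ⊢ search g (s ∘ bit b) ≐ Cond (search g s) `0 (isOne (g · (s ∘ bit b))) `1
search-∘bit g s b = ≐-trans (conv (search-∘bit-≈ g s b)) (Trunc-1-bit (Cond-isBit (search g s) (isOne-isBit _)))

search-isBit : (g : Tm (fctx n) (ι ⇒ ι)) (s : FTm n) → E ∣ Γ ⊢ IsBit (search g s)
search-isBit g s = by-shape s
  (IsBit-resp (≐-trans (≐-cong (searchᴴ g ●) hyp₀) (conv (search-ε g))) (isOne-isBit _))
  (IsBit-resp (≐-trans (≐-cong (searchᴴ g ●) hyp₀) (search-∘bit g _ false)) (Cond-isBit _ (isOne-isBit _)))
  (IsBit-resp (≐-trans (≐-cong (searchᴴ g ●) hyp₀) (search-∘bit g _ true)) (Cond-isBit _ (isOne-isBit _)))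

search-invariant : (g : Tm (fctx n) (ι ⇒ ι)) (j s : FTm n) → E ∣ Γ ⊢ Sub j s ⇒₁ g · j ⇒₁ search g s ≐ `1
search-invariant {E = E} g j s = eq-induction (Sub J (var here) ⇒₁ G · J ⇒₁ search G (var here)) `1 (∅ˢ ,, g ,, j)
  (⇒₁-intro (⇒₁-intro
    (search g `ε      ≈⟨ search-ε g ⟩
     isOne (g · `ε)   ≐⟨ ≐-cong (isOneᴴ (⌜ g ⌝ $ ●)) (≐-sym (Sub-ε≐1 hyp₁)) ⟩
     isOne (g · j)    ≐⟨ isOne-complete hyp₀ ⟩
     `1 ∎)))
  (λ τ s b ih → step (τ (there here)) (τ here) s b ih) s
  where
  J : Tm (ι ∷ ι ∷ (ι ⇒ ι) ∷ []) ι
  J = var (there here)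
  G : Tm (ι ∷ ι ∷ (ι ⇒ ι) ∷ []) (ι ⇒ ι)
  G = var (there (there here))
  step : ∀ {m} {Δ : List (Fm m)} (g : Tm (fctx m) (ι ⇒ ι)) (j s : FTm m) (b : Bool) →
         E ∣ Δ ⊢ Sub j s ⇒₁ g · j ⇒₁ search g s ≐ `1 →
         E ∣ Δ ⊢ Sub j (s ∘ bit b) ⇒₁ g · j ⇒₁ search g (s ∘ bit b) ≐ `1
  step g j s b ih = ⇒₁-intro (⇒₁-intro
    (∨E (BOr≐1-cases (Sub-isBitOrε j s) (≐-trans (conv (≈sym (subb j s b))) hyp₁))
      (≐-trans (search-∘bit g s b) (Cond-1-≐ (⇒₁-elim (⇒₁-elim (weaken (weaken (weaken ih))) hyp₀) hyp₁)))
      (≐-trans (search-∘bit g s b) (∨E (search-isBit g s)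
        (≐-trans (Cond-0-≐ hyp₀)
          (≐-trans (≐-cong (isOneᴴ (⌜ g ⌝ $ ●)) (≐-sym (Eq-sound hyp₁))) (isOne-complete hyp₂)))
        (Cond-1-≐ hyp₀)))))

search-complete : ∀ {g : Tm (fctx n) (ι ⇒ ι)} {j s : FTm n} →
                  E ∣ Γ ⊢ Sub j s ≐ `1 → E ∣ Γ ⊢ g · j ≐ `1 → E ∣ Γ ⊢ search g s ≐ `1
search-complete {g = g} {j} {s} d e = ⇒₁-elim (⇒₁-elim (search-invariant g j s) d) e

FoundBody : Tm (fctx n) (ι ⇒ ι) → FTm n → Fm (suc n)
FoundBody g s = (Sub (var here) (wk s) ≐ `1) ∧ᶠ (wk g · var here ≐ `1)

Found : Tm (fctx n) (ι ⇒ ι) → FTm n → Fm n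
Found g s = ∃ᶠ (FoundBody g s)

Found-subst : ∀ {m} (σ : Subst (fctx n) (fctx m)) (g : Tm (fctx n) (ι ⇒ ι)) (s : FTm n) →
              substF σ (Found g s) ≡ Found (subst σ g) (subst σ s)
Found-subst σ g s =
  cong₂ (λ t h → ∃ᶠ ((Sub (var here) t ≐ `1) ∧ᶠ (h · var here ≐ `1))) (subst-extS-wk σ s) (subst-extS-wk σ g)

-- search g s = 1 → (j is a prefix of s ∧ g j = 1), for some j ⪯ s.
SearchWitness : NPTemplate ((ι ⇒ ι) ∷ [])
SearchWitness = record
  { bound = var here
  ; lhs   = search G s ∧ᵗ (isOne (Sub j s) ∧ᵗ isOne (G · j))
  ; rhs   = search G s ∧ᵗ `1
  }
  where
  j s : Tm (ι ∷ ι ∷ (ι ⇒ ι) ∷ []) ι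
  j = var here
  s = var (there here)
  G : Tm (ι ∷ ι ∷ (ι ⇒ ι) ∷ []) (ι ⇒ ι)
  G = var (there (there here))

search-witness : (g : Tm (fctx n) (ι ⇒ ι)) (s : FTm n) → E ∣ Γ ⊢ npAt SearchWitness (∅ˢ ,, g) s
search-witness {E = E} g s = np-induction SearchWitness (∅ˢ ,, g) base step s
  where
  base : E ∣ _ ⊢ npAt SearchWitness (∅ˢ ,, g) `ε
  base = np-intro SearchWitness (∅ˢ ,, g) `ε `ε len-ε-⊑
    (∨E (isOne-isBit (g · `ε)) (∧ᵗ-0 (≐-trans (conv (search-ε g)) hyp₀))
        (∧ᵗ-congʳ (∧ᵗ-intro (isOne-complete (Sub-refl `ε)) hyp₀)))
  step : ∀ {m} {Δ : List (Fm m)} (τ : Subst ((ι ⇒ ι) ∷ []) (fctx m)) (y : FTm m) (b : Bool) →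
         E ∣ Δ ⊢ npAt SearchWitness τ y → E ∣ Δ ⊢ npAt SearchWitness τ (y ∘ bit b)
  step {Δ = Δ} τ y b ih = np-step SearchWitness τ y b ih (∨E (search-isBit G y′) not-yet already)
    where
    G : Tm (fctx _) (ι ⇒ ι)
    G = wk (τ here)
    y′ j : FTm _
    y′ = wk y
    j = var here
    Θ = npBody SearchWitness τ y ∷ map wkF Δ
    not-yet : E ∣ (search G y′ ≐ `0) ∷ Θ ⊢ npAt SearchWitness (wkˢ τ) (y′ ∘ bit b)
    not-yet = ∨E (isOne-isBit (G · (y′ ∘ bit b)))
      (np-intro SearchWitness (wkˢ τ) (y′ ∘ bit b) `ε
        (Sub⇒⊑ (≐-trans (conv (≈app (≈app ≈refl len-ε) ≈refl)) (Sub-ε _)))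
        (∧ᵗ-0 (≐-trans (search-∘bit G y′ b) (≐-trans (Cond-0-≐ hyp₁) hyp₀))))
      (np-intro SearchWitness (wkˢ τ) (y′ ∘ bit b) (y′ ∘ bit b) (Sub⇒⊑ (Sub-refl _))
        (∧ᵗ-congʳ (∧ᵗ-intro (isOne-complete (Sub-refl _)) hyp₀)))
    already : E ∣ (search G y′ ≐ `1) ∷ Θ ⊢ npAt SearchWitness (wkˢ τ) (y′ ∘ bit b)
    already = np-intro SearchWitness (wkˢ τ) (y′ ∘ bit b) j
      (Sub⇒⊑ (≐-trans (conv (≈app ≈refl (len-∘bit y′ b)))
                      (Sub-∘bit true (⊑⇒Sub (cast (cong (λ t → len j ⊑ len t) (sym (wk≡rename y))) (∧E₁ hyp₁))))))
      (∧ᵗ-congʳ (∧ᵗ-intro (isOne-complete (Sub-∘bit b (isOne-sound (∧E₁ found)))) (∧E₂ found)))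
      where
      found = ∧ᵗ-elim (isOne-isBit _) (∧ᵗ-cancelˡ hyp₀ (∧E₂ hyp₁))

search-sound : ∀ {g : Tm (fctx n) (ι ⇒ ι)} {s : FTm n} → E ∣ Γ ⊢ search g s ≐ `1 → E ∣ Γ ⊢ Found g s
search-sound {E = E} {Γ = Γ} {g} {s} = ⊃E (∃E (search-witness g s) (cast (sym wkF-eq) (⊃I found)))
  where
  G : Tm (fctx _) (ι ⇒ ι)
  G = wk g
  s′ j : FTm _
  s′ = wk s
  j = var here
  wkF-eq : wkF ((search g s ≐ `1) ⊃ Found g s) ≡ ((search G s′ ≐ `1) ⊃ Found G s′)
  wkF-eq = cong₂ (λ a F → (a ≐ `1) ⊃ F) (search-subst _ g s) (Found-subst _ g s)
  found : E ∣ (search G s′ ≐ `1) ∷ npBody SearchWitness (∅ˢ ,, g) s ∷ map wkF Γ ⊢ Found G s′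
  found = ∃I j (cast (sym (cong₂ (λ t h → (Sub j t ≐ `1) ∧ᶠ (h · j ≐ `1)) ([]-wk s′ j) ([]-wk G j)))
                     (∧I (isOne-sound (∧E₁ witness)) (isOne-sound (∧E₂ witness))))
    where witness = ∧ᵗ-elim (isOne-isBit _) (∧ᵗ-cancelˡ hyp₀ (∧E₂ hyp₁))

Sub-shorten : ∀ {a b t : FTm n} → E ∣ Γ ⊢ Sub (a ∘ b) t ≐ `1 → E ∣ Γ ⊢ Sub a t ≐ `1
Sub-shorten {E = E} {a = a} {b} {t} = ⇒₁-elim (eq-induction (Sub (v₁ ∘ v₂) v₀ ⇒₁ Sub v₁ v₀) `1 (params₂ a b)
  (⇒₁-intro (≐-trans (≐-cong (Subᴴ ● ⌜ `ε ⌝) (a≐ε (Sub-ε≐1 hyp₀))) (Sub-refl `ε)))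
  (λ τ t c ih → step (τ here) (τ (there here)) t c ih) t)
  where
  a≐ε : ∀ {Δ : List (Fm _)} → E ∣ Δ ⊢ a ∘ b ≐ `ε → E ∣ Δ ⊢ a ≐ `ε
  a≐ε d = by-shape b
    (≐-trans (conv (≈sym (catεr a))) (≐-trans (≐-sym (≐-cong (⌜ a ⌝ ∘ᴴ ●) hyp₀)) (weaken d)))
    (ε≠∘bit false (≐-trans (≐-sym (weaken d)) (≐-trans (≐-cong (⌜ a ⌝ ∘ᴴ ●) hyp₀) (conv (catb a _ false)))))
    (ε≠∘bit true (≐-trans (≐-sym (weaken d)) (≐-trans (≐-cong (⌜ a ⌝ ∘ᴴ ●) hyp₀) (conv (catb a _ true)))))
  step : ∀ {m} {Δ : List (Fm m)} (a b t : FTm m) (c : Bool) →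
         E ∣ Δ ⊢ Sub (a ∘ b) t ⇒₁ Sub a t ≐ `1 → E ∣ Δ ⊢ Sub (a ∘ b) (t ∘ bit c) ⇒₁ Sub a (t ∘ bit c) ≐ `1
  step a b t c ih = ⇒₁-intro (∨E (BOr≐1-cases (Sub-isBitOrε (a ∘ b) t) (≐-trans (conv (≈sym (subb (a ∘ b) t c))) hyp₀))
    (Sub-∘bit c (⇒₁-elim (weaken (weaken ih)) hyp₀))
    (≐-trans (≐-cong (Subᴴ ⌜ a ⌝ ●) (≐-sym (Eq-sound hyp₀))) (Sub-∘ a b)))

-- Bounded subword quantifiers

truncSubst : ∀ {Γ} → Tm Γ ι → Subst (ι ∷ Γ) (ι ∷ Γ)
truncSubst v here      = Trunc (rename there v) (len (var here))
truncSubst v (there x) = var (there x)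

suffixTest : ∀ {Γ} → Tm (ι ∷ Γ) ι → Tm Γ ι → Tm Γ (ι ⇒ ι)
suffixTest c v = lam (subst (truncSubst v) c)

skip₁ : ∀ {Γ} → Subst (ι ∷ Γ) (ι ∷ ι ∷ Γ)
skip₁ here      = var here
skip₁ (there x) = var (there (there x))

prefixTest : ∀ {Γ} → Tm (ι ∷ Γ) ι → Tm Γ (ι ⇒ ι)
prefixTest c = lam (search (suffixTest (subst skip₁ c) (var here)) (len (var here)))

boundedSearch : ∀ {Γ} → Tm Γ ι → Tm (ι ∷ Γ) ι → Tm Γ ι
boundedSearch T c = search (prefixTest c) T

suffixTest-subst : ∀ {Γ Δ} (σ : Subst Γ Δ) (c : Tm (ι ∷ Γ) ι) (v : Tm Γ ι) →
                   subst σ (suffixTest c v) ≡ suffixTest (subst (extS σ) c) (subst σ v)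
suffixTest-subst σ c v = cong lam (trans (subst-subst (extS σ) (truncSubst v) c)
                                  (trans (subst-cong commute c) (sym (subst-subst (truncSubst (subst σ v)) (extS σ) c))))
  where
  commute : extS σ ∘ˢ truncSubst v ≗ˢ truncSubst (subst σ v) ∘ˢ extS σ
  commute here      = cong (λ q → Trunc q (len (var here))) (subst-extS-rename σ v)
  commute (there x) = trans (sym (wk≡rename (σ x))) (sym (subst-rename (truncSubst (subst σ v)) there (σ x)))

prefixTest-subst : ∀ {Γ Δ} (σ : Subst Γ Δ) (c : Tm (ι ∷ Γ) ι) → subst σ (prefixTest c) ≡ prefixTest (subst (extS σ) c)
prefixTest-subst σ c = cong lam (trans (search-subst (extS σ) (suffixTest (subst skip₁ c) (var here)) (len (var here)))
  (cong (λ q → search q (len (var here))) (trans (suffixTest-subst (extS σ) (subst skip₁ c) (var here))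
     (cong (λ q → suffixTest q (var here)) (trans (subst-subst (extS (extS σ)) skip₁ c)
        (trans (subst-cong commute c) (sym (subst-subst skip₁ (extS σ) c))))))))
  where
  commute : extS (extS σ) ∘ˢ skip₁ ≗ˢ skip₁ ∘ˢ extS σ
  commute here      = refl
  commute (there x) = trans (rename-rename there there (σ x))
                      (trans (rename-as-subst _ (σ x)) (sym (subst-rename skip₁ there (σ x))))

boundedSearch-subst : ∀ {Γ Δ} (σ : Subst Γ Δ) (T : Tm Γ ι) (c : Tm (ι ∷ Γ) ι) →
                      subst σ (boundedSearch T c) ≡ boundedSearch (subst σ T) (subst (extS σ) c)
boundedSearch-subst σ T c = trans (search-subst σ (prefixTest c) T) (cong (λ q → search q (subst σ T)) (prefixTest-subst σ c))

suffixTest-β : ∀ {Γ} (c : Tm (ι ∷ Γ) ι) (v k : Tm Γ ι) → suffixTest c v · k ≈ c [ Trunc v (len k) ]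
suffixTest-β c v k = ≈trans (≈β _ k) (≡⇒≈ (trans (subst-subst (σ₀ k) (truncSubst v) c) (subst-cong at-k c)))
  where
  at-k : σ₀ k ∘ˢ truncSubst v ≗ˢ σ₀ (Trunc v (len k))
  at-k here      = cong (λ q → Trunc q (len k)) ([]-rename v k)
  at-k (there x) = refl

prefixTest-β : ∀ {Γ} (c : Tm (ι ∷ Γ) ι) (v : Tm Γ ι) → prefixTest c · v ≈ search (suffixTest c v) (len v)
prefixTest-β c v = ≈trans (≈β _ v) (≡⇒≈
  (trans (search-subst (σ₀ v) (suffixTest (subst skip₁ c) (var here)) (len (var here)))
  (cong (λ q → search q (len v)) (trans (suffixTest-subst (σ₀ v) (subst skip₁ c) (var here))
  (cong (λ q → suffixTest q v) (trans (subst-subst (extS (σ₀ v)) skip₁ c)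
                                      (subst-id (λ { here → refl ; (there x) → refl }) c)))))))

boundedSearch-complete : (T : FTm n) (c : Tm (ι ∷ fctx n) ι) (w x : FTm n) →
                         E ∣ Γ ⊢ Sub (w ∘ x) T ≐ `1 → E ∣ Γ ⊢ c [ x ] ≐ `1 → E ∣ Γ ⊢ boundedSearch T c ≐ `1
boundedSearch-complete T c w x prefix cx = search-complete prefix
  (prefixTest c · (w ∘ x)                     ≈⟨ prefixTest-β c (w ∘ x) ⟩
   search (suffixTest c (w ∘ x)) (len (w ∘ x)) ≐⟨ search-complete {j = len x} unary-suffix found ⟩
   `1 ∎)
  where
  unary-suffix = ≐-trans (≐-cong (Subᴴ ⌜ len x ⌝ ●) (≐-trans (len-∘ w x) (len-∘-comm w x))) (Sub-∘ (len x) (len w))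
  found =
    suffixTest c (w ∘ x) · len x        ≈⟨ suffixTest-β c (w ∘ x) (len x) ⟩
    c [ Trunc (w ∘ x) (len (len x)) ]
      ≐⟨ ≐-cong-[] c (≐-trans (≐-cong (Truncᴴ ⌜ w ∘ x ⌝ ●) (len-len x)) (Trunc-suffix w x)) ⟩
    c [ x ]                             ≐⟨ cx ⟩
    `1 ∎

PrefixPair : FTm n → Fm (suc (suc n))
PrefixPair T = (var here ⊑ subst wk²ˢ T) ∧ᶠ (var here ∘ var (there here) ⊑ subst wk²ˢ T)

SubwordBody : FTm n → Fm (suc n) → Fm (suc (suc n))
SubwordBody T B = (var here ⊑ subst wk²ˢ T) ∧ᶠ ((var here ∘ var (there here) ⊑ subst wk²ˢ T) ∧ᶠ wkF B)

∃⊆* : FTm n → Fm (suc n) → Fm n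
∃⊆* T B = ∃ᶠ (∃ᶠ (SubwordBody T B))

∀⊆* : FTm n → Fm (suc n) → Fm n
∀⊆* T B = ∀ᶠ (∃ᶠ (PrefixPair T) ⊃ B)

wk²ˢ-subst : ∀ {m l} (σ : Subst (fctx m) (fctx l)) (T : FTm m) →
             subst (extS {B = ι} (extS {B = ι} σ)) (subst wk²ˢ T) ≡ subst wk²ˢ (subst σ T)
wk²ˢ-subst σ T = trans (subst-subst _ wk²ˢ T) (trans (subst-cong shift T) (sym (subst-subst wk²ˢ σ T)))
  where
  shift : extS (extS σ) ∘ˢ wk²ˢ ≗ˢ wk²ˢ ∘ˢ σ
  shift x = trans (rename-rename there there (σ x)) (rename-as-subst _ (σ x))

wk²ˢ-[] : ∀ {m} (T : FTm m) (x w : FTm m) → subst (extS (σ₀ x)) (subst wk²ˢ T) [ w ] ≡ T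
wk²ˢ-[] T x w = trans (cong (_[ w ]) (subst-subst _ wk²ˢ T)) (trans (subst-subst _ _ T) (subst-id (λ _ → refl) T))

PrefixPair-subst : ∀ {m l} (σ : Subst (fctx m) (fctx l)) (T : FTm m) →
                   substF (extS {B = ι} (extS {B = ι} σ)) (PrefixPair T) ≡ PrefixPair (subst σ T)
PrefixPair-subst σ T = cong (λ t → (var here ⊑ t) ∧ᶠ (var here ∘ var (there here) ⊑ t)) (wk²ˢ-subst σ T)

∃⊆*-subst : ∀ {m l} (σ : Subst (fctx m) (fctx l)) (T : FTm m) (B : Fm (suc m)) →
            substF σ (∃⊆* T B) ≡ ∃⊆* (subst σ T) (substF (extS σ) B)
∃⊆*-subst σ T B = cong₂ (λ t C → ∃ᶠ (∃ᶠ ((var here ⊑ t) ∧ᶠ ((var here ∘ var (there here) ⊑ t) ∧ᶠ C))))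
  (wk²ˢ-subst σ T)
  (trans (substF-substF _ ↑ˢ B) (trans (substF-cong commute B) (sym (substF-substF ↑ˢ (extS σ) B))))
  where
  commute : extS (extS σ) ∘ˢ ↑ˢ ≗ˢ ↑ˢ ∘ˢ extS σ
  commute here      = refl
  commute (there x) = trans (rename-rename there there (σ x))
                      (trans (rename-as-subst _ (σ x)) (sym (subst-rename ↑ˢ there (σ x))))

∀⊆*-subst : ∀ {m l} (σ : Subst (fctx m) (fctx l)) (T : FTm m) (B : Fm (suc m)) →
            substF σ (∀⊆* T B) ≡ ∀⊆* (subst σ T) (substF (extS σ) B)
∀⊆*-subst σ T B = cong (λ P → ∀ᶠ (∃ᶠ P ⊃ substF (extS σ) B)) (PrefixPair-subst σ T)

∃⊆*-intro : ∀ {T : FTm n} {B : Fm (suc n)} (x w : FTm n) →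
            E ∣ Γ ⊢ w ⊑ T → E ∣ Γ ⊢ w ∘ x ⊑ T → E ∣ Γ ⊢ instF B x → E ∣ Γ ⊢ ∃⊆* T B
∃⊆*-intro {T = T} {B} x w dw dwx dB =
  ∃I x (∃I w (cast (sym (cong₃ (λ t y C → (w ⊑ t) ∧ᶠ ((w ∘ y ⊑ t) ∧ᶠ C)) (wk²ˢ-[] T x w) ([]-rename x w) wkF-[]))
                   (∧I dw (∧I dwx dB))))
  where
  wkF-[] : substF (σ₀ w) (substF (extS (σ₀ x)) (wkF B)) ≡ instF B x
  wkF-[] = trans (cong (substF (σ₀ w)) (substF-substF _ ↑ˢ B))
             (trans (substF-substF _ _ B) (substF-cong (λ { here → []-rename x w ; (there y) → refl }) B))

∃⊆*-elim : ∀ {T : FTm n} {B : Fm (suc n)} {C : Fm n} → E ∣ Γ ⊢ ∃⊆* T B →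
           E ∣ SubwordBody T B ∷ map wkF (∃ᶠ (SubwordBody T B) ∷ map wkF Γ) ⊢ wkF (wkF C) → E ∣ Γ ⊢ C
∃⊆*-elim d k = ∃E d (∃E hyp₀ k)

∀⊆*-intro : ∀ {T : FTm n} {B : Fm (suc n)} → E ∣ ∃ᶠ (PrefixPair T) ∷ map wkF Γ ⊢ B → E ∣ Γ ⊢ ∀⊆* T B
∀⊆*-intro d = ∀I (⊃I d)

∀⊆*-elim : ∀ {T : FTm n} {B : Fm (suc n)} (x w : FTm n) →
           E ∣ Γ ⊢ ∀⊆* T B → E ∣ Γ ⊢ w ⊑ T → E ∣ Γ ⊢ w ∘ x ⊑ T → E ∣ Γ ⊢ instF B x
∀⊆*-elim {T = T} x w d dw dwx =
  ⊃E (∀E d x) (∃I w (cast (sym (cong₂ (λ t y → (w ⊑ t) ∧ᶠ (w ∘ y ⊑ t)) (wk²ˢ-[] T x w) ([]-rename x w)))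
                          (∧I dw dwx)))

boundedSearch-sound : ∀ {T : FTm n} {c : Tm (ι ∷ fctx n) ι} →
                      E ∣ Γ ⊢ boundedSearch T c ≐ `1 → E ∣ Γ ⊢ ∃⊆* T (c ≐ `1)
boundedSearch-sound {E = E} {Γ = Γ} {T} {c} d =
  ∃E (search-sound d) (cast (sym (∃⊆*-subst _ T (c ≐ `1)))
    (∃E (search-sound inner-found) (cast (sym (∃⊆*-subst _ (wk T) (c₁ ≐ `1)))
      (∃⊆*-intro {B = c₂ ≐ `1} x w (Sub⇒⊑ (Sub-shorten wx-prefix)) (Sub⇒⊑ wx-prefix) suffix-found))))
  where
  c₁ : Tm (ι ∷ fctx (suc _)) ι
  c₁ = subst (extS ↑ˢ) c
  c₂ : Tm (ι ∷ fctx (suc (suc _))) ι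
  c₂ = subst (extS ↑ˢ) c₁
  v : FTm (suc _)
  v = var here
  inner-found : E ∣ FoundBody (prefixTest c) T ∷ map wkF Γ ⊢ search (suffixTest c₁ v) (len v) ≐ `1
  inner-found = ≐-trans (conv (≈sym (prefixTest-β c₁ v)))
                        (cast (cong (λ g → g · v ≐ `1) (prefixTest-subst _ c)) (∧E₂ hyp₀))
  k v′ x w : FTm (suc (suc _))
  k  = var here
  v′ = var (there here)
  x  = Trunc v′ (len k)
  w  = dropEnd v′ k
  Θ = FoundBody (suffixTest c₁ v) (len v) ∷ map wkF (FoundBody (prefixTest c) T ∷ map wkF Γ)
  wx-prefix : E ∣ Θ ⊢ Sub (w ∘ x) (wk (wk T)) ≐ `1
  wx-prefix = ≐-trans (≐-cong (Subᴴ ● ⌜ wk (wk T) ⌝) (≐-sym v′-split)) (∧E₁ hyp₁)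
    where
    v′-split = ≐-trans (dropEnd-∘-takeEnd v′ k) (≐-cong (⌜ w ⌝ ∘ᴴ ●) (≐-sym (Trunc-len≐takeEnd v′ k)))
  suffix-found : E ∣ Θ ⊢ c₂ [ x ] ≐ `1
  suffix-found = ≐-trans (conv (≈sym (suffixTest-β c₂ v′ k)))
                         (cast (cong (λ g → g · k ≐ `1) (suffixTest-subst _ c₁ v)) (∧E₂ hyp₀))

wkF-as-instF : (B : Fm (suc n)) → wkF B ≡ instF (substF (extS wk²ˢ) B) (var (there here))
wkF-as-instF B = sym (trans (substF-substF _ _ B) (substF-cong (λ { here → refl ; (there x) → refl }) B))

wkF-wkF-∃⊆* : (T : FTm n) (B : Fm (suc n)) → wkF (wkF (∃⊆* T B)) ≡ ∃⊆* (subst wk²ˢ T) (substF (extS wk²ˢ) B)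
wkF-wkF-∃⊆* T B = trans (wkF-wkF (∃⊆* T B)) (∃⊆*-subst wk²ˢ T B)

wkF-wkF-∀⊆* : (T : FTm n) (B : Fm (suc n)) → wkF (wkF (∀⊆* T B)) ≡ ∀⊆* (subst wk²ˢ T) (substF (extS wk²ˢ) B)
wkF-wkF-∀⊆* T B = trans (wkF-wkF (∀⊆* T B)) (∀⊆*-subst wk²ˢ T B)

∃⊆*-mono : ∀ {T : FTm n} {B B′ : Fm (suc n)} →
           (∀ {Δ : List (Fm (suc (suc n)))} → E ∣ Δ ⊢ wkF B → E ∣ Δ ⊢ wkF B′) →
           E ∣ Γ ⊢ ∃⊆* T B → E ∣ Γ ⊢ ∃⊆* T B′
∃⊆*-mono {T = T} {B} {B′} f d = ∃⊆*-elim {T = T} {B} d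
  (cast (sym (wkF-wkF-∃⊆* T B′))
    (∃⊆*-intro (var (there here)) (var here) (∧E₁ hyp₀) (∧E₁ (∧E₂ hyp₀))
               (cast (wkF-as-instF B′) (f (∧E₂ (∧E₂ hyp₀))))))

∃⊆*¬-∀⊆*-absurd : ∀ {T : FTm n} {B : Fm (suc n)} →
                  E ∣ Γ ⊢ ∃⊆* T (¬ᶠ B) → E ∣ Γ ⊢ ∀⊆* T B → E ∣ Γ ⊢ ⊥ᶠ
∃⊆*¬-∀⊆*-absurd {T = T} {B} d e = ⊃E (∃⊆*-elim {T = T} {B = ¬ᶠ B} d (cast (sym (cong (_⊃ ⊥ᶠ) (wkF-wkF-∀⊆* T B)))
  (⊃I (⊃E (∧E₂ (∧E₂ hyp₁)) (cast (sym (wkF-as-instF B))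
         (∀⊆*-elim (var (there here)) (var here) hyp₀ (∧E₁ hyp₁) (∧E₁ (∧E₂ hyp₁)))))))) e

∀⊆*-by-decision : ∀ {T : FTm n} {B : Fm (suc n)} → (∀ {Δ : List (Fm (suc n))} → E ∣ Δ ⊢ B ∨ᶠ ¬ᶠ B) →
                  E ∣ Γ ⊢ ¬ᶠ (∃⊆* T (¬ᶠ B)) → E ∣ Γ ⊢ ∀⊆* T B
∀⊆*-by-decision {T = T} {B} dec nope = ⊃E (⊃I (∀⊆*-intro {T = T} (∨E dec hyp₀ (ex-falso (∃E hyp₁
  (⊃E (cast (cong ¬ᶠ (wkF-wkF-∃⊆* T (¬ᶠ B))) hyp₃)
      (∃⊆*-intro {B = substF (extS wk²ˢ) (¬ᶠ B)} (var (there here)) (var here) (∧E₁ hyp₀) (∧E₂ hyp₀)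
                                               (cast (wkF-as-instF (¬ᶠ B)) hyp₁)))))))) nope

finRen : ∀ {n m} → (Fin n → Fin m) → Ren (fctx n) (fctx m)
finRen {suc n} ρ here      = finVar (ρ zero)
finRen {suc n} ρ (there x) = finRen (λ i → ρ (suc i)) x

finRen-finVar : ∀ {n m} (ρ : Fin n → Fin m) (i : Fin n) → finRen ρ (finVar i) ≡ finVar (ρ i)
finRen-finVar ρ zero    = refl
finRen-finVar ρ (suc i) = finRen-finVar (λ j → ρ (suc j)) i

finRen-suc : ∀ {n m A} (ρ : Fin n → Fin m) (x : fctx n ∋ A) → finRen (λ i → suc (ρ i)) x ≡ there (finRen ρ x)
finRen-suc {suc n} ρ here      = refl
finRen-suc {suc n} ρ (there x) = finRen-suc (λ i → ρ (suc i)) x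

finRen-id : ∀ {n A} (x : fctx n ∋ A) → finRen (λ i → i) x ≡ x
finRen-id {suc n} here      = refl
finRen-id {suc n} (there x) = trans (finRen-suc (λ i → i) x) (cong there (finRen-id x))

finRen-suc-suc : ∀ {n A} (x : fctx n ∋ A) → finRen (λ i → suc (suc i)) x ≡ there (there x)
finRen-suc-suc x = trans (finRen-suc suc x) (cong there (trans (finRen-suc (λ i → i) x) (cong there (finRen-id x))))

trT-renRT : ∀ {n m} (ρ : Fin n → Fin m) (t : RTm n) → trT (renRT ρ t) ≡ subst (λ x → var (finRen ρ x)) (trT t)
trT-renRT ρ (rv i)   = cong var (sym (finRen-finVar ρ i))
trT-renRT ρ rε       = refl
trT-renRT ρ r0       = refl
trT-renRT ρ r1       = refl
trT-renRT ρ (t ⌢ u)  = cong₂ _∘_ (trT-renRT ρ t) (trT-renRT ρ u)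
trT-renRT ρ (t ×ʳ u) = cong₂ Times (trT-renRT ρ t) (trT-renRT ρ u)

finRen-liftR : ∀ {n m} (ρ : Fin n → Fin m) → (λ {A} x → var (finRen (liftR ρ) {A} x)) ≗ˢ extS (λ x → var (finRen ρ x))
finRen-liftR ρ here      = refl
finRen-liftR ρ (there x) = cong var (finRen-suc ρ x)

trF-renRF : ∀ {n m} (ρ : Fin n → Fin m) (F : RFm n) → trF (renRF ρ F) ≡ substF (λ x → var (finRen ρ x)) (trF F)
trF-renRF ρ (rFlip t) = cong Flip (trT-renRT ρ t)
trF-renRF ρ (t =ʳ u)  = cong₂ _≐_ (trT-renRT ρ t) (trT-renRT ρ u)
trF-renRF ρ (t ⊆ʳ u)  = cong₂ _⊑_ (trT-renRT ρ t) (trT-renRT ρ u)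
trF-renRF ρ (¬ʳ A)    = cong ¬ᶠ (trF-renRF ρ A)
trF-renRF ρ (A ∧ʳ C)  = cong₂ _∧ᶠ_ (trF-renRF ρ A) (trF-renRF ρ C)
trF-renRF ρ (A ∨ʳ C)  = cong₂ _∨ᶠ_ (trF-renRF ρ A) (trF-renRF ρ C)
trF-renRF ρ (A →ʳ C)  = cong₂ _⊃_ (trF-renRF ρ A) (trF-renRF ρ C)
trF-renRF ρ (∃ʳ A)    = cong ∃ᶠ (trans (trF-renRF (liftR ρ) A) (substF-cong (finRen-liftR ρ) (trF A)))
trF-renRF ρ (∀ʳ A)    = cong ∀ᶠ (trans (trF-renRF (liftR ρ) A) (substF-cong (finRen-liftR ρ) (trF A)))

trT-wk² : ∀ {n} (t : RTm n) → trT (renRT (λ i → suc (suc i)) t) ≡ subst wk²ˢ (trT t)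
trT-wk² t = trans (trT-renRT _ t) (subst-cong (λ x → cong var (finRen-suc-suc x)) (trT t))

trF-bExists : ∀ {n} (t : RTm n) (P : RFm (suc n)) → trF (bExists t P) ≡ ∃⊆* (trT t) (trF P)
trF-bExists t P = cong₂ (λ u B → ∃ᶠ (∃ᶠ ((var here ⊑ u) ∧ᶠ ((var here ∘ var (there here) ⊑ u) ∧ᶠ B))))
  (trT-wk² t)
  (trans (trF-renRF skipW P) (substF-cong (λ { here → refl ; (there x) → cong var (finRen-suc-suc x) }) (trF P)))

trF-bForall : ∀ {n} (t : RTm n) (P : RFm (suc n)) → trF (bForall t P) ≡ ∀⊆* (trT t) (trF P)
trF-bForall t P = cong (λ u → ∀ᶠ (∃ᶠ ((var here ⊑ u) ∧ᶠ (var here ∘ var (there here) ⊑ u)) ⊃ trF P)) (trT-wk² t)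

-- Characteristic terms

-- All instances τ are required: a bounded quantifier uses the characteristic term of its body at
-- instances of the bound variable.
record Characteristic {n : ℕ} (A : Fm n) : Set₁ where
  field
    χ          : FTm n
    χ-isBit    : ∀ {E : Ext} {m} {Γ : List (Fm m)} (τ : Subst (fctx n) (fctx m)) → E ∣ Γ ⊢ IsBit (subst τ χ)
    χ-sound    : ∀ {E : Ext} {m} {Γ : List (Fm m)} (τ : Subst (fctx n) (fctx m)) →
                 E ∣ Γ ⊢ subst τ χ ≐ `1 → E ∣ Γ ⊢ substF τ A
    χ-complete : ∀ {E : Ext} {m} {Γ : List (Fm m)} (τ : Subst (fctx n) (fctx m)) →
                 E ∣ Γ ⊢ substF τ A → E ∣ Γ ⊢ subst τ χ ≐ `1
open Characteristic

¬ᵗ_ : ∀ {Γ} → Tm Γ ι → Tm Γ ι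
¬ᵗ p = Cond p `0 `1 `0

infixr 7 _∨ᵗ_ _⇒ᵗ_
_∨ᵗ_ _⇒ᵗ_ : ∀ {Γ} → Tm Γ ι → Tm Γ ι → Tm Γ ι
p ∨ᵗ q = Cond p `0 q `1
p ⇒ᵗ q = Cond p `0 `1 q

¬ᵗ-isBit : ∀ {p : FTm n} → E ∣ Γ ⊢ IsBit p → E ∣ Γ ⊢ IsBit (¬ᵗ p)
¬ᵗ-isBit bp = ∨E bp (∨I₂ (Cond-0-≐ hyp₀)) (∨I₁ (Cond-1-≐ hyp₀))

χ-Flip : (t : FTm n) → Characteristic (Flip t)
χ-Flip t = record
  { χ          = isOne (Flipcoin t)
  ; χ-isBit    = λ τ → isOne-isBit _
  ; χ-sound    = λ τ d → ⊃E (∧E₂ (ax (axFlip _))) (isOne-sound d)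
  ; χ-complete = λ τ d → isOne-complete (⊃E (∧E₁ (ax (axFlip _))) d)
  }

χ-≐ : (t u : FTm n) → Characteristic (t ≐ u)
χ-≐ t u = record
  { χ          = endsIn1 (Eq t u)
  ; χ-isBit    = λ τ → endsIn1-isBit _
  ; χ-sound    = λ τ → Eq-sound
  ; χ-complete = λ τ → Eq-complete
  }

χ-⊑ : (t u : FTm n) → Characteristic (t ⊑ u)
χ-⊑ t u = record
  { χ          = isOne (Sub t u)
  ; χ-isBit    = λ τ → isOne-isBit _
  ; χ-sound    = λ τ d → Sub⇒⊑ (isOne-sound d)
  ; χ-complete = λ τ d → isOne-complete (⊑⇒Sub d)
  }

χ-¬ : ∀ {A : Fm n} → Characteristic A → Characteristic (¬ᶠ A)
χ-¬ cA = record
  { χ          = ¬ᵗ χ cA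
  ; χ-isBit    = λ τ → ¬ᵗ-isBit (χ-isBit cA τ)
  ; χ-sound    = λ τ d → ⊃I (≐-trans (≐-sym (Cond-1-≐ (χ-complete cA τ hyp₀))) (weaken d))
  ; χ-complete = λ τ d → ∨E (χ-isBit cA τ) (Cond-0-≐ hyp₀) (ex-falso (⊃E (weaken d) (χ-sound cA τ hyp₀)))
  }

χ-∧ : ∀ {A C : Fm n} → Characteristic A → Characteristic C → Characteristic (A ∧ᶠ C)
χ-∧ cA cC = record
  { χ          = χ cA ∧ᵗ χ cC
  ; χ-isBit    = λ τ → ∨E (χ-isBit cA τ) (∨I₁ (Cond-0-≐ hyp₀)) (IsBit-resp (Cond-1-≐ hyp₀) (χ-isBit cC τ))
  ; χ-sound    = λ τ d → let both = ∧ᵗ-elim (χ-isBit cA τ) d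
                         in ∧I (χ-sound cA τ (∧E₁ both)) (χ-sound cC τ (∧E₂ both))
  ; χ-complete = λ τ d → ∧ᵗ-intro (χ-complete cA τ (∧E₁ d)) (χ-complete cC τ (∧E₂ d))
  }

χ-∨ : ∀ {A C : Fm n} → Characteristic A → Characteristic C → Characteristic (A ∨ᶠ C)
χ-∨ cA cC = record
  { χ          = χ cA ∨ᵗ χ cC
  ; χ-isBit    = λ τ → ∨E (χ-isBit cA τ) (IsBit-resp (Cond-0-≐ hyp₀) (χ-isBit cC τ)) (∨I₂ (Cond-1-≐ hyp₀))
  ; χ-sound    = λ τ d → ∨E (χ-isBit cA τ) (∨I₂ (χ-sound cC τ (≐-trans (≐-sym (Cond-0-≐ hyp₀)) (weaken d))))
                                           (∨I₁ (χ-sound cA τ hyp₀))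
  ; χ-complete = λ τ d → ∨E d (Cond-1-≐ (χ-complete cA τ hyp₀))
                             (∨E (χ-isBit cA τ) (≐-trans (Cond-0-≐ hyp₀) (χ-complete cC τ hyp₁)) (Cond-1-≐ hyp₀))
  }

χ-⊃ : ∀ {A C : Fm n} → Characteristic A → Characteristic C → Characteristic (A ⊃ C)
χ-⊃ cA cC = record
  { χ          = χ cA ⇒ᵗ χ cC
  ; χ-isBit    = λ τ → ∨E (χ-isBit cA τ) (∨I₂ (Cond-0-≐ hyp₀)) (IsBit-resp (Cond-1-≐ hyp₀) (χ-isBit cC τ))
  ; χ-sound    = λ τ d → ⊃I (χ-sound cC τ (≐-trans (≐-sym (Cond-1-≐ (χ-complete cA τ hyp₀))) (weaken d)))
  ; χ-complete = λ τ d → ∨E (χ-isBit cA τ) (Cond-0-≐ hyp₀)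
                             (≐-trans (Cond-1-≐ hyp₀) (χ-complete cC τ (⊃E (weaken d) (χ-sound cA τ hyp₀))))
  }

↑ˢ-∘ˢ-extS : ∀ {n m} (τ : Subst (fctx n) (fctx m)) → ↑ˢ ∘ˢ extS τ ≗ˢ (wk²ˢ ∘ˢ τ ,, var (there here))
↑ˢ-∘ˢ-extS τ here      = refl
↑ˢ-∘ˢ-extS τ (there x) = subst-rename ↑ˢ there (τ x)

χ-∃⊆* : ∀ {B : Fm (suc n)} (T : FTm n) → Characteristic B → Characteristic (∃⊆* T B)
χ-∃⊆* {B = B} T cB = record
  { χ          = boundedSearch T (χ cB)
  ; χ-isBit    = λ τ → cast (cong IsBit (sym (boundedSearch-subst τ T (χ cB)))) (search-isBit _ _)
  ; χ-sound    = sound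
  ; χ-complete = complete
  }
  where
  sound : ∀ {E : Ext} {m} {Γ : List (Fm m)} (τ : Subst (fctx _) (fctx m)) →
          E ∣ Γ ⊢ subst τ (boundedSearch T (χ cB)) ≐ `1 → E ∣ Γ ⊢ substF τ (∃⊆* T B)
  sound {E = E} τ d = cast (sym (∃⊆*-subst τ T B))
    (∃⊆*-mono {T = T′} {B = c′ ≐ `1} {B′ = B′} body-sound (boundedSearch-sound {T = T′} {c = c′} found))
    where
    T′ = subst τ T
    c′ = subst (extS τ) (χ cB)
    B′ = substF (extS τ) B
    found = cast (cong (_≐ `1) (boundedSearch-subst τ T (χ cB))) d
    body-sound : ∀ {Δ} → E ∣ Δ ⊢ wkF (c′ ≐ `1) → E ∣ Δ ⊢ wkF B′
    body-sound e = cast (sym (substF-substF ↑ˢ (extS τ) B))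
                        (χ-sound cB (↑ˢ ∘ˢ extS τ) (cast (cong (_≐ `1) (subst-subst ↑ˢ (extS τ) (χ cB))) e))
  complete : ∀ {E : Ext} {m} {Γ : List (Fm m)} (τ : Subst (fctx _) (fctx m)) →
             E ∣ Γ ⊢ substF τ (∃⊆* T B) → E ∣ Γ ⊢ subst τ (boundedSearch T (χ cB)) ≐ `1
  complete τ d = ∃⊆*-elim {T = subst τ T} {B = substF (extS τ) B} (cast (∃⊆*-subst τ T B) d)
    (cast (cong (_≐ `1) (sym (trans (wk-wk (subst τ bs)) (trans (subst-subst wk²ˢ τ bs) (boundedSearch-subst τ₂ T (χ cB))))))
      (boundedSearch-complete (subst τ₂ T) (subst (extS τ₂) (χ cB)) w x wx-prefix x-satisfies))
    where
    bs = boundedSearch T (χ cB)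
    τ₂ = wk²ˢ ∘ˢ τ
    w x : FTm _
    w = var here
    x = var (there here)
    wx-prefix = ⊑⇒Sub (cast (cong (w ∘ x ⊑_) (subst-subst wk²ˢ τ T)) (∧E₁ (∧E₂ hyp₀)))
    x-satisfies = cast (cong (_≐ `1) (sym ([]-extS τ₂ (χ cB) x)))
      (χ-complete cB (τ₂ ,, x)
        (cast (trans (substF-substF ↑ˢ (extS τ) B) (substF-cong (↑ˢ-∘ˢ-extS τ) B)) (∧E₂ (∧E₂ hyp₀))))

decide : ∀ {A : Fm n} → Characteristic A → ∀ {m} {Γ : List (Fm m)} (τ : Subst (fctx n) (fctx m)) →
         E ∣ Γ ⊢ substF τ A ∨ᶠ ¬ᶠ (substF τ A)
decide cA τ =
  ∨E (χ-isBit cA τ) (∨I₂ (⊃I (≐-trans (≐-sym hyp₁) (χ-complete cA τ hyp₀)))) (∨I₁ (χ-sound cA τ hyp₀))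

-- (∀x ⊆* T) B is decided as ¬ (∃x ⊆* T) ¬B, which is equivalent to it because B is decidable.
χ-∀⊆* : ∀ {B : Fm (suc n)} (T : FTm n) → Characteristic B → Characteristic (∀⊆* T B)
χ-∀⊆* {B = B} T cB = record
  { χ          = χ none
  ; χ-isBit    = χ-isBit none
  ; χ-sound    = λ τ d → cast (sym (∀⊆*-subst τ T B))
                   (∀⊆*-by-decision {T = subst τ T} (decide cB (extS τ))
                                    (cast (cong ¬ᶠ (∃⊆*-subst τ T (¬ᶠ B))) (χ-sound none τ d)))
  ; χ-complete = λ τ d → χ-complete none τ
                   (⊃I (∃⊆*¬-∀⊆*-absurd {T = subst τ T} (cast (∃⊆*-subst τ T (¬ᶠ B)) hyp₀)
                                                          (weaken (cast (∀⊆*-subst τ T B) d))))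
  }
  where none = χ-¬ (χ-∃⊆* T (χ-¬ cB))

χ-sound-id : ∀ {A : Fm n} (cA : Characteristic A) → E ∣ Γ ⊢ χ cA ≐ `1 → E ∣ Γ ⊢ A
χ-sound-id {A = A} cA d =
  cast (substF-id (λ _ → refl) A) (χ-sound cA var (cast (cong (_≐ `1) (sym (subst-id (λ _ → refl) (χ cA)))) d))

χ-complete-id : ∀ {A : Fm n} (cA : Characteristic A) → E ∣ Γ ⊢ A → E ∣ Γ ⊢ χ cA ≐ `1
χ-complete-id {A = A} cA d =
  cast (cong (_≐ `1) (subst-id (λ _ → refl) (χ cA))) (χ-complete cA var (cast (sym (substF-id (λ _ → refl) A)) d))

characteristic : ∀ {n} {F : RFm n} → Σb₀ F → Characteristic (trF F)
characteristic (sFlip t)     = χ-Flip (trT t)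
characteristic (sEq t u)     = χ-≐ (trT t) (trT u)
characteristic (sSub t u)    = χ-⊑ (trT t) (trT u)
characteristic (sNeg s)      = χ-¬ (characteristic s)
characteristic (sAnd s s′)   = χ-∧ (characteristic s) (characteristic s′)
characteristic (sOr s s′)    = χ-∨ (characteristic s) (characteristic s′)
characteristic (sImp s s′)   = χ-⊃ (characteristic s) (characteristic s′)
characteristic (sBEx t {P} s)  = ≡.subst Characteristic (sym (trF-bExists t P)) (χ-∃⊆* (trT t) (characteristic s))
characteristic (sBAll t {P} s) = ≡.subst Characteristic (sym (trF-bForall t P)) (χ-∀⊆* (trT t) (characteristic s))

Σb₀-excluded-middle : ∀ {E : Ext} {n} {Γ : List (Fm n)} {F : RFm n} → Σb₀ F → E ∣ Γ ⊢ trF F ∨ᶠ ¬ᶠ (trF F)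
Σb₀-excluded-middle {F = F} s =
  cast (cong (λ A → A ∨ᶠ ¬ᶠ A) (substF-id (λ x → refl) (trF F))) (decide (characteristic s) var)

-- Closed terms evaluate to numerals

-- Strings are stored last digit first, so that num (b ∷ v) = num v ∘ bit b; Flipcoin therefore
-- consults η at the reversed list.
Str : Set
Str = List Bool

num : ∀ {Γ} → Str → Tm Γ ι
num []      = `ε
num (b ∷ v) = num v ∘ bit b

numeral-reverse : ∀ {Γ} (v : Str) → numeral {Γ} (reverse v) ≡ num v
numeral-reverse []      = refl
numeral-reverse (b ∷ v) = trans (cong numeral (unfold-reverse b v))
                          (trans (foldl-∷ʳ _ `ε b (reverse v)) (cong (_∘ bit b) (numeral-reverse v)))

tailˢ : Str → Str
tailˢ []      = []
tailˢ (b ∷ v) = v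

truncˢ : Str → Str → Str
truncˢ []      y       = []
truncˢ (b ∷ x) []      = []
truncˢ (b ∷ x) (c ∷ y) = b ∷ truncˢ x y

condˢ : Str → Str → Str → Str → Str
condˢ []          y z w = y
condˢ (false ∷ _) y z w = z
condˢ (true ∷ _)  y z w = w

eqˢ : Str → Str → Str
eqˢ []          []          = true ∷ []
eqˢ []          (_ ∷ _)     = false ∷ []
eqˢ (_ ∷ _)     []          = false ∷ []
eqˢ (false ∷ x) (false ∷ y) = eqˢ x y
eqˢ (true ∷ x)  (true ∷ y)  = eqˢ x y
eqˢ (false ∷ x) (true ∷ y)  = false ∷ []
eqˢ (true ∷ x)  (false ∷ y) = false ∷ []

timesˢ : Str → Str → Str
timesˢ x []      = []
timesˢ x (b ∷ y) = x ++ timesˢ x y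

Bˢ : Str → Str
Bˢ x = condˢ x [] (false ∷ []) (true ∷ [])

subˢ : Str → Str → Str
subˢ x []      = condˢ x (true ∷ []) (false ∷ []) (false ∷ [])
subˢ x (b ∷ y) = condˢ (Bˢ (subˢ x y)) (Bˢ (eqˢ x (b ∷ y))) (Bˢ (eqˢ x (b ∷ y))) (true ∷ [])

recˢ : Str → (Str → Str → Str) → (Str → Str → Str) → (Str → Str) → Str → Str
recˢ x h₀ h₁ k []      = x
recˢ x h₀ h₁ k (b ∷ y) = truncˢ (selB b h₀ h₁ y (recˢ x h₀ h₁ k y)) (k y)

num-∘ : ∀ {Γ} (v w : Str) → num {Γ} v ∘ num w ≈ num (w ++ v)
num-∘ v []      = catεr _
num-∘ v (b ∷ w) = ≈trans (catb _ _ b) (≈app (≈app ≈refl (num-∘ v w)) ≈refl)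

num-Tail : ∀ {Γ} (v : Str) → Tail (num {Γ} v) ≈ num (tailˢ v)
num-Tail []      = tailε
num-Tail (b ∷ v) = tailb _ b

num-Trunc : ∀ {Γ} (x y : Str) → Trunc (num {Γ} x) (num y) ≈ num (truncˢ x y)
num-Trunc []      y       = truncεl _
num-Trunc (b ∷ x) []      = truncεr _
num-Trunc (b ∷ x) (c ∷ y) = ≈trans (truncb _ _ b c) (≈app (≈app ≈refl (num-Trunc x y)) ≈refl)

num-Cond : ∀ {Γ} (x y z w : Str) → Cond (num {Γ} x) (num y) (num z) (num w) ≈ num (condˢ x y z w)
num-Cond []          y z w = condε _ _ _
num-Cond (false ∷ x) y z w = cond0 _ _ _ _
num-Cond (true ∷ x)  y z w = cond1 _ _ _ _

num-Conc : ∀ {Γ} (x y : Str) → Conc (num {Γ} x) (num y) ≈ num (y ++ x)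
num-Conc x []      = concε _
num-Conc x (b ∷ y) = ≈trans (concb _ _ b) (≈app (≈app ≈refl (num-Conc x y)) ≈refl)

num-Eq : ∀ {Γ} (x y : Str) → Eq (num {Γ} x) (num y) ≈ num (eqˢ x y)
num-Eq []          []          = ≈trans eqεε 1≈ε1
num-Eq []          (b ∷ y)     = ≈trans (eqεb _ b) 0≈ε0
num-Eq (b ∷ x)     []          = ≈trans (eqbε _ b) 0≈ε0
num-Eq (false ∷ x) (false ∷ y) = ≈trans (eqbb _ _ false) (num-Eq x y)
num-Eq (true ∷ x)  (true ∷ y)  = ≈trans (eqbb _ _ true) (num-Eq x y)
num-Eq (false ∷ x) (true ∷ y)  = ≈trans (eq01 _ _) 0≈ε0
num-Eq (true ∷ x)  (false ∷ y) = ≈trans (eq10 _ _) 0≈ε0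

num-Times : ∀ {Γ} (x y : Str) → Times (num {Γ} x) (num y) ≈ num (timesˢ x y)
num-Times x []      = timesε _
num-Times x (b ∷ y) = ≈trans (timesb _ _ b) (≈trans (≈app (≈app ≈refl (num-Times x y)) ≈refl) (num-Conc (timesˢ x y) x))

num-B : ∀ {Γ} (x : Str) → B (num {Γ} x) ≈ num (Bˢ x)
num-B x = ≈trans (Cond-≈ ≈refl ≈refl 0≈ε0 1≈ε1) (num-Cond x [] _ _)

num-Sub : ∀ {Γ} (x y : Str) → Sub (num {Γ} x) (num y) ≈ num (subˢ x y)
num-Sub x []      = ≈trans (subε _) (≈trans (Cond-≈ ≈refl 1≈ε1 0≈ε0 0≈ε0) (num-Cond x _ _ _))
num-Sub x (b ∷ y) = ≈trans (subb _ _ b)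
  (≈trans (Cond-≈ (≈trans (Cond-≈₁ (num-Sub x y)) (num-B (subˢ x y))) (≈trans (Cond-≈₁ (num-Eq x (b ∷ y))) (num-B _))
                   (≈trans (Cond-≈₁ (num-Eq x (b ∷ y))) (num-B _)) 1≈ε1)
          (num-Cond (Bˢ (subˢ x y)) _ _ _))

⟦_⟧ᵀ : Ty → Set
⟦ ι ⟧ᵀ     = Str
⟦ A ⇒ B ⟧ᵀ = ⟦ A ⟧ᵀ → ⟦ B ⟧ᵀ

Env : Ctx → Set
Env Γ = ∀ {A} → Γ ∋ A → ⟦ A ⟧ᵀ

_▸_ : ∀ {Γ A} → Env Γ → ⟦ A ⟧ᵀ → Env (A ∷ Γ)
(ρ ▸ v) here      = v
(ρ ▸ v) (there x) = ρ x

module Evaluation (η : Str → Bool) where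

  ⟦_⟧ᶜ : ∀ {A} → Const A → ⟦ A ⟧ᵀ
  ⟦ c0 ⟧ᶜ        = false ∷ []
  ⟦ c1 ⟧ᶜ        = true ∷ []
  ⟦ cε ⟧ᶜ        = []
  ⟦ cCat ⟧ᶜ      = λ v w → w ++ v
  ⟦ cTrunc ⟧ᶜ    = truncˢ
  ⟦ cTail ⟧ᶜ     = tailˢ
  ⟦ cFlipcoin ⟧ᶜ = λ r → η (reverse r) ∷ []
  ⟦ cCond ⟧ᶜ     = condˢ
  ⟦ cRec ⟧ᶜ      = recˢ
  ⟦ cConc ⟧ᶜ     = λ v w → w ++ v
  ⟦ cEq ⟧ᶜ       = eqˢ
  ⟦ cTimes ⟧ᶜ    = timesˢ
  ⟦ cSub ⟧ᶜ      = subˢ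

  ⟦_⟧ : ∀ {Γ A} → Tm Γ A → Env Γ → ⟦ A ⟧ᵀ
  ⟦ var x ⟧ ρ = ρ x
  ⟦ con c ⟧ ρ = ⟦ c ⟧ᶜ
  ⟦ lam t ⟧ ρ = λ v → ⟦ t ⟧ (ρ ▸ v)
  ⟦ t · u ⟧ ρ = ⟦ t ⟧ ρ (⟦ u ⟧ ρ)

  Computes : (A : Ty) → Tm [] A → ⟦ A ⟧ᵀ → Set
  Computes ι       t v = Tη η ∣ [] ⊢ t ≐ num v
  Computes (A ⇒ B) f g = ∀ t v → Computes A t v → Computes B (f · t) (g v)

  Computes-≈ : ∀ A {t t′ : Tm [] A} {v} → t ≈ t′ → Computes A t v → Computes A t′ v
  Computes-≈ ι       p d = ≐-trans (conv (≈sym p)) d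
  Computes-≈ (A ⇒ B) p d = λ u w r → Computes-≈ B (≈app p ≈refl) (d u w r)

  computes-unary : (c : Const (ι ⇒ ι)) (f : Str → Str) → (∀ v → con c · num v ≈ num (f v)) →
                   Computes (ι ⇒ ι) (con c) f
  computes-unary c f law t v r = ≐-trans (≐-cong (⌜ con c ⌝ $ ●) r) (conv (law v))

  computes-binary : (c : Const (ι ⇒ ι ⇒ ι)) (f : Str → Str → Str) → (∀ v w → con c · num v · num w ≈ num (f v w)) →
                    Computes (ι ⇒ ι ⇒ ι) (con c) f
  computes-binary c f law t v r u w s =
    ≐-trans (≐-cong (⌜ con c ⌝ $ ● $ ⌜ u ⌝) r) (≐-trans (≐-cong (⌜ con c ⌝ $ ⌜ num v ⌝ $ ●) s) (conv (law v w)))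

  computes-Cond : Computes (ι ⇒ ι ⇒ ι ⇒ ι ⇒ ι) (con cCond) condˢ
  computes-Cond x v r y v′ r′ z v″ r″ w v‴ r‴ =
    ≐-trans (≐-cong (Condᴴ ● ⌜ y ⌝ ⌜ z ⌝ ⌜ w ⌝) r)
    (≐-trans (≐-cong (Condᴴ ⌜ num v ⌝ ● ⌜ z ⌝ ⌜ w ⌝) r′)
    (≐-trans (≐-cong (Condᴴ ⌜ num v ⌝ ⌜ num v′ ⌝ ● ⌜ w ⌝) r″)
    (≐-trans (≐-cong (Condᴴ ⌜ num v ⌝ ⌜ num v′ ⌝ ⌜ num v″ ⌝ ●) r‴)
    (conv (num-Cond v v′ v″ v‴)))))

  computes-Rec : Computes (ι ⇒ (ι ⇒ ι ⇒ ι) ⇒ (ι ⇒ ι ⇒ ι) ⇒ (ι ⇒ ι) ⇒ ι ⇒ ι) (con cRec) recˢ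
  computes-Rec x v rx h₀ g₀ rh₀ h₁ g₁ rh₁ k gk rk y u ry =
    ≐-trans (≐-cong (⌜ con cRec · x · h₀ · h₁ · k ⌝ $ ●) ry) (at-num u)
    where
    at-num : ∀ u → Computes ι (Rec x h₀ h₁ k (num u)) (recˢ v g₀ g₁ gk u)
    at-num []      = ≐-trans (conv (recε x h₀ h₁ k)) rx
    at-num (b ∷ u) = ≐-trans (conv (recb x h₀ h₁ k (num u) b))
      (computes-binary cTrunc truncˢ num-Trunc _ _ (step b) (k · num u) (gk u) (rk (num u) u ≐-refl))
      where
      step : ∀ b → Computes ι (selB b h₀ h₁ · num u · Rec x h₀ h₁ k (num u)) (selB b g₀ g₁ u (recˢ v g₀ g₁ gk u))
      step false = rh₀ (num u) u ≐-refl _ _ (at-num u)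
      step true  = rh₁ (num u) u ≐-refl _ _ (at-num u)

  computes-Flipcoin : Computes (ι ⇒ ι) (con cFlipcoin) (λ r → η (reverse r) ∷ [])
  computes-Flipcoin t v r = ≐-trans (≐-cong (⌜ con cFlipcoin ⌝ $ ●) r)
    (cast (cong (λ q → Flipcoin q ≐ num (η (reverse v) ∷ [])) (numeral-reverse v)) (ext (reverse v , refl)))

  computes-const : ∀ {A} (c : Const A) → Computes A (con c) ⟦ c ⟧ᶜ
  computes-const c0        = conv 0≈ε0
  computes-const c1        = conv 1≈ε1
  computes-const cε        = ≐-refl
  computes-const cCat      = computes-binary cCat _ num-∘
  computes-const cTrunc    = computes-binary cTrunc truncˢ num-Trunc
  computes-const cTail     = computes-unary cTail tailˢ num-Tail
  computes-const cFlipcoin = computes-Flipcoin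
  computes-const cCond     = computes-Cond
  computes-const cRec      = computes-Rec
  computes-const cConc     = computes-binary cConc _ num-Conc
  computes-const cEq       = computes-binary cEq eqˢ num-Eq
  computes-const cTimes    = computes-binary cTimes timesˢ num-Times
  computes-const cSub      = computes-binary cSub subˢ num-Sub

  fundamental : ∀ {Γ A} (t : Tm Γ A) (σ : Subst Γ []) (ρ : Env Γ) →
                (∀ {B} (x : Γ ∋ B) → Computes B (σ x) (ρ x)) → Computes A (subst σ t) (⟦ t ⟧ ρ)
  fundamental (var x) σ ρ h = h x
  fundamental (con c) σ ρ h = computes-const c
  fundamental {A = A ⇒ B} (lam t) σ ρ h u v r =
    Computes-≈ B (≈sym (≈β _ u))
      (≡.subst (λ q → Computes B q (⟦ t ⟧ (ρ ▸ v))) (sym ([]-extS σ t u)) (fundamental t (σ ,, u) (ρ ▸ v) extended))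
    where
    extended : ∀ {C} (x : (A ∷ _) ∋ C) → Computes C ((σ ,, u) x) ((ρ ▸ v) x)
    extended here      = r
    extended (there x) = h x
  fundamental (t · u) σ ρ h = fundamental t σ ρ h (subst σ u) (⟦ u ⟧ ρ) (fundamental u σ ρ h)

  closed-≐-num : (t : FTm 0) → Tη η ∣ [] ⊢ t ≐ num (⟦ t ⟧ (λ ()))
  closed-≐-num t = ≡.subst (λ q → Computes ι q (⟦ t ⟧ (λ ()))) (subst-id (λ ()) t) (fundamental t var (λ ()) (λ ()))

num≐1-absurd : (v : Str) → v ≢ true ∷ [] → E ∣ Γ ⊢ num v ≐ `1 → E ∣ Γ ⊢ ⊥ᶠ
num≐1-absurd []               v≢1 d = ε≠1 d
num≐1-absurd (false ∷ v)      v≢1 d = ∘0≠∘1 (≐-trans d (conv 1≈ε1))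
num≐1-absurd (true ∷ [])      v≢1 d = ⊥-elim (v≢1 refl)
num≐1-absurd (true ∷ c ∷ v)   v≢1 d =
  ε≠∘bit c (≐-sym (≐-trans (conv (≈sym (tailb _ true))) (≐-trans (≐-cong (Tailᴴ ●) d) (conv Tail-1))))

Σb₀-decide-closed : ∀ {F : RFm 0} → Σb₀ F → (η : Str → Bool) →
                    Tη η ∣ [] ⊢ trF F ⊎ Tη η ∣ [] ⊢ ¬ᶠ (trF F)
Σb₀-decide-closed s η = by-value (⟦ χ c ⟧ (λ ())) (closed-≐-num (χ c))
  where
  open Evaluation η
  c = characteristic s
  by-value : ∀ v → Tη η ∣ [] ⊢ χ c ≐ num v → Tη η ∣ [] ⊢ _ ⊎ Tη η ∣ [] ⊢ ¬ᶠ _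
  by-value v value with ≡-dec _≟_ v (true ∷ [])
  ... | yes refl = inj₁ (χ-sound-id c (≐-trans value (conv (≈sym 1≈ε1))))
  ... | no v≢1   = inj₂ (⊃I (num≐1-absurd v v≢1 (≐-trans (≐-sym (weaken value)) (χ-complete-id c hyp₀))))

mainTheorem9 : ((n : ℕ) (F : RFm n) → Σb₀ F → Der noExt [] (trF F ∨ᶠ ¬ᶠ (trF F)))
               × ((F : RFm 0) → Σb₀ F → (η : List Bool → Bool) →
                  Der (Tη η) [] (trF F) ⊎ Der (Tη η) [] (¬ᶠ (trF F)))
mainTheorem9 = (λ n F → Σb₀-excluded-middle) , (λ F → Σb₀-decide-closed)
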